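{- Let $\heartsuit\in\{B,C,D,BC\}$, $1\le i\le n$, and write $\pi_n=\pi_n^\heartsuit$, $\widehat\pi_n=\widehat\pi_n^\heartsuit$. Let $f_1,g_1$ be Laurent polynomials and $f_2=f_1\pi_i$, $g_2=g_1\widehat\pi_i$. If $(f_1,g_1)^\heartsuit=0$ and $(f_2,g_1)^\heartsuit=1$, then $(f_1,g_2)^\heartsuit=1$ and $(f_2,g_2)^\heartsuit=0$. Moreover, any linear space $V$ of Laurent polynomials stable under $\pi_i$ and orthogonal to $g_1$ is orthogonal to $g_2$.
   Context: Operators written on the right. $s_i$ exchanges $x_i,x_{i+1}$; $s_n:x_n\mapsto x_n^{ -1}$; $\tau_n:x_{n-1}\mapsto x_n^{ -1},x_n\mapsto x_{n-1}^{ -1}$. $f\pi_i=\frac{x_if-x_{i+1}f^{s_i}}{x_i-x_{i+1}}$ ($i<n$); $f\pi_n^C=\frac{x_nf-x_n^{ -1}f^{s_n}}{x_n-x_n^{ -1}}$; $f\pi_n^B=\frac{x_nf-f^{s_n}}{x_n-1}$; $f\pi_n^{BC}=\frac{(x_n+\beta)f-(x_n^{ -1}+\beta)f^{s_n}}{x_n-x_n^{ -1}}$; $f\pi_n^D=\frac{f-x_{n-1}^{ -1}x_n^{ -1}f^{\tau_n}}{1-x_{n-1}^{ -1}x_n^{ -1}}$; $\widehat\pi=\pi-1$. With $\rho^B=[n-\tfrac12,\dots,\tfrac12]$, $\rho^C=\rho^{BC}=[n,\dots,1]$, $\rho^D=[n-1,\dots,0]$, $\Delta^B=\prod_i(x_i^{1/2}-x_i^{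 -1/2})\prod_{i<j}(x_i-x_j)(1-\frac1{x_ix_j})$, $\Delta^C=\prod_i(x_i-x_i^{ -1})\prod_{i<j}(x_i-x_j)(1-\frac1{x_ix_j})$, $\Delta^D=\prod_{i<j}(x_i-x_j)(1-\frac1{x_ix_j})$, $\Delta^{BC}=\Delta^C\prod_i(1+\beta x_i)^{ -1}$ (expanded in powers of $\beta x_i$), the scalar product is $(f,g)^\heartsuit=\mathrm{CT}(fg\,x^{\rho^\heartsuit}\Delta^\heartsuit)$, CT the constant term in $x_1,\dots,x_n$. -}

module Defs where

open import Level using (Level)
open import Algebra.Bundles using (CommutativeRing)
open import Data.Nat as ℕ using (ℕ; zero; suc; _∸_)
open import Data.Integer as ℤ using (ℤ; +_; -[1+_])
open import Data.Fin as Fin using (Fin; zero; suc; toℕ; inject₁)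
open import Data.Vec as Vec using (Vec; lookup; tabulate; replicate; _[_]≔_)
open import Data.Vec.Properties using (≡-dec)
open import Data.List as List using (List; []; _∷_; _++_; foldr; concatMap; allFin)
open import Data.Maybe as Maybe using (Maybe; just; nothing)
open import Data.Product using (_×_; _,_; proj₁; proj₂; map₂)
open import Data.Empty using (⊥)
open import Relation.Nullary using (yes; no)

data Type : Set where
  B C D BC : Type

-- Index helpers on variables x₀ … x_{n-1} (0-based; x_{k} here is x_{k+1} in the paper)
-- next index (i+1) if it exists
nextFin : ∀ {n} → Fin n → Maybe (Fin n)
nextFin {suc zero} zero = nothing
nextFin {suc (suc n)} zero = just (suc zero)
nextFin {suc (suc n)} (suc i) = Maybe.map suc (nextFin i)

prevFin : ∀ {n} → Fin n → Maybe (Fin n)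
prevFin zero = nothing
prevFin (suc i) = just (inject₁ i)

-- Laurent polynomials in x₀,…,x_{n-1} over a commutative ring R,
-- represented as finite formal sums of terms  c · x^e  (e ∈ ℤⁿ),
-- compared by equality of coefficient functions.
module Laurent {c ℓ} (R : CommutativeRing c ℓ) where
  open CommutativeRing R public

  Exp : ℕ → Set
  Exp n = Vec ℤ n

  LPoly : ℕ → Set c
  LPoly n = List (Carrier × Exp n)

  module _ {n : ℕ} where

    coeff : LPoly n → Exp n → Carrier
    coeff [] m = 0#
    coeff ((a , e) ∷ p) m with ≡-dec ℤ._≟_ e m
    ... | yes _ = a + coeff p m
    ... | no  _ = coeff p m

    infix 4 _≋_
    _≋_ : LPoly n → LPoly n → Set ℓ
    p ≋ q = ∀ m → coeff p m ≈ coeff q m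

    zeroE : Exp n
    zeroE = replicate n (+ 0)

    0L : LPoly n
    0L = []

    const : Carrier → LPoly n
    const a = (a , zeroE) ∷ []

    1L : LPoly n
    1L = const 1#

    infixl 6 _⊕_ _⊖_
    infixl 7 _⊛_ _·_

    _⊕_ : LPoly n → LPoly n → LPoly n
    p ⊕ q = p ++ q

    _·_ : Carrier → LPoly n → LPoly n
    a · p = List.map (λ t → a * proj₁ t , proj₂ t) p

    neg : LPoly n → LPoly n
    neg p = (- 1#) · p

    _⊖_ : LPoly n → LPoly n → LPoly n
    p ⊖ q = p ⊕ neg q

    _⊛_ : LPoly n → LPoly n → LPoly n
    p ⊛ q = concatMap (λ s → List.map (λ t → (proj₁ s * proj₁ t , Vec.zipWith ℤ._+_ (proj₂ s) (proj₂ t))) q) p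

    prodL : List (LPoly n) → LPoly n
    prodL = foldr _⊛_ 1L

    xpow : Fin n → ℤ → LPoly n
    xpow k z = (1# , zeroE [ k ]≔ z) ∷ []

    var : Fin n → LPoly n
    var k = xpow k (+ 1)

    ivar : Fin n → LPoly n
    ivar k = xpow k (ℤ.- (+ 1))

    act : (Exp n → Exp n) → LPoly n → LPoly n
    act σ = List.map (map₂ σ)

    swapE : Fin n → Fin n → Exp n → Exp n
    swapE i j e = (e [ i ]≔ lookup e j) [ j ]≔ lookup e i

    invE : Fin n → Exp n → Exp n
    invE i e = e [ i ]≔ ℤ.- lookup e i

    tauE : Fin n → Fin n → Exp n → Exp n
    tauE p i e = (e [ p ]≔ ℤ.- lookup e i) [ i ]≔ ℤ.- lookup e p

    -- IsPi t β i f h  :  h = f π_i^t , i.e. h · (denominator) = numerator,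
    -- exactly the quotient in the defining formula of π_i.
    IsPi : Type → Carrier → Fin n → LPoly n → LPoly n → Set ℓ
    IsPi t β i f h with nextFin i
    ... | just j = h ⊛ (var i ⊖ var j) ≋ (var i ⊛ f) ⊖ (var j ⊛ act (swapE i j) f)
    IsPi C β i f h | nothing =
      h ⊛ (var i ⊖ ivar i) ≋ (var i ⊛ f) ⊖ (ivar i ⊛ act (invE i) f)
    IsPi B β i f h | nothing =
      h ⊛ (var i ⊖ 1L) ≋ (var i ⊛ f) ⊖ act (invE i) f
    IsPi BC β i f h | nothing =
      h ⊛ (var i ⊖ ivar i) ≋ ((var i ⊕ const β) ⊛ f) ⊖ ((ivar i ⊕ const β) ⊛ act (invE i) f)
    IsPi D β i f h | nothing with prevFin i
    ... | just p = h ⊛ (1L ⊖ (ivar p ⊛ ivar i)) ≋ f ⊖ ((ivar p ⊛ ivar i) ⊛ act (tauE p i) f)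
    ... | nothing = Lift ℓ ⊥
      where open import Level using (Lift)

    -- h = g π̂_i = g π_i − g   ⇔   h + g = g π_i
    IsPiHat : Type → Carrier → Fin n → LPoly n → LPoly n → Set ℓ
    IsPiHat t β i g h = IsPi t β i g (h ⊕ g)

    pairs : List (Fin n × Fin n)
    pairs = concatMap (λ k → concatMap (λ l → pairsIf k l) (allFin n)) (allFin n)
      where
        pairsIf : Fin n → Fin n → List (Fin n × Fin n)
        pairsIf k l with toℕ k ℕ.<? toℕ l
        ... | yes _ = (k , l) ∷ []
        ... | no _ = []

    Δpairs : LPoly n
    Δpairs = prodL (List.map (λ kl → (var (proj₁ kl) ⊖ var (proj₂ kl)) ⊛ (1L ⊖ (ivar (proj₁ kl) ⊛ ivar (proj₂ kl)))) pairs)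

    xρ : Exp n → LPoly n
    xρ ρ = (1# , ρ) ∷ []

    ρC ρD : Exp n
    ρC = tabulate (λ k → + (n ∸ toℕ k))
    ρD = tabulate (λ k → + (n ∸ suc (toℕ k)))

    WC : LPoly n
    WC = xρ ρC ⊛ (prodL (List.map (λ k → var k ⊖ ivar k) (allFin n)) ⊛ Δpairs)

    WD : LPoly n
    WD = xρ ρD ⊛ Δpairs

    -- x^{ρ^B} Δ^B = x^{ρ^D} ∏_i (x_i − 1) Δ^D, since x_i^{1/2}(x_i^{1/2} − x_i^{-1/2}) = x_i − 1
    WB : LPoly n
    WB = xρ ρD ⊛ (prodL (List.map (λ k → var k ⊖ 1L) (allFin n)) ⊛ Δpairs)

    CT : LPoly n → Carrier
    CT p = coeff p zeroE

    pow : Carrier → ℕ → Carrier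
    pow a zero = 1#
    pow a (suc m) = a * pow a m

    -- CT( h · ∏_i (1 + β x_i)^{-1} ) with ∏_i (1+βx_i)^{-1} = ∏_i Σ_m (−β)^m x_i^m :
    -- the term c·x^e contributes c · ∏_i (−β)^{−e_i} if all e_i ≤ 0, else 0.
    βfactor : Carrier → ℤ → Carrier
    βfactor β (+ zero) = 1#
    βfactor β (+ suc _) = 0#
    βfactor β -[1+ m ] = pow (- β) (suc m)

    CTβ : Carrier → LPoly n → Carrier
    CTβ β p = List.foldr (λ t acc → proj₁ t * Vec.foldr (λ _ → Carrier) (λ z r → βfactor β z * r) 1# (proj₂ t) + acc) 0# p

    sp : Type → Carrier → LPoly n → LPoly n → Carrier
    sp B β f g = CT ((f ⊛ g) ⊛ WB)
    sp C β f g = CT ((f ⊛ g) ⊛ WC)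
    sp D β f g = CT ((f ⊛ g) ⊛ WD)
    sp BC β f g = CTβ β ((f ⊛ g) ⊛ WC)

    -- a linear subspace of Laurent polynomials (a set of polynomials, hence ≋-closed)
    record IsLinearSpace {v} (V : LPoly n → Set v) : Set (c Level.⊔ ℓ Level.⊔ v) where
      field
        respects : ∀ {p q} → p ≋ q → V p → V q
        has-0    : V 0L
        closed-⊕ : ∀ {p q} → V p → V q → V (p ⊕ q)
        closed-· : ∀ a {p} → V p → V (a · p)

-- Each π_i is a divided difference f π = (X f - Y f^σ) / Den, where σ (s_i, s_n or τ_n) acts on
-- exponents as a reflection, and the weight x^ρ Δ of (_,_)^♡ factors as Den W′ with Y W′ σ-invariant.
-- As the constant term is σ-invariant too, (f π, g) = (f, g π); for ♡ = BC the factor 1 + β x_n of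
-- Y = x_n^{-1} + β first cancels the n-th factor of ∏ (1 + β x_i)^{-1}. Moreover f π is σ-invariant,
-- so π is idempotent. Writing g₂ + g₁ = g₁ π, this gives (f, g₂) = (f π, g₁) - (f, g₁); hence
-- (f₁, g₂) = 1 - 0, (f₂, g₂) = (f₂, g₁) - (f₂, g₁) = 0, and (f, g₂) = 0 - 0 for f in V.

module Submission where

open import Defs
open import Level using (_⊔_; lower)
open import Algebra.Bundles using (CommutativeRing)
import Algebra.Properties.Ring as RingProperties
import Algebra.Properties.CommutativeSemigroup as CommutativeSemigroupProperties
import Relation.Binary.Reasoning.Setoid as SetoidReasoning
open import Relation.Binary.Structures using (IsEquivalence)
open import Data.Nat as ℕ using (ℕ; zero; suc; _∸_; s≤s; z≤n)
import Data.Nat.Properties as ℕP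
open import Data.Integer as ℤ using (ℤ; +_; -[1+_])
import Data.Integer.Properties as ℤP
open import Data.Integer.Tactic.RingSolver using (solve-∀)
open import Data.Fin as Fin using (Fin; zero; suc; toℕ)
import Data.Fin.Properties as FinP
open import Data.Vec as Vec using (Vec; lookup; _[_]≔_)
open import Data.Vec.Properties as VecP using (≡-dec)
open import Data.List as List using (List; []; _∷_; _++_)
import Data.List.Properties as ListP
open import Data.Maybe using (just; nothing)
open import Data.Product using (_×_; _,_; proj₁; proj₂; Σ-syntax)
open import Data.Empty using (⊥-elim)
open import Data.Sum using (_⊎_; inj₁; inj₂)
open import Relation.Nullary using (Dec; yes; no; ¬_; _×-dec_)
open import Relation.Binary.PropositionalEquality as ≡ using (_≡_; _≢_; refl)
open import Function using (_∘_)

-- swapSuc i is the transposition (i i+1); it is the identity when i is the last index.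
swapSuc : ∀ {m} → Fin m → Fin m → Fin m
swapSuc {suc zero}    zero    k             = k
swapSuc {suc (suc m)} zero    zero          = suc zero
swapSuc {suc (suc m)} zero    (suc zero)    = zero
swapSuc {suc (suc m)} zero    (suc (suc k)) = suc (suc k)
swapSuc {suc (suc m)} (suc i) zero          = zero
swapSuc {suc (suc m)} (suc i) (suc k)       = suc (swapSuc i k)

swapSuc-involutive : ∀ {m} (i k : Fin m) → swapSuc i (swapSuc i k) ≡ k
swapSuc-involutive {suc zero}    zero    k             = refl
swapSuc-involutive {suc (suc m)} zero    zero          = refl
swapSuc-involutive {suc (suc m)} zero    (suc zero)    = refl
swapSuc-involutive {suc (suc m)} zero    (suc (suc k)) = refl
swapSuc-involutive {suc (suc m)} (suc i) zero          = refl
swapSuc-involutive {suc (suc m)} (suc i) (suc k)       = ≡.cong suc (swapSuc-involutive i k)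

swapSuc-fixes : ∀ {m} (i k : Fin m) → k ≢ i → k ≢ swapSuc i i → swapSuc i k ≡ k
swapSuc-fixes {suc zero}    zero    k             _   _   = refl
swapSuc-fixes {suc (suc m)} zero    zero          k≢i _   = ⊥-elim (k≢i refl)
swapSuc-fixes {suc (suc m)} zero    (suc zero)    _   k≢j = ⊥-elim (k≢j refl)
swapSuc-fixes {suc (suc m)} zero    (suc (suc k)) _   _   = refl
swapSuc-fixes {suc (suc m)} (suc i) zero          _   _   = refl
swapSuc-fixes {suc (suc m)} (suc i) (suc k)       k≢i k≢j =
  ≡.cong suc (swapSuc-fixes i k (k≢i ∘ ≡.cong suc) (k≢j ∘ ≡.cong suc))

nextFin⇒swapSuc : ∀ {m} {i j : Fin m} → nextFin i ≡ just j → swapSuc i i ≡ j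
nextFin⇒swapSuc {suc zero}    {zero}  ()
nextFin⇒swapSuc {suc (suc m)} {zero}  refl = refl
nextFin⇒swapSuc {suc (suc m)} {suc i} eq with nextFin i in eq′
nextFin⇒swapSuc {suc (suc m)} {suc i} refl | just _ = ≡.cong suc (nextFin⇒swapSuc eq′)

nextFin⇒toℕ : ∀ {m} {i j : Fin m} → nextFin i ≡ just j → toℕ j ≡ suc (toℕ i)
nextFin⇒toℕ {suc zero}    {zero}  ()
nextFin⇒toℕ {suc (suc m)} {zero}  refl = refl
nextFin⇒toℕ {suc (suc m)} {suc i} eq with nextFin i in eq′
nextFin⇒toℕ {suc (suc m)} {suc i} refl | just _ = ≡.cong suc (nextFin⇒toℕ eq′)

toℕ⇒nextFin : ∀ {m} {i j : Fin m} → toℕ j ≡ suc (toℕ i) → nextFin i ≡ just j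
toℕ⇒nextFin {suc zero}    {zero}  {zero}         ()
toℕ⇒nextFin {suc (suc m)} {zero}  {suc zero}     refl = refl
toℕ⇒nextFin {suc (suc m)} {suc i} {suc j}        eq
  rewrite toℕ⇒nextFin {i = i} {j} (ℕP.suc-injective eq) = refl

nextFin-nothing⇒last : ∀ {m} {i : Fin m} → nextFin i ≡ nothing → suc (toℕ i) ≡ m
nextFin-nothing⇒last {suc zero}    {zero}  refl = refl
nextFin-nothing⇒last {suc (suc m)} {suc i} eq with nextFin i in eq′
nextFin-nothing⇒last {suc (suc m)} {suc i} refl | nothing = ≡.cong suc (nextFin-nothing⇒last eq′)

nextFin⇒≢ : ∀ {m} {i j : Fin m} → nextFin i ≡ just j → i ≢ j
nextFin⇒≢ i→j refl = ℕP.1+n≢n (≡.sym (nextFin⇒toℕ i→j))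

prevFin⇒toℕ : ∀ {m} {i p : Fin m} → prevFin i ≡ just p → toℕ i ≡ suc (toℕ p)
prevFin⇒toℕ {i = suc i} refl = ≡.cong suc (≡.sym (FinP.toℕ-inject₁ i))

swapSuc-mono-< : ∀ {m} (i k l : Fin m) → ¬ (k ≡ i × l ≡ swapSuc i i) → toℕ k ℕ.< toℕ l → toℕ (swapSuc i k) ℕ.< toℕ (swapSuc i l)
swapSuc-mono-< {suc (suc m)} zero    zero          (suc zero)    ¬ij _          = ⊥-elim (¬ij (refl , refl))
swapSuc-mono-< {suc (suc m)} zero    zero          (suc (suc l)) _   _          = s≤s (s≤s z≤n)
swapSuc-mono-< {suc (suc m)} zero    (suc zero)    (suc zero)    _   (s≤s ())
swapSuc-mono-< {suc (suc m)} zero    (suc zero)    (suc (suc l)) _   _          = s≤s z≤n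
swapSuc-mono-< {suc (suc m)} zero    (suc (suc k)) (suc zero)    _   (s≤s ())
swapSuc-mono-< {suc (suc m)} zero    (suc (suc k)) (suc (suc l)) _   k<l        = k<l
swapSuc-mono-< {suc (suc m)} (suc i) zero          (suc l)       _   _          = s≤s z≤n
swapSuc-mono-< {suc (suc m)} (suc i) (suc k)       (suc l)       ¬ij (s≤s k<l) =
  s≤s (swapSuc-mono-< i k l (λ (p , q) → ¬ij (≡.cong suc p , ≡.cong suc q)) k<l)

module _ {c ℓ} (R : CommutativeRing c ℓ) where

  open Laurent R renaming (refl to ≈-refl) hiding (zero)
  open RingProperties ring using (-1*x≈-x; x∙y⁻¹≈ε⇒x≈y; x≈y⇒x∙y⁻¹≈ε; -0#≈0#)
  open CommutativeSemigroupProperties +-commutativeSemigroup using (interchange)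
  module ≈-Reasoning = SetoidReasoning setoid

  module _ {n : ℕ} where

    infixl 6 _+ᵉ_
    infixr 7 _*ᵉ_

    _+ᵉ_ : Exp n → Exp n → Exp n
    _+ᵉ_ = Vec.zipWith ℤ._+_

    -ᵉ_ : Exp n → Exp n
    -ᵉ_ = Vec.map (ℤ.-_)

    _*ᵉ_ : ℤ → Exp n → Exp n
    z *ᵉ e = Vec.map (z ℤ.*_) e

    unit : Fin n → ℤ → Exp n
    unit k z = zeroE [ k ]≔ z

    Exp-ext : ∀ {a b : Exp n} → (∀ k → lookup a k ≡ lookup b k) → a ≡ b
    Exp-ext {a} {b} a≗b = ≡.trans (≡.sym (VecP.tabulate∘lookup a)) (≡.trans (VecP.tabulate-cong a≗b) (VecP.tabulate∘lookup b))

    lookup-+ᵉ : ∀ a b k → lookup (a +ᵉ b) k ≡ lookup a k ℤ.+ lookup b k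
    lookup-+ᵉ a b k = VecP.lookup-zipWith ℤ._+_ k a b

    lookup-*ᵉ : ∀ z e k → lookup (z *ᵉ e) k ≡ z ℤ.* lookup e k
    lookup-*ᵉ z e k = VecP.lookup-map k (z ℤ.*_) e

    lookup-zeroE : ∀ (k : Fin n) → lookup zeroE k ≡ + 0
    lookup-zeroE k = VecP.lookup-replicate k (+ 0)

    lookup-unit-≡ : ∀ k z → lookup (unit k z) k ≡ z
    lookup-unit-≡ k z = VecP.lookup∘update k zeroE z

    lookup-unit-≢ : ∀ {k m : Fin n} z → m ≢ k → lookup (unit k z) m ≡ + 0
    lookup-unit-≢ z m≢k = ≡.trans (VecP.lookup∘update′ m≢k zeroE z) (lookup-zeroE _)

    +ᵉ-assoc : ∀ a b d → (a +ᵉ b) +ᵉ d ≡ a +ᵉ (b +ᵉ d)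
    +ᵉ-assoc = VecP.zipWith-assoc ℤP.+-assoc

    +ᵉ-comm : ∀ a b → a +ᵉ b ≡ b +ᵉ a
    +ᵉ-comm = VecP.zipWith-comm ℤP.+-comm

    +ᵉ-identityˡ : ∀ a → zeroE +ᵉ a ≡ a
    +ᵉ-identityˡ = VecP.zipWith-identityˡ ℤP.+-identityˡ

    +ᵉ-identityʳ : ∀ a → a +ᵉ zeroE ≡ a
    +ᵉ-identityʳ = VecP.zipWith-identityʳ ℤP.+-identityʳ

    +ᵉ-inverseʳ : ∀ a → a +ᵉ -ᵉ a ≡ zeroE
    +ᵉ-inverseʳ = VecP.zipWith-inverseʳ ℤP.+-inverseʳ

    +ᵉ-inverseˡ : ∀ a → -ᵉ a +ᵉ a ≡ zeroE
    +ᵉ-inverseˡ = VecP.zipWith-inverseˡ ℤP.+-inverseˡ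

    unit-+ᵉ : ∀ k a b → unit k a +ᵉ unit k b ≡ unit k (a ℤ.+ b)
    unit-+ᵉ k a b = Exp-ext at
      where
      at : ∀ m → lookup (unit k a +ᵉ unit k b) m ≡ lookup (unit k (a ℤ.+ b)) m
      at m with m Fin.≟ k
      ... | yes refl = ≡.trans (lookup-+ᵉ (unit m a) (unit m b) m) (≡.trans (≡.cong₂ ℤ._+_ (lookup-unit-≡ m a) (lookup-unit-≡ m b)) (≡.sym (lookup-unit-≡ m _)))
      ... | no  m≢k  = ≡.trans (lookup-+ᵉ (unit k a) (unit k b) m) (≡.trans (≡.cong₂ ℤ._+_ (lookup-unit-≢ a m≢k) (lookup-unit-≢ b m≢k)) (≡.sym (lookup-unit-≢ _ m≢k)))

    unit-zero : ∀ k → unit k (+ 0) ≡ zeroE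
    unit-zero k = Exp-ext at
      where
      at : ∀ m → lookup (unit k (+ 0)) m ≡ lookup zeroE m
      at m with m Fin.≟ k
      ... | yes refl = ≡.trans (lookup-unit-≡ m (+ 0)) (≡.sym (lookup-zeroE m))
      ... | no  m≢k  = ≡.trans (lookup-unit-≢ (+ 0) m≢k) (≡.sym (lookup-zeroE m))

    lookup--ᵉ : ∀ e k → lookup (-ᵉ e) k ≡ ℤ.- lookup e k
    lookup--ᵉ e k = VecP.lookup-map k ℤ.-_ e

    *ᵉ-zeroˡ : ∀ d → + 0 *ᵉ d ≡ zeroE
    *ᵉ-zeroˡ d = Exp-ext λ k → ≡.trans (lookup-*ᵉ (+ 0) d k) (≡.sym (lookup-zeroE k))

    *ᵉ-identityˡ : ∀ d → + 1 *ᵉ d ≡ d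
    *ᵉ-identityˡ d = Exp-ext λ k → ≡.trans (lookup-*ᵉ (+ 1) d k) (ℤP.*-identityˡ (lookup d k))

    *ᵉ-suc : ∀ k d → d +ᵉ + k *ᵉ d ≡ + suc k *ᵉ d
    *ᵉ-suc k d = Exp-ext λ m → begin
      lookup (d +ᵉ + k *ᵉ d) m                  ≡⟨ ≡.trans (lookup-+ᵉ d (+ k *ᵉ d) m) (≡.cong (λ w → lookup d m ℤ.+ w) (lookup-*ᵉ (+ k) d m)) ⟩
      lookup d m ℤ.+ + k ℤ.* lookup d m         ≡⟨ ≡.cong (λ w → w ℤ.+ + k ℤ.* lookup d m) (ℤP.*-identityˡ (lookup d m)) ⟨
      + 1 ℤ.* lookup d m ℤ.+ + k ℤ.* lookup d m ≡⟨ ℤP.*-distribʳ-+ (lookup d m) (+ 1) (+ k) ⟨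
      + suc k ℤ.* lookup d m                    ≡⟨ lookup-*ᵉ (+ suc k) d m ⟨
      lookup (+ suc k *ᵉ d) m                   ∎
      where open ≡.≡-Reasoning

    *ᵉ-neg : ∀ k d → + suc k *ᵉ -ᵉ d ≡ -[1+ k ] *ᵉ d
    *ᵉ-neg k d = Exp-ext λ m → ≡.trans (lookup-*ᵉ (+ suc k) (-ᵉ d) m) (≡.trans (≡.cong (+ suc k ℤ.*_) (lookup--ᵉ d m))
                   (≡.trans (swap-neg (+ suc k) (lookup d m)) (≡.sym (lookup-*ᵉ -[1+ k ] d m))))
      where
      swap-neg : ∀ s x → s ℤ.* ℤ.- x ≡ ℤ.- s ℤ.* x
      swap-neg = solve-∀

    lookup-swapE-i : ∀ {i j : Fin n} e → i ≢ j → lookup (swapE i j e) i ≡ lookup e j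
    lookup-swapE-i {i} {j} e i≢j = ≡.trans (VecP.lookup∘update′ i≢j (e [ i ]≔ lookup e j) (lookup e i)) (VecP.lookup∘update i e (lookup e j))

    lookup-swapE-j : ∀ (i j : Fin n) e → lookup (swapE i j e) j ≡ lookup e i
    lookup-swapE-j i j e = VecP.lookup∘update j (e [ i ]≔ lookup e j) (lookup e i)

    lookup-swapE-≢ : ∀ {i j m : Fin n} e → m ≢ i → m ≢ j → lookup (swapE i j e) m ≡ lookup e m
    lookup-swapE-≢ {i} {j} e m≢i m≢j = ≡.trans (VecP.lookup∘update′ m≢j (e [ i ]≔ lookup e j) (lookup e i)) (VecP.lookup∘update′ m≢i e (lookup e j))

    lookup-invE-i : ∀ (i : Fin n) e → lookup (invE i e) i ≡ ℤ.- lookup e i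
    lookup-invE-i i e = VecP.lookup∘update i e (ℤ.- lookup e i)

    lookup-invE-≢ : ∀ {i m : Fin n} e → m ≢ i → lookup (invE i e) m ≡ lookup e m
    lookup-invE-≢ {i} e m≢i = VecP.lookup∘update′ m≢i e (ℤ.- lookup e i)

    lookup-tauE-p : ∀ {p i : Fin n} e → p ≢ i → lookup (tauE p i e) p ≡ ℤ.- lookup e i
    lookup-tauE-p {p} {i} e p≢i = ≡.trans (VecP.lookup∘update′ p≢i (e [ p ]≔ ℤ.- lookup e i) (ℤ.- lookup e p)) (VecP.lookup∘update p e (ℤ.- lookup e i))

    lookup-tauE-i : ∀ (p i : Fin n) e → lookup (tauE p i e) i ≡ ℤ.- lookup e p
    lookup-tauE-i p i e = VecP.lookup∘update i (e [ p ]≔ ℤ.- lookup e i) (ℤ.- lookup e p)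

    lookup-tauE-≢ : ∀ {p i m : Fin n} e → m ≢ p → m ≢ i → lookup (tauE p i e) m ≡ lookup e m
    lookup-tauE-≢ {p} {i} e m≢p m≢i = ≡.trans (VecP.lookup∘update′ m≢i (e [ p ]≔ ℤ.- lookup e i) (ℤ.- lookup e p)) (VecP.lookup∘update′ m≢p e (ℤ.- lookup e i))

    lookup-swapE-swapSuc : ∀ {i j : Fin n} → nextFin i ≡ just j → ∀ e m → lookup (swapE i j e) m ≡ lookup e (swapSuc i m)
    lookup-swapE-swapSuc {i} {j} i→j e m with m Fin.≟ i | m Fin.≟ j
    ... | yes refl | _        = ≡.trans (lookup-swapE-i e (nextFin⇒≢ i→j)) (≡.cong (lookup e) (≡.sym (nextFin⇒swapSuc i→j)))
    ... | no _     | yes refl = ≡.trans (lookup-swapE-j i m e) (≡.cong (lookup e) (≡.sym (swapSuc-j)))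
      where
      swapSuc-j : swapSuc i m ≡ i
      swapSuc-j = ≡.trans (≡.cong (swapSuc i) (≡.sym (nextFin⇒swapSuc i→j))) (swapSuc-involutive i i)
    ... | no m≢i   | no m≢j   =
      ≡.trans (lookup-swapE-≢ e m≢i m≢j) (≡.cong (lookup e) (≡.sym (swapSuc-fixes i m m≢i (λ m≡ → m≢j (≡.trans m≡ (nextFin⇒swapSuc i→j))))))

    record IsLinearInvolution (σ : Exp n → Exp n) : Set where
      field
        additive   : ∀ a b → σ (a +ᵉ b) ≡ σ a +ᵉ σ b
        involutive : ∀ e → σ (σ e) ≡ e

      fixes-zeroE : σ zeroE ≡ zeroE
      fixes-zeroE = begin
        σ zeroE                            ≡⟨ +ᵉ-identityʳ (σ zeroE) ⟨
        σ zeroE +ᵉ zeroE                   ≡⟨ ≡.cong (σ zeroE +ᵉ_) (+ᵉ-inverseʳ (σ zeroE)) ⟨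
        σ zeroE +ᵉ (σ zeroE +ᵉ -ᵉ σ zeroE) ≡⟨ +ᵉ-assoc _ _ _ ⟨
        (σ zeroE +ᵉ σ zeroE) +ᵉ -ᵉ σ zeroE ≡⟨ ≡.cong (_+ᵉ -ᵉ σ zeroE) (additive zeroE zeroE) ⟨
        σ (zeroE +ᵉ zeroE) +ᵉ -ᵉ σ zeroE   ≡⟨ ≡.cong (λ x → σ x +ᵉ -ᵉ σ zeroE) (+ᵉ-identityˡ zeroE) ⟩
        σ zeroE +ᵉ -ᵉ σ zeroE              ≡⟨ +ᵉ-inverseʳ (σ zeroE) ⟩
        zeroE                             ∎
        where open ≡.≡-Reasoning

    IsLinearInvolution-resp : ∀ {σ τ} → (∀ e → σ e ≡ τ e) → IsLinearInvolution τ → IsLinearInvolution σ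
    IsLinearInvolution-resp {σ} {τ} σ≗τ τ-inv = record
      { additive   = λ a b → ≡.trans (σ≗τ (a +ᵉ b)) (≡.trans (additive a b) (≡.sym (≡.cong₂ _+ᵉ_ (σ≗τ a) (σ≗τ b))))
      ; involutive = λ e → ≡.trans (σ≗τ (σ e)) (≡.trans (≡.cong τ (σ≗τ e)) (involutive e))
      }
      where open IsLinearInvolution τ-inv

    -- s_i, s_n and τ_n act on exponents as reflections e ↦ e + ⟨α∨, e⟩ α in a root α; linearity,
    -- involutivity and the division of single terms by 1 - x^α are proved once for all of them.
    record Reflection : Set where
      field
        root        : Exp n
        coroot      : Exp n → ℤ
        coroot-+ᵉ   : ∀ a b → coroot (a +ᵉ b) ≡ coroot a ℤ.+ coroot b
        coroot-*ᵉ   : ∀ z a → coroot (z *ᵉ a) ≡ z ℤ.* coroot a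
        coroot-root : coroot root ≡ -[1+ 1 ]

      reflect : Exp n → Exp n
      reflect e = e +ᵉ coroot e *ᵉ root

      lookup-reflect : ∀ e m → lookup (reflect e) m ≡ lookup e m ℤ.+ coroot e ℤ.* lookup root m
      lookup-reflect e m = ≡.trans (lookup-+ᵉ e _ m) (≡.cong (λ w → lookup e m ℤ.+ w) (lookup-*ᵉ (coroot e) root m))

      lookup-reflect-at : ∀ {m r} → lookup root m ≡ r → ∀ e → lookup (reflect e) m ≡ lookup e m ℤ.+ coroot e ℤ.* r
      lookup-reflect-at {m} root-m e = ≡.trans (lookup-reflect e m) (≡.cong (λ r → lookup e m ℤ.+ coroot e ℤ.* r) root-m)

      lookup-reflect-off : ∀ {m} → lookup root m ≡ + 0 → ∀ e → lookup (reflect e) m ≡ lookup e m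
      lookup-reflect-off {m} root-m e = ≡.trans (lookup-reflect-at root-m e) (≡.trans (≡.cong (λ r → lookup e m ℤ.+ r) (ℤP.*-zeroʳ (coroot e))) (ℤP.+-identityʳ _))

      reflect-additive : ∀ a b → reflect (a +ᵉ b) ≡ reflect a +ᵉ reflect b
      reflect-additive a b = Exp-ext λ m → begin
        lookup (reflect (a +ᵉ b)) m                                               ≡⟨ lookup-reflect (a +ᵉ b) m ⟩
        lookup (a +ᵉ b) m ℤ.+ coroot (a +ᵉ b) ℤ.* lookup root m                   ≡⟨ ≡.cong₂ (λ x y → x ℤ.+ y ℤ.* lookup root m) (lookup-+ᵉ a b m) (coroot-+ᵉ a b) ⟩
        (lookup a m ℤ.+ lookup b m) ℤ.+ (coroot a ℤ.+ coroot b) ℤ.* lookup root m ≡⟨ shuffle (lookup a m) (lookup b m) (coroot a) (coroot b) (lookup root m) ⟩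
        (lookup a m ℤ.+ coroot a ℤ.* lookup root m) ℤ.+ (lookup b m ℤ.+ coroot b ℤ.* lookup root m)
                                                                                         ≡⟨ ≡.cong₂ ℤ._+_ (lookup-reflect a m) (lookup-reflect b m) ⟨
        lookup (reflect a) m ℤ.+ lookup (reflect b) m                             ≡⟨ lookup-+ᵉ (reflect a) (reflect b) m ⟨
        lookup (reflect a +ᵉ reflect b) m                                                ∎
        where
        open ≡.≡-Reasoning
        shuffle : ∀ x y k l d → (x ℤ.+ y) ℤ.+ (k ℤ.+ l) ℤ.* d ≡ (x ℤ.+ k ℤ.* d) ℤ.+ (y ℤ.+ l ℤ.* d)
        shuffle = solve-∀

      coroot-reflect : ∀ e → coroot (reflect e) ≡ ℤ.- coroot e
      coroot-reflect e = begin
        coroot (e +ᵉ coroot e *ᵉ root)         ≡⟨ coroot-+ᵉ e _ ⟩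
        coroot e ℤ.+ coroot (coroot e *ᵉ root) ≡⟨ ≡.cong (λ w → coroot e ℤ.+ w) (≡.trans (coroot-*ᵉ (coroot e) root) (≡.cong (coroot e ℤ.*_) coroot-root)) ⟩
        coroot e ℤ.+ coroot e ℤ.* -[1+ 1 ]     ≡⟨ k-2k (coroot e) ⟩
        ℤ.- coroot e                              ∎
        where
        open ≡.≡-Reasoning
        k-2k : ∀ k → k ℤ.+ k ℤ.* -[1+ 1 ] ≡ ℤ.- k
        k-2k = solve-∀

      reflect-involutive : ∀ e → reflect (reflect e) ≡ e
      reflect-involutive e = Exp-ext λ m → begin
        lookup (reflect (reflect e)) m                                                 ≡⟨ lookup-reflect (reflect e) m ⟩
        lookup (reflect e) m ℤ.+ coroot (reflect e) ℤ.* lookup root m                  ≡⟨ ≡.cong₂ (λ x k → x ℤ.+ k ℤ.* lookup root m) (lookup-reflect e m) (coroot-reflect e) ⟩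
        (lookup e m ℤ.+ coroot e ℤ.* lookup root m) ℤ.+ ℤ.- coroot e ℤ.* lookup root m ≡⟨ cancel (lookup e m) (coroot e) (lookup root m) ⟩
        lookup e m                                                                            ∎
        where
        open ≡.≡-Reasoning
        cancel : ∀ x k d → (x ℤ.+ k ℤ.* d) ℤ.+ ℤ.- k ℤ.* d ≡ x
        cancel = solve-∀

      isLinearInvolution : IsLinearInvolution reflect
      isLinearInvolution = record { additive = reflect-additive ; involutive = reflect-involutive }

      reflect-fixes : ∀ {e} → coroot e ≡ + 0 → reflect e ≡ e
      reflect-fixes {e} κe≡0 = Exp-ext λ m →
        ≡.trans (lookup-reflect e m) (≡.trans (≡.cong (λ k → lookup e m ℤ.+ k ℤ.* lookup root m) κe≡0) (ℤP.+-identityʳ _))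

      reflect-root : reflect root ≡ -ᵉ root
      reflect-root = Exp-ext λ m → begin
        lookup (reflect root) m                         ≡⟨ lookup-reflect root m ⟩
        lookup root m ℤ.+ coroot root ℤ.* lookup root m ≡⟨ ≡.cong (λ k → lookup root m ℤ.+ k ℤ.* lookup root m) coroot-root ⟩
        lookup root m ℤ.+ -[1+ 1 ] ℤ.* lookup root m    ≡⟨ d-2d (lookup root m) ⟩
        ℤ.- lookup root m                               ≡⟨ VecP.lookup-map m (ℤ.-_) root ⟨
        lookup (-ᵉ root) m                                        ∎
        where
        open ≡.≡-Reasoning
        d-2d : ∀ d → d ℤ.+ -[1+ 1 ] ℤ.* d ≡ ℤ.- d
        d-2d = solve-∀

      reflect-shift : ∀ {x y} c → y ≡ x +ᵉ c *ᵉ root → ∀ e → y +ᵉ reflect e ≡ (x +ᵉ e) +ᵉ (c ℤ.+ coroot e) *ᵉ root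
      reflect-shift {x} c refl e = Exp-ext λ m → begin
        lookup ((x +ᵉ c *ᵉ root) +ᵉ reflect e) m                                             ≡⟨ lookup-+ᵉ (x +ᵉ c *ᵉ root) (reflect e) m ⟩
        lookup (x +ᵉ c *ᵉ root) m ℤ.+ lookup (reflect e) m                                   ≡⟨ ≡.cong₂ ℤ._+_ (≡.trans (lookup-+ᵉ x (c *ᵉ root) m) (≡.cong (λ w → lookup x m ℤ.+ w) (lookup-*ᵉ c root m))) (lookup-reflect e m) ⟩
        (lookup x m ℤ.+ c ℤ.* lookup root m) ℤ.+ (lookup e m ℤ.+ coroot e ℤ.* lookup root m) ≡⟨ shuffle (lookup x m) c (lookup e m) (coroot e) (lookup root m) ⟩
        (lookup x m ℤ.+ lookup e m) ℤ.+ (c ℤ.+ coroot e) ℤ.* lookup root m                   ≡⟨ ≡.cong₂ ℤ._+_ (lookup-+ᵉ x e m) (lookup-*ᵉ (c ℤ.+ coroot e) root m) ⟨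
        lookup (x +ᵉ e) m ℤ.+ lookup ((c ℤ.+ coroot e) *ᵉ root) m                            ≡⟨ lookup-+ᵉ (x +ᵉ e) ((c ℤ.+ coroot e) *ᵉ root) m ⟨
        lookup ((x +ᵉ e) +ᵉ (c ℤ.+ coroot e) *ᵉ root) m                                            ∎
        where
        open ≡.≡-Reasoning
        shuffle : ∀ x c e k d → (x ℤ.+ c ℤ.* d) ℤ.+ (e ℤ.+ k ℤ.* d) ≡ (x ℤ.+ e) ℤ.+ (c ℤ.+ k) ℤ.* d
        shuffle = solve-∀

    coordinateForm : ℤ → Fin n → ℤ → Fin n → Exp n → ℤ
    coordinateForm a k b l e = a ℤ.* lookup e k ℤ.+ b ℤ.* lookup e l

    reflectionAlong : ∀ a k b l (root : Exp n) → coordinateForm a k b l root ≡ -[1+ 1 ] → Reflection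
    reflectionAlong a k b l root coroot-root = record
      { root = root ; coroot = coordinateForm a k b l ; coroot-root = coroot-root
      ; coroot-+ᵉ = λ x y → ≡.trans (≡.cong₂ (λ u v → a ℤ.* u ℤ.+ b ℤ.* v) (lookup-+ᵉ x y k) (lookup-+ᵉ x y l))
                                    (linear a b (lookup x k) (lookup y k) (lookup x l) (lookup y l))
      ; coroot-*ᵉ = λ z x → ≡.trans (≡.cong₂ (λ u v → a ℤ.* u ℤ.+ b ℤ.* v) (lookup-*ᵉ z x k) (lookup-*ᵉ z x l))
                                    (homogeneous a b z (lookup x k) (lookup x l))
      }
      where
      linear : ∀ a b u u′ v v′ → a ℤ.* (u ℤ.+ u′) ℤ.+ b ℤ.* (v ℤ.+ v′) ≡ (a ℤ.* u ℤ.+ b ℤ.* v) ℤ.+ (a ℤ.* u′ ℤ.+ b ℤ.* v′)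
      linear = solve-∀
      homogeneous : ∀ a b z u v → a ℤ.* (z ℤ.* u) ℤ.+ b ℤ.* (z ℤ.* v) ≡ z ℤ.* (a ℤ.* u ℤ.+ b ℤ.* v)
      homogeneous = solve-∀

    lookup-unit+unit : ∀ {k l : Fin n} a b m → lookup (unit k a +ᵉ unit l b) m ≡ lookup (unit k a) m ℤ.+ lookup (unit l b) m
    lookup-unit+unit {k} {l} a b m = lookup-+ᵉ (unit k a) (unit l b) m

    module _ {i j : Fin n} (i≢j : i ≢ j) where

      adjacentReflection : Reflection
      adjacentReflection = reflectionAlong (+ 1) i -[1+ 0 ] j (unit j (+ 1) +ᵉ unit i -[1+ 0 ])
        (≡.cong₂ (λ u v → + 1 ℤ.* u ℤ.+ -[1+ 0 ] ℤ.* v)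
          (≡.trans (lookup-unit+unit (+ 1) -[1+ 0 ] i) (≡.cong₂ ℤ._+_ (lookup-unit-≢ (+ 1) i≢j) (lookup-unit-≡ i -[1+ 0 ])))
          (≡.trans (lookup-unit+unit (+ 1) -[1+ 0 ] j) (≡.cong₂ ℤ._+_ (lookup-unit-≡ j (+ 1)) (lookup-unit-≢ -[1+ 0 ] (i≢j ∘ ≡.sym)))))

      swapE≗reflect : ∀ e → swapE i j e ≡ Reflection.reflect adjacentReflection e
      swapE≗reflect e = Exp-ext at
        where
        open Reflection adjacentReflection
        at-i : ∀ x y → y ≡ x ℤ.+ (+ 1 ℤ.* x ℤ.+ -[1+ 0 ] ℤ.* y) ℤ.* (+ 0 ℤ.+ -[1+ 0 ])
        at-i = solve-∀
        at-j : ∀ x y → x ≡ y ℤ.+ (+ 1 ℤ.* x ℤ.+ -[1+ 0 ] ℤ.* y) ℤ.* (+ 1 ℤ.+ + 0)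
        at-j = solve-∀
        at : ∀ m → lookup (swapE i j e) m ≡ lookup (reflect e) m
        at m with m Fin.≟ i | m Fin.≟ j
        ... | yes refl | _ = ≡.trans (lookup-swapE-i e i≢j) (≡.trans (at-i (lookup e i) (lookup e j)) (≡.sym (lookup-reflect-at
              (≡.trans (lookup-unit+unit (+ 1) -[1+ 0 ] m) (≡.cong₂ ℤ._+_ (lookup-unit-≢ (+ 1) i≢j) (lookup-unit-≡ i -[1+ 0 ]))) e)))
        ... | no m≢i | yes refl = ≡.trans (lookup-swapE-j i j e) (≡.trans (at-j (lookup e i) (lookup e j)) (≡.sym (lookup-reflect-at
              (≡.trans (lookup-unit+unit (+ 1) -[1+ 0 ] m) (≡.cong₂ ℤ._+_ (lookup-unit-≡ j (+ 1)) (lookup-unit-≢ -[1+ 0 ] m≢i))) e)))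
        ... | no m≢i | no m≢j = ≡.trans (lookup-swapE-≢ e m≢i m≢j) (≡.sym (lookup-reflect-off
              (≡.trans (lookup-unit+unit (+ 1) -[1+ 0 ] m) (≡.cong₂ ℤ._+_ (lookup-unit-≢ (+ 1) m≢j) (lookup-unit-≢ -[1+ 0 ] m≢i))) e))

      swapE-isLinearInvolution : IsLinearInvolution (swapE i j)
      swapE-isLinearInvolution = IsLinearInvolution-resp swapE≗reflect (Reflection.isLinearInvolution adjacentReflection)

    swapE-unit : ∀ {i j : Fin n} → nextFin i ≡ just j → ∀ k z → swapE i j (unit k z) ≡ unit (swapSuc i k) z
    swapE-unit {i} i→j k z = Exp-ext λ m → ≡.trans (lookup-swapE-swapSuc i→j (unit k z) m) (at m)
      where
      at : ∀ m → lookup (unit k z) (swapSuc i m) ≡ lookup (unit (swapSuc i k) z) m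
      at m with m Fin.≟ swapSuc i k
      ... | yes refl = ≡.trans (≡.cong (lookup (unit k z)) (swapSuc-involutive i k)) (≡.trans (lookup-unit-≡ k z) (≡.sym (lookup-unit-≡ m z)))
      ... | no m≢πk  = ≡.trans (lookup-unit-≢ z (λ πm≡k → m≢πk (≡.trans (≡.sym (swapSuc-involutive i m)) (≡.cong (swapSuc i) πm≡k))))
                               (≡.sym (lookup-unit-≢ z m≢πk))

    module _ (i : Fin n) where

      -- long root for π^C and π^BC, short root for π^B
      longReflection shortReflection : Reflection
      longReflection  = reflectionAlong (+ 1) i (+ 0) i (unit i -[1+ 1 ])
        (≡.cong (λ u → + 1 ℤ.* u ℤ.+ + 0 ℤ.* u) (lookup-unit-≡ i -[1+ 1 ]))
      shortReflection = reflectionAlong (+ 2) i (+ 0) i (unit i -[1+ 0 ])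
        (≡.cong (λ u → + 2 ℤ.* u ℤ.+ + 0 ℤ.* u) (lookup-unit-≡ i -[1+ 0 ]))

      invE≗reflect-long : ∀ e → invE i e ≡ Reflection.reflect longReflection e
      invE≗reflect-long e = Exp-ext at
        where
        open Reflection longReflection
        at-i : ∀ x → ℤ.- x ≡ x ℤ.+ (+ 1 ℤ.* x ℤ.+ + 0 ℤ.* x) ℤ.* -[1+ 1 ]
        at-i = solve-∀
        at : ∀ m → lookup (invE i e) m ≡ lookup (reflect e) m
        at m with m Fin.≟ i
        ... | yes refl = ≡.trans (lookup-invE-i m e) (≡.trans (at-i (lookup e m)) (≡.sym (lookup-reflect-at (lookup-unit-≡ m -[1+ 1 ]) e)))
        ... | no m≢i   = ≡.trans (lookup-invE-≢ e m≢i) (≡.sym (lookup-reflect-off (lookup-unit-≢ -[1+ 1 ] m≢i) e))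

      invE≗reflect-short : ∀ e → invE i e ≡ Reflection.reflect shortReflection e
      invE≗reflect-short e = Exp-ext at
        where
        open Reflection shortReflection
        at-i : ∀ x → ℤ.- x ≡ x ℤ.+ (+ 2 ℤ.* x ℤ.+ + 0 ℤ.* x) ℤ.* -[1+ 0 ]
        at-i = solve-∀
        at : ∀ m → lookup (invE i e) m ≡ lookup (reflect e) m
        at m with m Fin.≟ i
        ... | yes refl = ≡.trans (lookup-invE-i m e) (≡.trans (at-i (lookup e m)) (≡.sym (lookup-reflect-at (lookup-unit-≡ m -[1+ 0 ]) e)))
        ... | no m≢i   = ≡.trans (lookup-invE-≢ e m≢i) (≡.sym (lookup-reflect-off (lookup-unit-≢ -[1+ 0 ] m≢i) e))

      invE-isLinearInvolution : IsLinearInvolution (invE i)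
      invE-isLinearInvolution = IsLinearInvolution-resp invE≗reflect-long (Reflection.isLinearInvolution longReflection)

      invE-unit-≢ : ∀ {k} z → k ≢ i → invE i (unit k z) ≡ unit k z
      invE-unit-≢ z k≢i = ≡.trans (invE≗reflect-long _) (Reflection.reflect-fixes longReflection
        (≡.cong (λ u → + 1 ℤ.* u ℤ.+ + 0 ℤ.* u) (lookup-unit-≢ z (k≢i ∘ ≡.sym))))

      invE-unit-≡ : ∀ z → invE i (unit i z) ≡ unit i (ℤ.- z)
      invE-unit-≡ z = Exp-ext at
        where
        at : ∀ m → lookup (invE i (unit i z)) m ≡ lookup (unit i (ℤ.- z)) m
        at m with m Fin.≟ i
        ... | yes refl = ≡.trans (lookup-invE-i m (unit m z)) (≡.trans (≡.cong ℤ.-_ (lookup-unit-≡ m z)) (≡.sym (lookup-unit-≡ m (ℤ.- z))))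
        ... | no m≢i   = ≡.trans (lookup-invE-≢ (unit i z) m≢i) (≡.trans (lookup-unit-≢ z m≢i) (≡.sym (lookup-unit-≢ (ℤ.- z) m≢i)))

    module _ {p i : Fin n} (p≢i : p ≢ i) where

      τReflection : Reflection
      τReflection = reflectionAlong (+ 1) p (+ 1) i (unit p -[1+ 0 ] +ᵉ unit i -[1+ 0 ])
        (≡.cong₂ (λ u v → + 1 ℤ.* u ℤ.+ + 1 ℤ.* v)
          (≡.trans (lookup-unit+unit -[1+ 0 ] -[1+ 0 ] p) (≡.cong₂ ℤ._+_ (lookup-unit-≡ p -[1+ 0 ]) (lookup-unit-≢ -[1+ 0 ] p≢i)))
          (≡.trans (lookup-unit+unit -[1+ 0 ] -[1+ 0 ] i) (≡.cong₂ ℤ._+_ (lookup-unit-≢ -[1+ 0 ] (p≢i ∘ ≡.sym)) (lookup-unit-≡ i -[1+ 0 ]))))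

      tauE≗reflect : ∀ e → tauE p i e ≡ Reflection.reflect τReflection e
      tauE≗reflect e = Exp-ext at
        where
        open Reflection τReflection
        at-p : ∀ x y → ℤ.- y ≡ x ℤ.+ (+ 1 ℤ.* x ℤ.+ + 1 ℤ.* y) ℤ.* (-[1+ 0 ] ℤ.+ + 0)
        at-p = solve-∀
        at-i : ∀ x y → ℤ.- x ≡ y ℤ.+ (+ 1 ℤ.* x ℤ.+ + 1 ℤ.* y) ℤ.* (+ 0 ℤ.+ -[1+ 0 ])
        at-i = solve-∀
        at : ∀ m → lookup (tauE p i e) m ≡ lookup (reflect e) m
        at m with m Fin.≟ p | m Fin.≟ i
        ... | yes refl | _ = ≡.trans (lookup-tauE-p e p≢i) (≡.trans (at-p (lookup e p) (lookup e i)) (≡.sym (lookup-reflect-at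
              (≡.trans (lookup-unit+unit -[1+ 0 ] -[1+ 0 ] m) (≡.cong₂ ℤ._+_ (lookup-unit-≡ p -[1+ 0 ]) (lookup-unit-≢ -[1+ 0 ] p≢i))) e)))
        ... | no m≢p | yes refl = ≡.trans (lookup-tauE-i p i e) (≡.trans (at-i (lookup e p) (lookup e i)) (≡.sym (lookup-reflect-at
              (≡.trans (lookup-unit+unit -[1+ 0 ] -[1+ 0 ] m) (≡.cong₂ ℤ._+_ (lookup-unit-≢ -[1+ 0 ] m≢p) (lookup-unit-≡ i -[1+ 0 ]))) e)))
        ... | no m≢p | no m≢i = ≡.trans (lookup-tauE-≢ e m≢p m≢i) (≡.sym (lookup-reflect-off
              (≡.trans (lookup-unit+unit -[1+ 0 ] -[1+ 0 ] m) (≡.cong₂ ℤ._+_ (lookup-unit-≢ -[1+ 0 ] m≢p) (lookup-unit-≢ -[1+ 0 ] m≢i))) e))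

      tauE≗swapE∘invE∘invE : ∀ e → tauE p i e ≡ swapE p i (invE p (invE i e))
      tauE≗swapE∘invE∘invE e = Exp-ext at
        where
        at : ∀ m → lookup (tauE p i e) m ≡ lookup (swapE p i (invE p (invE i e))) m
        at m with m Fin.≟ p | m Fin.≟ i
        ... | yes refl | _ = ≡.trans (lookup-tauE-p e p≢i) (≡.sym (≡.trans (lookup-swapE-i (invE p (invE i e)) p≢i)
                               (≡.trans (lookup-invE-≢ (invE i e) (p≢i ∘ ≡.sym)) (lookup-invE-i i e))))
        ... | no m≢p | yes refl = ≡.trans (lookup-tauE-i p i e) (≡.sym (≡.trans (lookup-swapE-j p i (invE p (invE i e)))
                               (≡.trans (lookup-invE-i p (invE i e)) (≡.cong ℤ.-_ (lookup-invE-≢ e p≢i)))))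
        ... | no m≢p | no m≢i = ≡.trans (lookup-tauE-≢ e m≢p m≢i) (≡.sym (≡.trans (lookup-swapE-≢ (invE p (invE i e)) m≢p m≢i)
                               (≡.trans (lookup-invE-≢ (invE i e) m≢p) (lookup-invE-≢ e m≢i))))

      tauE-isLinearInvolution : IsLinearInvolution (tauE p i)
      tauE-isLinearInvolution = IsLinearInvolution-resp tauE≗reflect (Reflection.isLinearInvolution τReflection)

    -- Laurent polynomials as functionals on exponents

    -- A Laurent polynomial p acts on functions φ on exponents by ⟦ p ⟧ φ = Σ_e p_e φ(e);
    -- with φ the indicator of m this is the coefficient of x^m.
    ⟦_⟧ : LPoly n → (Exp n → Carrier) → Carrier
    ⟦ [] ⟧          φ = 0#
    ⟦ (a , e) ∷ p ⟧ φ = a * φ e + ⟦ p ⟧ φ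

    ⟦⟧-cong : ∀ p {φ ψ : Exp n → Carrier} → (∀ e → φ e ≈ ψ e) → ⟦ p ⟧ φ ≈ ⟦ p ⟧ ψ
    ⟦⟧-cong []            φ≈ψ = ≈-refl
    ⟦⟧-cong ((a , e) ∷ p) φ≈ψ = +-cong (*-congˡ (φ≈ψ e)) (⟦⟧-cong p φ≈ψ)

    ⟦⟧-⊕ : ∀ p q φ → ⟦ p ⊕ q ⟧ φ ≈ ⟦ p ⟧ φ + ⟦ q ⟧ φ
    ⟦⟧-⊕ []            q φ = sym (+-identityˡ _)
    ⟦⟧-⊕ ((a , e) ∷ p) q φ = trans (+-congˡ (⟦⟧-⊕ p q φ)) (sym (+-assoc _ _ _))

    ⟦⟧-· : ∀ a p φ → ⟦ a · p ⟧ φ ≈ a * ⟦ p ⟧ φ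
    ⟦⟧-· a []            φ = sym (zeroʳ a)
    ⟦⟧-· a ((b , e) ∷ p) φ = begin
      a * b * φ e + ⟦ a · p ⟧ φ   ≈⟨ +-cong (*-assoc a b (φ e)) (⟦⟧-· a p φ) ⟩
      a * (b * φ e) + a * ⟦ p ⟧ φ ≈⟨ distribˡ a _ _ ⟨
      a * (b * φ e + ⟦ p ⟧ φ)     ∎
      where open ≈-Reasoning

    ⟦⟧-neg : ∀ p φ → ⟦ neg p ⟧ φ ≈ - ⟦ p ⟧ φ
    ⟦⟧-neg p φ = trans (⟦⟧-· (- 1#) p φ) (-1*x≈-x _)

    ⟦⟧-⊖ : ∀ p q φ → ⟦ p ⊖ q ⟧ φ ≈ ⟦ p ⟧ φ - ⟦ q ⟧ φ
    ⟦⟧-⊖ p q φ = trans (⟦⟧-⊕ p (neg q) φ) (+-congˡ (⟦⟧-neg q φ))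

    ⟦⟧-zero : ∀ p → ⟦ p ⟧ (λ _ → 0#) ≈ 0#
    ⟦⟧-zero []            = ≈-refl
    ⟦⟧-zero ((a , e) ∷ p) = trans (+-cong (zeroʳ a) (⟦⟧-zero p)) (+-identityˡ 0#)

    ⟦⟧-+ : ∀ p (φ ψ : Exp n → Carrier) → ⟦ p ⟧ (λ e → φ e + ψ e) ≈ ⟦ p ⟧ φ + ⟦ p ⟧ ψ
    ⟦⟧-+ []            φ ψ = sym (+-identityˡ 0#)
    ⟦⟧-+ ((a , e) ∷ p) φ ψ = trans (+-cong (distribˡ a _ _) (⟦⟧-+ p φ ψ)) (interchange _ _ _ _)

    ⟦⟧-* : ∀ p x (φ : Exp n → Carrier) → ⟦ p ⟧ (λ e → x * φ e) ≈ x * ⟦ p ⟧ φ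
    ⟦⟧-* []            x φ = sym (zeroʳ x)
    ⟦⟧-* ((a , e) ∷ p) x φ = begin
      a * (x * φ e) + ⟦ p ⟧ (λ e → x * φ e) ≈⟨ +-cong (x∙yz≈y∙xz a x (φ e)) (⟦⟧-* p x φ) ⟩
      x * (a * φ e) + x * ⟦ p ⟧ φ           ≈⟨ distribˡ x _ _ ⟨
      x * (a * φ e + ⟦ p ⟧ φ)               ∎
      where
      open ≈-Reasoning
      open CommutativeSemigroupProperties *-commutativeSemigroup using (x∙yz≈y∙xz)

    ⟦⟧-negate : ∀ p (φ : Exp n → Carrier) → ⟦ p ⟧ (λ e → - φ e) ≈ - ⟦ p ⟧ φ
    ⟦⟧-negate p φ = trans (⟦⟧-cong p (λ e → sym (-1*x≈-x (φ e)))) (trans (⟦⟧-* p (- 1#) φ) (-1*x≈-x _))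

    ⟦⟧-swap : ∀ p q (ψ : Exp n → Exp n → Carrier) →
              ⟦ p ⟧ (λ a → ⟦ q ⟧ (ψ a)) ≈ ⟦ q ⟧ (λ b → ⟦ p ⟧ (λ a → ψ a b))
    ⟦⟧-swap []            q ψ = sym (⟦⟧-zero q)
    ⟦⟧-swap ((x , e) ∷ p) q ψ = begin
      x * ⟦ q ⟧ (ψ e) + ⟦ p ⟧ (λ a → ⟦ q ⟧ (ψ a))                 ≈⟨ +-cong (sym (⟦⟧-* q x (ψ e))) (⟦⟧-swap p q ψ) ⟩
      ⟦ q ⟧ (λ b → x * ψ e b) + ⟦ q ⟧ (λ b → ⟦ p ⟧ (λ a → ψ a b)) ≈⟨ ⟦⟧-+ q _ _ ⟨
      ⟦ q ⟧ (λ b → x * ψ e b + ⟦ p ⟧ (λ a → ψ a b))              ∎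
      where open ≈-Reasoning

    ⟦⟧-map-shift : ∀ x e q φ → ⟦ List.map (λ t → x * proj₁ t , e +ᵉ proj₂ t) q ⟧ φ ≈ x * ⟦ q ⟧ (λ b → φ (e +ᵉ b))
    ⟦⟧-map-shift x e []            φ = sym (zeroʳ x)
    ⟦⟧-map-shift x e ((b , f) ∷ q) φ = begin
      x * b * φ (e +ᵉ f) + _                              ≈⟨ +-cong (*-assoc x b _) (⟦⟧-map-shift x e q φ) ⟩
      x * (b * φ (e +ᵉ f)) + x * ⟦ q ⟧ (λ b → φ (e +ᵉ b)) ≈⟨ distribˡ x _ _ ⟨
      x * (b * φ (e +ᵉ f) + ⟦ q ⟧ (λ b → φ (e +ᵉ b)))     ∎
      where open ≈-Reasoning

    ⟦⟧-⊛ : ∀ p q φ → ⟦ p ⊛ q ⟧ φ ≈ ⟦ p ⟧ (λ a → ⟦ q ⟧ (λ b → φ (a +ᵉ b)))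
    ⟦⟧-⊛ []            q φ = ≈-refl
    ⟦⟧-⊛ ((x , e) ∷ p) q φ =
      trans (⟦⟧-⊕ (List.map _ q) (p ⊛ q) φ) (+-cong (⟦⟧-map-shift x e q φ) (⟦⟧-⊛ p q φ))

    ⟦⟧-act : ∀ σ p (φ : Exp n → Carrier) → ⟦ act σ p ⟧ φ ≈ ⟦ p ⟧ (φ ∘ σ)
    ⟦⟧-act σ []            φ = ≈-refl
    ⟦⟧-act σ ((a , e) ∷ p) φ = +-congˡ (⟦⟧-act σ p φ)

    ⟦⟧-xρ : ∀ e φ → ⟦ xρ e ⟧ φ ≈ φ e
    ⟦⟧-xρ e φ = trans (+-identityʳ _) (*-identityˡ _)

    ⟦⟧-xρ⊛ : ∀ e p φ → ⟦ xρ e ⊛ p ⟧ φ ≈ ⟦ p ⟧ (λ b → φ (e +ᵉ b))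
    ⟦⟧-xρ⊛ e p φ = trans (⟦⟧-⊛ (xρ e) p φ) (⟦⟧-xρ e (λ a → ⟦ p ⟧ (λ b → φ (a +ᵉ b))))

    ⟦⟧-xρ⊖xρ : ∀ a b φ → ⟦ xρ a ⊖ xρ b ⟧ φ ≈ φ a - φ b
    ⟦⟧-xρ⊖xρ a b φ = trans (⟦⟧-⊖ (xρ a) (xρ b) φ) (+-cong (⟦⟧-xρ a φ) (-‿cong (⟦⟧-xρ b φ)))

    ≡⇒≈ : ∀ (φ : Exp n → Carrier) {a b} → a ≡ b → φ a ≈ φ b
    ≡⇒≈ φ a≡b = reflexive (≡.cong φ a≡b)

    -- Equality as functionals. It agrees with ≋ (≋⇒~, ~⇒≋), and the ring laws become easy because
    -- ⟦ p ⊛ q ⟧ is an iterated ⟦⟧ (⟦⟧-⊛).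
    infix 4 _~_
    record _~_ (p q : LPoly n) : Set (c ⊔ ℓ) where
      constructor mk~
      field at : ∀ φ → ⟦ p ⟧ φ ≈ ⟦ q ⟧ φ
    open _~_ public

    ~-isEquivalence : IsEquivalence _~_
    ~-isEquivalence = record
      { refl  = mk~ λ φ → ≈-refl
      ; sym   = λ p~q → mk~ λ φ → sym (at p~q φ)
      ; trans = λ p~q q~r → mk~ λ φ → trans (at p~q φ) (at q~r φ)
      }

    ⊕-cong : ∀ {p p′ q q′} → p ~ p′ → q ~ q′ → p ⊕ q ~ p′ ⊕ q′
    ⊕-cong {p} {p′} {q} {q′} p~p′ q~q′ =
      mk~ λ φ → trans (⟦⟧-⊕ p q φ) (trans (+-cong (at p~p′ φ) (at q~q′ φ)) (sym (⟦⟧-⊕ p′ q′ φ)))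

    ⊕-congˡ : ∀ p {q q′} → q ~ q′ → p ⊕ q ~ p ⊕ q′
    ⊕-congˡ p q~q′ = ⊕-cong (mk~ λ φ → ≈-refl) q~q′

    ⊕-congʳ : ∀ {p p′} q → p ~ p′ → p ⊕ q ~ p′ ⊕ q
    ⊕-congʳ q p~p′ = ⊕-cong p~p′ (mk~ λ φ → ≈-refl)

    ⊕-assoc : ∀ p q r → (p ⊕ q) ⊕ r ~ p ⊕ (q ⊕ r)
    ⊕-assoc p q r = mk~ λ φ → begin
      ⟦ (p ⊕ q) ⊕ r ⟧ φ             ≈⟨ trans (⟦⟧-⊕ (p ⊕ q) r φ) (+-congʳ (⟦⟧-⊕ p q φ)) ⟩
      (⟦ p ⟧ φ + ⟦ q ⟧ φ) + ⟦ r ⟧ φ ≈⟨ +-assoc _ _ _ ⟩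
      ⟦ p ⟧ φ + (⟦ q ⟧ φ + ⟦ r ⟧ φ) ≈⟨ trans (⟦⟧-⊕ p (q ⊕ r) φ) (+-congˡ (⟦⟧-⊕ q r φ)) ⟨
      ⟦ p ⊕ (q ⊕ r) ⟧ φ               ∎
      where open ≈-Reasoning

    ⊕-comm : ∀ p q → p ⊕ q ~ q ⊕ p
    ⊕-comm p q = mk~ λ φ → trans (⟦⟧-⊕ p q φ) (trans (+-comm _ _) (sym (⟦⟧-⊕ q p φ)))

    ⊕-identityʳ : ∀ p → p ⊕ [] ~ p
    ⊕-identityʳ p = mk~ λ φ → trans (⟦⟧-⊕ p [] φ) (+-identityʳ _)

    ⊕-inverseʳ : ∀ p → p ⊖ p ~ []
    ⊕-inverseʳ p = mk~ λ φ → trans (⟦⟧-⊖ p p φ) (-‿inverseʳ _)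

    neg-cong : ∀ {p q} → p ~ q → neg p ~ neg q
    neg-cong {p} {q} p~q = mk~ λ φ → trans (⟦⟧-neg p φ) (trans (-‿cong (at p~q φ)) (sym (⟦⟧-neg q φ)))

    ⊛-congˡ : ∀ p {q q′} → q ~ q′ → p ⊛ q ~ p ⊛ q′
    ⊛-congˡ p {q} {q′} q~q′ = mk~ λ φ → trans (⟦⟧-⊛ p q φ) (trans (⟦⟧-cong p (λ a → at q~q′ _)) (sym (⟦⟧-⊛ p q′ φ)))

    ⊛-congʳ : ∀ {p p′} q → p ~ p′ → p ⊛ q ~ p′ ⊛ q
    ⊛-congʳ {p} {p′} q p~p′ = mk~ λ φ → trans (⟦⟧-⊛ p q φ) (trans (at p~p′ _) (sym (⟦⟧-⊛ p′ q φ)))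

    ⊛-comm : ∀ p q → p ⊛ q ~ q ⊛ p
    ⊛-comm p q = mk~ λ φ → begin
      ⟦ p ⊛ q ⟧ φ                            ≈⟨ ⟦⟧-⊛ p q φ ⟩
      ⟦ p ⟧ (λ a → ⟦ q ⟧ (λ b → φ (a +ᵉ b))) ≈⟨ ⟦⟧-swap p q (λ a b → φ (a +ᵉ b)) ⟩
      ⟦ q ⟧ (λ b → ⟦ p ⟧ (λ a → φ (a +ᵉ b))) ≈⟨ ⟦⟧-cong q (λ b → ⟦⟧-cong p (λ a → ≡⇒≈ φ (+ᵉ-comm a b))) ⟩
      ⟦ q ⟧ (λ b → ⟦ p ⟧ (λ a → φ (b +ᵉ a))) ≈⟨ ⟦⟧-⊛ q p φ ⟨
      ⟦ q ⊛ p ⟧ φ                                 ∎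
      where open ≈-Reasoning

    ⊛-cong : ∀ {p p′ q q′} → p ~ p′ → q ~ q′ → p ⊛ q ~ p′ ⊛ q′
    ⊛-cong {p} {p′} {q} {q′} p~p′ q~q′ = ~-trans (⊛-congˡ p q~q′) (⊛-congʳ q′ p~p′)
      where open IsEquivalence ~-isEquivalence renaming (trans to ~-trans)

    ⊛-assoc : ∀ p q r → (p ⊛ q) ⊛ r ~ p ⊛ (q ⊛ r)
    ⊛-assoc p q r = mk~ λ φ → begin
      ⟦ (p ⊛ q) ⊛ r ⟧ φ                                           ≈⟨ trans (⟦⟧-⊛ (p ⊛ q) r φ) (⟦⟧-⊛ p q _) ⟩
      ⟦ p ⟧ (λ a → ⟦ q ⟧ (λ b → ⟦ r ⟧ (λ d → φ ((a +ᵉ b) +ᵉ d)))) ≈⟨ ⟦⟧-cong p (λ a → ⟦⟧-cong q (λ b → ⟦⟧-cong r (λ d → ≡⇒≈ φ (+ᵉ-assoc a b d)))) ⟩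
      ⟦ p ⟧ (λ a → ⟦ q ⟧ (λ b → ⟦ r ⟧ (λ d → φ (a +ᵉ (b +ᵉ d))))) ≈⟨ ⟦⟧-cong p (λ a → ⟦⟧-⊛ q r _) ⟨
      ⟦ p ⟧ (λ a → ⟦ q ⊛ r ⟧ (λ bd → φ (a +ᵉ bd)))                ≈⟨ ⟦⟧-⊛ p (q ⊛ r) φ ⟨
      ⟦ p ⊛ (q ⊛ r) ⟧ φ                                                     ∎
      where open ≈-Reasoning

    ⊛-identityˡ : ∀ p → 1L ⊛ p ~ p
    ⊛-identityˡ p = mk~ λ φ → trans (⟦⟧-xρ⊛ zeroE p φ) (⟦⟧-cong p (λ b → ≡⇒≈ φ (+ᵉ-identityˡ b)))

    ⊛-distribʳ : ∀ p q r → (p ⊕ q) ⊛ r ~ (p ⊛ r) ⊕ (q ⊛ r)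
    ⊛-distribʳ p q r = mk~ λ φ → begin
      ⟦ (p ⊕ q) ⊛ r ⟧ φ         ≈⟨ trans (⟦⟧-⊛ (p ⊕ q) r φ) (⟦⟧-⊕ p q _) ⟩
      ⟦ p ⟧ _ + ⟦ q ⟧ _         ≈⟨ +-cong (⟦⟧-⊛ p r φ) (⟦⟧-⊛ q r φ) ⟨
      ⟦ p ⊛ r ⟧ φ + ⟦ q ⊛ r ⟧ φ ≈⟨ ⟦⟧-⊕ (p ⊛ r) (q ⊛ r) φ ⟨
      ⟦ (p ⊛ r) ⊕ (q ⊛ r) ⟧ φ             ∎
      where open ≈-Reasoning

    Laurent-ring : CommutativeRing c (c ⊔ ℓ)
    Laurent-ring = record
      { Carrier = LPoly n ; _≈_ = _~_ ; _+_ = _⊕_ ; _*_ = _⊛_ ; -_ = neg ; 0# = [] ; 1# = 1L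
      ; isCommutativeRing = record
        { isRing = record
          { +-isAbelianGroup = record
            { isGroup = record
              { isMonoid = record
                { isSemigroup = record
                  { isMagma = record { isEquivalence = ~-isEquivalence ; ∙-cong = ⊕-cong }
                  ; assoc = ⊕-assoc }
                ; identity = (λ p → mk~ λ φ → ≈-refl) , ⊕-identityʳ }
              ; inverse = (λ p → ~-trans (⊕-comm (neg p) p) (⊕-inverseʳ p)) , ⊕-inverseʳ
              ; ⁻¹-cong = neg-cong }
            ; comm = ⊕-comm }
          ; *-cong = ⊛-cong
          ; *-assoc = ⊛-assoc
          ; *-identity = ⊛-identityˡ , (λ p → ~-trans (⊛-comm p 1L) (⊛-identityˡ p))
          ; distrib = (λ r p q → ~-trans (⊛-comm r (p ⊕ q)) (~-trans (⊛-distribʳ p q r) (⊕-cong (⊛-comm p r) (⊛-comm q r))))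
                    , (λ r p q → ⊛-distribʳ p q r) }
        ; *-comm = ⊛-comm } }
      where open IsEquivalence ~-isEquivalence renaming (trans to ~-trans)

    module L = CommutativeRing Laurent-ring
    module ~-Reasoning = SetoidReasoning L.setoid

    indicator : Exp n → Exp n → Carrier
    indicator m e with ≡-dec ℤ._≟_ e m
    ... | yes _ = 1#
    ... | no  _ = 0#

    indicator-≢ : ∀ {m e} → e ≢ m → indicator m e ≈ 0#
    indicator-≢ {m} {e} e≢m with ≡-dec ℤ._≟_ e m
    ... | yes e≡m = ⊥-elim (e≢m e≡m)
    ... | no  _   = ≈-refl

    coeff≈⟦⟧indicator : ∀ p m → coeff p m ≈ ⟦ p ⟧ (indicator m)
    coeff≈⟦⟧indicator []            m = ≈-refl
    coeff≈⟦⟧indicator ((a , e) ∷ p) m with ≡-dec ℤ._≟_ e m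
    ... | yes _ = +-cong (sym (*-identityʳ a)) (coeff≈⟦⟧indicator p m)
    ... | no  _ = trans (coeff≈⟦⟧indicator p m) (sym (trans (+-congʳ (zeroʳ a)) (+-identityˡ _)))

    ~⇒≋ : ∀ {p q} → p ~ q → p ≋ q
    ~⇒≋ {p} {q} p~q m = trans (coeff≈⟦⟧indicator p m) (trans (at p~q (indicator m)) (sym (coeff≈⟦⟧indicator q m)))

    removeExp : Exp n → LPoly n → LPoly n
    removeExp e []            = []
    removeExp e ((b , f) ∷ p) with ≡-dec ℤ._≟_ f e
    ... | yes _ = removeExp e p
    ... | no  _ = (b , f) ∷ removeExp e p

    ⟦⟧-removeExp : ∀ p e φ → ⟦ p ⟧ φ ≈ coeff p e * φ e + ⟦ removeExp e p ⟧ φ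
    ⟦⟧-removeExp []            e φ = sym (trans (+-identityʳ _) (zeroˡ _))
    ⟦⟧-removeExp ((b , f) ∷ p) e φ with ≡-dec ℤ._≟_ f e
    ... | yes refl = begin
      b * φ f + ⟦ p ⟧ φ                                 ≈⟨ +-congˡ (⟦⟧-removeExp p f φ) ⟩
      b * φ f + (coeff p f * φ f + ⟦ removeExp f p ⟧ φ) ≈⟨ +-assoc _ _ _ ⟨
      (b * φ f + coeff p f * φ f) + ⟦ removeExp f p ⟧ φ ≈⟨ +-congʳ (distribʳ (φ f) b _) ⟨
      (b + coeff p f) * φ f + ⟦ removeExp f p ⟧ φ           ∎
      where open ≈-Reasoning
    ... | no _ = begin
      b * φ f + ⟦ p ⟧ φ                                 ≈⟨ +-congˡ (⟦⟧-removeExp p e φ) ⟩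
      b * φ f + (coeff p e * φ e + ⟦ removeExp e p ⟧ φ) ≈⟨ x∙yz≈y∙xz _ _ _ ⟩
      coeff p e * φ e + (b * φ f + ⟦ removeExp e p ⟧ φ)     ∎
      where
      open ≈-Reasoning
      open CommutativeSemigroupProperties +-commutativeSemigroup using (x∙yz≈y∙xz)

    coeff-removeExp-≡ : ∀ p e → coeff (removeExp e p) e ≈ 0#
    coeff-removeExp-≡ []            e = ≈-refl
    coeff-removeExp-≡ ((b , f) ∷ p) e with ≡-dec ℤ._≟_ f e
    ... | yes _   = coeff-removeExp-≡ p e
    ... | no  f≢e with ≡-dec ℤ._≟_ f e
    ...   | yes f≡e = ⊥-elim (f≢e f≡e)
    ...   | no  _   = coeff-removeExp-≡ p e

    coeff-removeExp-≢ : ∀ p {e m} → m ≢ e → coeff (removeExp e p) m ≈ coeff p m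
    coeff-removeExp-≢ []            m≢e = ≈-refl
    coeff-removeExp-≢ ((b , f) ∷ p) {e} {m} m≢e with ≡-dec ℤ._≟_ f e
    ... | yes refl with ≡-dec ℤ._≟_ f m
    ...   | yes refl = ⊥-elim (m≢e refl)
    ...   | no  _    = coeff-removeExp-≢ p m≢e
    coeff-removeExp-≢ ((b , f) ∷ p) {e} {m} m≢e | no _ with ≡-dec ℤ._≟_ f m
    ...   | yes _ = +-congˡ (coeff-removeExp-≢ p m≢e)
    ...   | no  _ = coeff-removeExp-≢ p m≢e

    length-removeExp : ∀ e p → List.length (removeExp e p) ℕ.≤ List.length p
    length-removeExp e []            = z≤n
    length-removeExp e ((b , f) ∷ p) with ≡-dec ℤ._≟_ f e
    ... | yes _ = ℕP.m≤n⇒m≤1+n (length-removeExp e p)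
    ... | no  _ = s≤s (length-removeExp e p)

    -- strip all terms carrying the exponent of the head; k bounds the length
    ≋[]⇒⟦⟧≈0 : ∀ k p → List.length p ℕ.≤ k → p ≋ [] → ∀ φ → ⟦ p ⟧ φ ≈ 0#
    ≋[]⇒⟦⟧≈0 k       []            _         _    φ = ≈-refl
    ≋[]⇒⟦⟧≈0 (suc k) ((a , e) ∷ p) (s≤s |p|≤k) p≋0 φ = begin
      a * φ e + ⟦ p ⟧ φ                                 ≈⟨ +-congˡ (⟦⟧-removeExp p e φ) ⟩
      a * φ e + (coeff p e * φ e + ⟦ removeExp e p ⟧ φ) ≈⟨ +-assoc _ _ _ ⟨
      (a * φ e + coeff p e * φ e) + ⟦ removeExp e p ⟧ φ ≈⟨ +-cong (sym (distribʳ (φ e) a _)) rest≈0 ⟩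
      (a + coeff p e) * φ e + 0#                        ≈⟨ +-identityʳ _ ⟩
      (a + coeff p e) * φ e                             ≈⟨ *-congʳ (trans (sym (coeff-head-≡ a p)) (p≋0 e)) ⟩
      0# * φ e                                          ≈⟨ zeroˡ _ ⟩
      0#                                                        ∎
      where
      open ≈-Reasoning
      coeff-head-≡ : ∀ a p → coeff ((a , e) ∷ p) e ≈ a + coeff p e
      coeff-head-≡ a p with ≡-dec ℤ._≟_ e e
      ... | yes _   = ≈-refl
      ... | no  e≢e = ⊥-elim (e≢e refl)
      coeff-head-≢ : ∀ {m} → m ≢ e → coeff ((a , e) ∷ p) m ≈ coeff p m
      coeff-head-≢ {m} m≢e with ≡-dec ℤ._≟_ e m
      ... | yes e≡m = ⊥-elim (m≢e (≡.sym e≡m))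
      ... | no  _   = ≈-refl
      rest≋0 : removeExp e p ≋ []
      rest≋0 m with ≡-dec ℤ._≟_ m e
      ... | yes refl = coeff-removeExp-≡ p m
      ... | no  m≢e  = trans (coeff-removeExp-≢ p m≢e) (trans (sym (coeff-head-≢ m≢e)) (p≋0 m))
      rest≈0 : ⟦ removeExp e p ⟧ φ ≈ 0#
      rest≈0 = ≋[]⇒⟦⟧≈0 k (removeExp e p) (ℕP.≤-trans (length-removeExp e p) |p|≤k) rest≋0 φ

    ≋⇒~ : ∀ {p q} → p ≋ q → p ~ q
    ≋⇒~ {p} {q} p≋q = mk~ λ φ → x∙y⁻¹≈ε⇒x≈y _ _ (trans (sym (⟦⟧-⊖ p q φ)) (≋[]⇒⟦⟧≈0 _ (p ⊖ q) ℕP.≤-refl p-q≋0 φ))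
      where
      p-q≋0 : p ⊖ q ≋ []
      p-q≋0 m = trans (coeff≈⟦⟧indicator (p ⊖ q) m)
                      (trans (⟦⟧-⊖ p q _) (x≈y⇒x∙y⁻¹≈ε (trans (sym (coeff≈⟦⟧indicator p m)) (trans (p≋q m) (coeff≈⟦⟧indicator q m)))))

    act-cong : ∀ σ {p q} → p ~ q → act σ p ~ act σ q
    act-cong σ {p} {q} p~q = mk~ λ φ → trans (⟦⟧-act σ p φ) (trans (at p~q (φ ∘ σ)) (sym (⟦⟧-act σ q φ)))

    act-ext : ∀ {σ τ} → (∀ e → σ e ≡ τ e) → ∀ p → act σ p ~ act τ p
    act-ext {σ} {τ} σ≗τ p = mk~ λ φ → trans (⟦⟧-act σ p φ) (trans (⟦⟧-cong p (λ e → ≡⇒≈ φ (σ≗τ e))) (sym (⟦⟧-act τ p φ)))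

    act-∘ : ∀ σ τ p → act σ (act τ p) ~ act (σ ∘ τ) p
    act-∘ σ τ p = mk~ λ φ → trans (⟦⟧-act σ (act τ p) φ) (trans (⟦⟧-act τ p (φ ∘ σ)) (sym (⟦⟧-act (σ ∘ τ) p φ)))

    act-⊕ : ∀ σ p q → act σ (p ⊕ q) ~ act σ p ⊕ act σ q
    act-⊕ σ p q = mk~ λ φ → begin
      ⟦ act σ (p ⊕ q) ⟧ φ           ≈⟨ trans (⟦⟧-act σ (p ⊕ q) φ) (⟦⟧-⊕ p q (φ ∘ σ)) ⟩
      ⟦ p ⟧ (φ ∘ σ) + ⟦ q ⟧ (φ ∘ σ) ≈⟨ +-cong (⟦⟧-act σ p φ) (⟦⟧-act σ q φ) ⟨
      ⟦ act σ p ⟧ φ + ⟦ act σ q ⟧ φ ≈⟨ ⟦⟧-⊕ (act σ p) (act σ q) φ ⟨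
      ⟦ act σ p ⊕ act σ q ⟧ φ           ∎
      where open ≈-Reasoning

    act-· : ∀ σ a p → act σ (a · p) ~ a · act σ p
    act-· σ a p = mk~ λ φ → begin
      ⟦ act σ (a · p) ⟧ φ ≈⟨ trans (⟦⟧-act σ (a · p) φ) (⟦⟧-· a p (φ ∘ σ)) ⟩
      a * ⟦ p ⟧ (φ ∘ σ)   ≈⟨ trans (*-congˡ (sym (⟦⟧-act σ p φ))) (sym (⟦⟧-· a (act σ p) φ)) ⟩
      ⟦ a · act σ p ⟧ φ     ∎
      where open ≈-Reasoning

    act-⊖ : ∀ σ p q → act σ (p ⊖ q) ~ act σ p ⊖ act σ q
    act-⊖ σ p q = L.trans (act-⊕ σ p (neg q)) (⊕-cong L.refl (act-· σ (- 1#) q))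

    module _ {σ : Exp n → Exp n} (σ-inv : IsLinearInvolution σ) where
      open IsLinearInvolution σ-inv

      act-⊛ : ∀ p q → act σ (p ⊛ q) ~ act σ p ⊛ act σ q
      act-⊛ p q = mk~ λ φ → begin
        ⟦ act σ (p ⊛ q) ⟧ φ                                ≈⟨ trans (⟦⟧-act σ (p ⊛ q) φ) (⟦⟧-⊛ p q (φ ∘ σ)) ⟩
        ⟦ p ⟧ (λ a → ⟦ q ⟧ (λ b → φ (σ (a +ᵉ b))))         ≈⟨ ⟦⟧-cong p (λ a → ⟦⟧-cong q (λ b → ≡⇒≈ φ (additive a b))) ⟩
        ⟦ p ⟧ (λ a → ⟦ q ⟧ (λ b → φ (σ a +ᵉ σ b)))         ≈⟨ ⟦⟧-cong p (λ a → ⟦⟧-act σ q _) ⟨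
        ⟦ p ⟧ (λ a → ⟦ act σ q ⟧ (λ b → φ (σ a +ᵉ b)))     ≈⟨ ⟦⟧-act σ p _ ⟨
        ⟦ act σ p ⟧ (λ a → ⟦ act σ q ⟧ (λ b → φ (a +ᵉ b))) ≈⟨ ⟦⟧-⊛ (act σ p) (act σ q) φ ⟨
        ⟦ act σ p ⊛ act σ q ⟧ φ                                      ∎
        where open ≈-Reasoning

      act-const : ∀ a → act σ (const a) ≡ const a
      act-const a = ≡.cong (λ e → (a , e) ∷ []) fixes-zeroE

      act-involutive : ∀ p → act σ (act σ p) ~ p
      act-involutive p = L.trans (act-∘ σ σ p) (mk~ λ φ → trans (⟦⟧-act (σ ∘ σ) p φ) (⟦⟧-cong p (λ e → ≡⇒≈ φ (involutive e))))

    -- Division by x^w (1 - x^d)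

    indicator-shift : ∀ m d a → indicator m (a +ᵉ d) ≈ indicator (m +ᵉ -ᵉ d) a
    indicator-shift m d a with ≡-dec ℤ._≟_ (a +ᵉ d) m | ≡-dec ℤ._≟_ a (m +ᵉ -ᵉ d)
    ... | yes _     | yes _   = ≈-refl
    ... | no  _     | no  _   = ≈-refl
    ... | yes refl  | no  a≢  = ⊥-elim (a≢ (≡.sym (begin
      (a +ᵉ d) +ᵉ -ᵉ d ≡⟨ +ᵉ-assoc a d (-ᵉ d) ⟩
      a +ᵉ (d +ᵉ -ᵉ d) ≡⟨ ≡.cong (a +ᵉ_) (+ᵉ-inverseʳ d) ⟩
      a +ᵉ zeroE       ≡⟨ +ᵉ-identityʳ a ⟩
      a                   ∎)))
      where open ≡.≡-Reasoning
    ... | no  a+d≢ | yes refl = ⊥-elim (a+d≢ (begin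
      (m +ᵉ -ᵉ d) +ᵉ d ≡⟨ +ᵉ-assoc m (-ᵉ d) d ⟩
      m +ᵉ (-ᵉ d +ᵉ d) ≡⟨ ≡.cong (m +ᵉ_) (+ᵉ-inverseˡ d) ⟩
      m +ᵉ zeroE       ≡⟨ +ᵉ-identityʳ m ⟩
      m                   ∎))
      where open ≡.≡-Reasoning

    -- If r (1 - x^d) = 0 then the coefficients of r are invariant under the shift by -d; when
    -- d_c < 0 such a shift eventually pushes every exponent out of the (finite) support of r.
    module _ {d : Exp n} {c : Fin n} {t : ℕ} (d-c : lookup d c ≡ -[1+ t ]) (r : LPoly n) (r[1-xᵈ]≈0 : r ⊛ (1L ⊖ xρ d) ~ []) where

      private
        coeff-shift : ∀ m → ⟦ r ⟧ (indicator m) ≈ ⟦ r ⟧ (indicator (m +ᵉ -ᵉ d))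
        coeff-shift m = x∙y⁻¹≈ε⇒x≈y _ _ (begin
          ⟦ r ⟧ (indicator m) - ⟦ r ⟧ (indicator (m +ᵉ -ᵉ d))                    ≈⟨ +-cong (⟦⟧-cong r (λ a → ≡⇒≈ (indicator m) (+ᵉ-identityʳ a))) (-‿cong (⟦⟧-cong r (indicator-shift m d))) ⟨
          ⟦ r ⟧ (λ a → indicator m (a +ᵉ zeroE)) - ⟦ r ⟧ (λ a → indicator m (a +ᵉ d)) ≈⟨ trans (⟦⟧-+ r _ _) (+-congˡ (⟦⟧-negate r _)) ⟨
          ⟦ r ⟧ (λ a → indicator m (a +ᵉ zeroE) - indicator m (a +ᵉ d))             ≈⟨ ⟦⟧-cong r (λ a → ⟦⟧-xρ⊖xρ zeroE d _) ⟨
          ⟦ r ⟧ (λ a → ⟦ 1L ⊖ xρ d ⟧ (λ b → indicator m (a +ᵉ b)))                 ≈⟨ ⟦⟧-⊛ r (1L ⊖ xρ d) (indicator m) ⟨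
          ⟦ r ⊛ (1L ⊖ xρ d) ⟧ (indicator m)                                          ≈⟨ at r[1-xᵈ]≈0 (indicator m) ⟩
          0#                                                                          ∎)
          where open ≈-Reasoning

        shiftBy : Exp n → ℕ → Exp n
        shiftBy m zero    = m
        shiftBy m (suc k) = shiftBy m k +ᵉ -ᵉ d

        coeff-shiftBy : ∀ m k → ⟦ r ⟧ (indicator m) ≈ ⟦ r ⟧ (indicator (shiftBy m k))
        coeff-shiftBy m zero    = ≈-refl
        coeff-shiftBy m (suc k) = trans (coeff-shiftBy m k) (coeff-shift (shiftBy m k))

        shiftBy-grows : ∀ m k → lookup m c ℤ.+ + k ℤ.≤ lookup (shiftBy m k) c
        shiftBy-grows m zero    = ℤP.≤-reflexive (ℤP.+-identityʳ _)
        shiftBy-grows m (suc k) = begin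
          lookup m c ℤ.+ + suc k                   ≡⟨ ≡.cong (λ w → lookup m c ℤ.+ w) (≡.trans (ℤP.pos-+ 1 k) (ℤP.+-comm (+ 1) (+ k))) ⟩
          lookup m c ℤ.+ (+ k ℤ.+ + 1)             ≡⟨ ℤP.+-assoc (lookup m c) (+ k) (+ 1) ⟨
          (lookup m c ℤ.+ + k) ℤ.+ + 1             ≤⟨ ℤP.+-mono-≤ (shiftBy-grows m k) (ℤ.+≤+ (s≤s z≤n)) ⟩
          lookup (shiftBy m k) c ℤ.+ + suc t       ≡⟨ ≡.cong (λ w → lookup (shiftBy m k) c ℤ.+ w)
                                                        (≡.sym (≡.trans (VecP.lookup-map c ℤ.-_ d) (≡.cong ℤ.-_ d-c))) ⟩
          lookup (shiftBy m k) c ℤ.+ lookup (-ᵉ d) c ≡⟨ lookup-+ᵉ (shiftBy m k) (-ᵉ d) c ⟨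
          lookup (shiftBy m (suc k)) c             ∎
          where open ℤP.≤-Reasoning

        spread : Exp n → LPoly n → ℕ
        spread m []            = 0
        spread m ((a , e) ∷ p) = ℤ.∣ lookup e c ℤ.- lookup m c ∣ ℕ.+ spread m p

        below-spread : ∀ m e → lookup e c ℤ.≤ lookup m c ℤ.+ + ℤ.∣ lookup e c ℤ.- lookup m c ∣
        below-spread m e = ℤP.≤-trans (ℤP.≤-reflexive (≡.sym (y+[x-y] (lookup e c) (lookup m c)))) (ℤP.+-monoʳ-≤ (lookup m c) (i≤∣i∣ _))
          where
          y+[x-y] : ∀ x y → y ℤ.+ (x ℤ.- y) ≡ x
          y+[x-y] = solve-∀
          i≤∣i∣ : ∀ i → i ℤ.≤ + ℤ.∣ i ∣
          i≤∣i∣ (+ _)    = ℤP.≤-refl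
          i≤∣i∣ -[1+ _ ] = ℤ.-≤+

        coeff-beyond-spread : ∀ m p bound → spread m p ℕ.≤ bound → ∀ m′ → lookup m c ℤ.+ + bound ℤ.< lookup m′ c → ⟦ p ⟧ (indicator m′) ≈ 0#
        coeff-beyond-spread m []            bound _ m′ _ = ≈-refl
        coeff-beyond-spread m ((a , e) ∷ p) bound spread≤bound m′ beyond = begin
          a * indicator m′ e + ⟦ p ⟧ (indicator m′) ≈⟨ +-cong (*-congˡ (indicator-≢ e≢m′)) (coeff-beyond-spread m p bound (ℕP.≤-trans (ℕP.m≤n+m _ _) spread≤bound) m′ beyond) ⟩
          a * 0# + 0#                               ≈⟨ trans (+-identityʳ _) (zeroʳ a) ⟩
          0#                                          ∎
          where
          open ≈-Reasoning
          e≢m′ : e ≢ m′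
          e≢m′ refl = ℤP.<-irrefl refl (ℤP.≤-<-trans (ℤP.≤-trans (below-spread m e)
                        (ℤP.+-monoʳ-≤ (lookup m c) (ℤ.+≤+ (ℕP.≤-trans (ℕP.m≤m+n _ _) spread≤bound)))) beyond)

      cancel-1-xᵈ : r ~ []
      cancel-1-xᵈ = ≋⇒~ λ m → trans (coeff≈⟦⟧indicator r m) (coeff-vanishes m)
        where
        coeff-vanishes : ∀ m → ⟦ r ⟧ (indicator m) ≈ 0#
        coeff-vanishes m = trans (coeff-shiftBy m K) (coeff-beyond-spread m r (spread m r) ℕP.≤-refl (shiftBy m K)
          (ℤP.<-≤-trans (ℤP.+-monoʳ-< (lookup m c) (ℤ.+<+ ℕP.≤-refl)) (shiftBy-grows m K)))
          where K = suc (spread m r)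

    module Lᴾ = RingProperties L.ring
    module L⁺ = CommutativeSemigroupProperties L.+-commutativeSemigroup
    module L* = CommutativeSemigroupProperties L.*-commutativeSemigroup

    xρ-⊛ : ∀ a b → xρ a ⊛ xρ b ~ xρ (a +ᵉ b)
    xρ-⊛ a b = mk~ λ φ → trans (⟦⟧-xρ⊛ a (xρ b) φ) (trans (⟦⟧-xρ b (λ e → φ (a +ᵉ e))) (sym (⟦⟧-xρ (a +ᵉ b) φ)))

    xρ-⊛-1-xρ : ∀ w d → xρ w ⊛ (1L ⊖ xρ d) ~ xρ w ⊖ xρ (w +ᵉ d)
    xρ-⊛-1-xρ w d = mk~ λ φ → begin
      ⟦ xρ w ⊛ (1L ⊖ xρ d) ⟧ φ    ≈⟨ trans (⟦⟧-xρ⊛ w (1L ⊖ xρ d) φ) (⟦⟧-xρ⊖xρ zeroE d _) ⟩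
      φ (w +ᵉ zeroE) - φ (w +ᵉ d) ≈⟨ +-congʳ (≡⇒≈ φ (+ᵉ-identityʳ w)) ⟩
      φ w - φ (w +ᵉ d)            ≈⟨ ⟦⟧-xρ⊖xρ w (w +ᵉ d) φ ⟨
      ⟦ xρ w ⊖ xρ (w +ᵉ d) ⟧ φ             ∎
      where open ≈-Reasoning

    cancel-xʷ[1-xᵈ] : ∀ {Den w d c t} → lookup d c ≡ -[1+ t ] → Den ~ xρ w ⊛ (1L ⊖ xρ d) → ∀ r → r ⊛ Den ~ [] → r ~ []
    cancel-xʷ[1-xᵈ] {Den} {w} {d} d-c Den≈ r rDen≈0 = begin
      r                      ≈⟨ L.*-identityʳ r ⟨
      r ⊛ 1L                 ≈⟨ ⊛-congˡ r (L.trans (L.reflexive (≡.cong xρ (≡.sym (+ᵉ-inverseʳ w)))) (L.sym (xρ-⊛ w (-ᵉ w)))) ⟩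
      r ⊛ (xρ w ⊛ xρ (-ᵉ w)) ≈⟨ L.*-assoc r (xρ w) (xρ (-ᵉ w)) ⟨
      (r ⊛ xρ w) ⊛ xρ (-ᵉ w) ≈⟨ ⊛-congʳ (xρ (-ᵉ w)) (cancel-1-xᵈ d-c (r ⊛ xρ w) rxʷ[1-xᵈ]≈0) ⟩
      [] ⊛ xρ (-ᵉ w)         ≈⟨ L.refl ⟩
      []                                 ∎
      where
      open ~-Reasoning
      rxʷ[1-xᵈ]≈0 : (r ⊛ xρ w) ⊛ (1L ⊖ xρ d) ~ []
      rxʷ[1-xᵈ]≈0 = L.trans (L.*-assoc r (xρ w) _) (L.trans (⊛-congˡ r (L.sym Den≈)) rDen≈0)

    ⊖-telescope : ∀ a b d → (a ⊖ b) ⊕ (b ⊖ d) ~ a ⊖ d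
    ⊖-telescope a b d = begin
      (a ⊖ b) ⊕ (b ⊖ d)     ≈⟨ L.+-assoc a (neg b) (b ⊖ d) ⟩
      a ⊕ (neg b ⊕ (b ⊖ d)) ≈⟨ ⊕-congˡ a (L.sym (L.+-assoc (neg b) b (neg d))) ⟩
      a ⊕ ((neg b ⊕ b) ⊖ d) ≈⟨ ⊕-congˡ a (⊕-congʳ (neg d) (L.-‿inverseˡ b)) ⟩
      a ⊕ ([] ⊖ d)          ≈⟨ L.refl ⟩
      a ⊖ d                      ∎
      where open ~-Reasoning

    geometric : Exp n → ℕ → LPoly n
    geometric d zero    = []
    geometric d (suc k) = 1L ⊕ xρ d ⊛ geometric d k

    geometric-telescopes : ∀ d k → geometric d k ⊛ (1L ⊖ xρ d) ~ 1L ⊖ xρ (+ k *ᵉ d)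
    geometric-telescopes d zero    = L.sym (L.trans (L.reflexive (≡.cong (λ e → 1L ⊖ xρ e) (*ᵉ-zeroˡ d))) (L.-‿inverseʳ 1L))
    geometric-telescopes d (suc k) = begin
      (1L ⊕ xρ d ⊛ geometric d k) ⊛ (1L ⊖ xρ d)               ≈⟨ L.distribʳ (1L ⊖ xρ d) 1L (xρ d ⊛ geometric d k) ⟩
      1L ⊛ (1L ⊖ xρ d) ⊕ (xρ d ⊛ geometric d k) ⊛ (1L ⊖ xρ d) ≈⟨ ⊕-cong (L.*-identityˡ (1L ⊖ xρ d)) (L.*-assoc (xρ d) (geometric d k) (1L ⊖ xρ d)) ⟩
      (1L ⊖ xρ d) ⊕ xρ d ⊛ (geometric d k ⊛ (1L ⊖ xρ d))      ≈⟨ ⊕-congˡ (1L ⊖ xρ d) (⊛-congˡ (xρ d) (geometric-telescopes d k)) ⟩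
      (1L ⊖ xρ d) ⊕ xρ d ⊛ (1L ⊖ xρ (+ k *ᵉ d))               ≈⟨ ⊕-congˡ (1L ⊖ xρ d) (xρ-⊛-1-xρ d (+ k *ᵉ d)) ⟩
      (1L ⊖ xρ d) ⊕ (xρ d ⊖ xρ (d +ᵉ + k *ᵉ d))               ≈⟨ ⊖-telescope 1L (xρ d) _ ⟩
      1L ⊖ xρ (d +ᵉ + k *ᵉ d)                                 ≡⟨ ≡.cong (λ e → 1L ⊖ xρ e) (*ᵉ-suc k d) ⟩
      1L ⊖ xρ (+ suc k *ᵉ d)                                      ∎
      where open ~-Reasoning

    -- Σ x^{j d} over 0 ≤ j < N, and −Σ x^{j d} over N ≤ j < 0
    geometricℤ : Exp n → ℤ → LPoly n
    geometricℤ d (+ k)    = geometric d k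
    geometricℤ d -[1+ k ] = neg (xρ (-ᵉ d) ⊛ geometric (-ᵉ d) (suc k))

    geometricℤ-telescopes : ∀ d N → geometricℤ d N ⊛ (1L ⊖ xρ d) ~ 1L ⊖ xρ (N *ᵉ d)
    geometricℤ-telescopes d (+ k)    = geometric-telescopes d k
    geometricℤ-telescopes d -[1+ k ] = begin
      neg (xρ (-ᵉ d) ⊛ G) ⊛ (1L ⊖ xρ d)    ≈⟨ ⊛-congʳ (1L ⊖ xρ d) (Lᴾ.-‿distribˡ-* (xρ (-ᵉ d)) G) ⟩
      (neg (xρ (-ᵉ d)) ⊛ G) ⊛ (1L ⊖ xρ d)  ≈⟨ L*.xy∙z≈y∙xz (neg (xρ (-ᵉ d))) G (1L ⊖ xρ d) ⟩
      G ⊛ (neg (xρ (-ᵉ d)) ⊛ (1L ⊖ xρ d))  ≈⟨ ⊛-congˡ G (L.sym (Lᴾ.-‿distribˡ-* (xρ (-ᵉ d)) (1L ⊖ xρ d))) ⟩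
      G ⊛ neg (xρ (-ᵉ d) ⊛ (1L ⊖ xρ d))    ≈⟨ ⊛-congˡ G (neg-cong (xρ-⊛-1-xρ (-ᵉ d) d)) ⟩
      G ⊛ neg (xρ (-ᵉ d) ⊖ xρ (-ᵉ d +ᵉ d)) ≈⟨ ⊛-congˡ G (Lᴾ.⁻¹-anti-homo‿- (xρ (-ᵉ d)) (xρ (-ᵉ d +ᵉ d))) ⟩
      G ⊛ (xρ (-ᵉ d +ᵉ d) ⊖ xρ (-ᵉ d))     ≡⟨ ≡.cong (λ e → G ⊛ (xρ e ⊖ xρ (-ᵉ d))) (+ᵉ-inverseˡ d) ⟩
      G ⊛ (1L ⊖ xρ (-ᵉ d))                 ≈⟨ geometric-telescopes (-ᵉ d) (suc k) ⟩
      1L ⊖ xρ (+ suc k *ᵉ -ᵉ d)            ≡⟨ ≡.cong (λ e → 1L ⊖ xρ e) (*ᵉ-neg k d) ⟩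
      1L ⊖ xρ (-[1+ k ] *ᵉ d)                      ∎
      where
      open ~-Reasoning
      G = geometric (-ᵉ d) (suc k)

    const⊛xρ : ∀ x a e → const a ⊛ xρ (x +ᵉ e) ~ xρ x ⊛ ((a , e) ∷ [])
    const⊛xρ x a e = mk~ λ φ → begin
      ⟦ const a ⊛ xρ (x +ᵉ e) ⟧ φ                ≈⟨ trans (⟦⟧-⊛ (const a) (xρ (x +ᵉ e)) φ) (+-identityʳ _) ⟩
      a * ⟦ xρ (x +ᵉ e) ⟧ (λ b → φ (zeroE +ᵉ b)) ≈⟨ *-congˡ (trans (⟦⟧-xρ (x +ᵉ e) (λ b → φ (zeroE +ᵉ b))) (≡⇒≈ φ (+ᵉ-identityˡ (x +ᵉ e)))) ⟩
      a * φ (x +ᵉ e)                             ≈⟨ trans (+-identityʳ _) (*-congʳ (*-identityˡ a)) ⟨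
      1# * a * φ (x +ᵉ e) + 0#             ∎
      where open ≈-Reasoning

    ⊖-interchange : ∀ p q r s → (p ⊕ q) ⊖ (r ⊕ s) ~ (p ⊖ r) ⊕ (q ⊖ s)
    ⊖-interchange p q r s = L.trans (⊕-congˡ (p ⊕ q) (L.sym (Lᴾ.-‿+-comm r s))) (L⁺.interchange p q (neg r) (neg s))

    numerator : LPoly n → LPoly n → (Exp n → Exp n) → LPoly n → LPoly n
    numerator X Y σ f = X ⊛ f ⊖ Y ⊛ act σ f

    numerator-⊕ : ∀ X Y σ f g → numerator X Y σ (f ⊕ g) ~ numerator X Y σ f ⊕ numerator X Y σ g
    numerator-⊕ X Y σ f g = L.trans (⊕-cong (L.distribˡ X f g) (neg-cong (L.trans (⊛-congˡ Y (act-⊕ σ f g)) (L.distribˡ Y (act σ f) (act σ g)))))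
                                    (⊖-interchange (X ⊛ f) (X ⊛ g) (Y ⊛ act σ f) (Y ⊛ act σ g))

    quotient-exists : ∀ X Y σ Den (q : Carrier → Exp n → LPoly n) → (∀ a e → q a e ⊛ Den ~ numerator X Y σ ((a , e) ∷ [])) →
                      ∀ f → Σ[ h ∈ LPoly n ] h ⊛ Den ~ numerator X Y σ f
    quotient-exists X Y σ Den q q-ok []            = [] , L.sym (L.trans (⊕-cong (L.zeroʳ X) (neg-cong (L.zeroʳ Y))) (L.-‿inverseʳ []))
    quotient-exists X Y σ Den q q-ok ((a , e) ∷ f) =
      let h , h-ok = quotient-exists X Y σ Den q q-ok f
      in q a e ⊕ h , L.trans (L.distribʳ Den (q a e) h) (L.trans (⊕-cong (q-ok a e) h-ok) (L.sym (numerator-⊕ X Y σ ((a , e) ∷ []) f)))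

    quotient-term : ∀ {Den w d} σ x y → Den ~ xρ w ⊛ (1L ⊖ xρ d) → ∀ a e N → y +ᵉ σ e ≡ (x +ᵉ e) +ᵉ N *ᵉ d →
                    (const a ⊛ (xρ ((x +ᵉ e) +ᵉ -ᵉ w) ⊛ geometricℤ d N)) ⊛ Den ~ numerator (xρ x) (xρ y) σ ((a , e) ∷ [])
    quotient-term {Den} {w} {d} σ x y Den≈ a e N shift = begin
      (const a ⊛ (M ⊛ G)) ⊛ Den                         ≈⟨ L.*-assoc (const a) (M ⊛ G) Den ⟩
      const a ⊛ ((M ⊛ G) ⊛ Den)                         ≈⟨ ⊛-congˡ (const a) (L.trans (⊛-congˡ (M ⊛ G) Den≈) (L*.interchange M G (xρ w) (1L ⊖ xρ d))) ⟩
      const a ⊛ ((M ⊛ xρ w) ⊛ (G ⊛ (1L ⊖ xρ d)))        ≈⟨ ⊛-congˡ (const a) (⊛-cong (L.trans (xρ-⊛ _ w) (L.reflexive (≡.cong xρ M+w))) (geometricℤ-telescopes d N)) ⟩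
      const a ⊛ (xρ (x +ᵉ e) ⊛ (1L ⊖ xρ (N *ᵉ d)))      ≈⟨ ⊛-congˡ (const a) (xρ-⊛-1-xρ (x +ᵉ e) (N *ᵉ d)) ⟩
      const a ⊛ (xρ (x +ᵉ e) ⊖ xρ ((x +ᵉ e) +ᵉ N *ᵉ d)) ≡⟨ ≡.cong (λ u → const a ⊛ (xρ (x +ᵉ e) ⊖ xρ u)) (≡.sym shift) ⟩
      const a ⊛ (xρ (x +ᵉ e) ⊖ xρ (y +ᵉ σ e))           ≈⟨ Lᴾ.x[y-z]≈xy-xz (const a) (xρ (x +ᵉ e)) (xρ (y +ᵉ σ e)) ⟩
      const a ⊛ xρ (x +ᵉ e) ⊖ const a ⊛ xρ (y +ᵉ σ e)   ≈⟨ ⊕-cong (const⊛xρ x a e) (neg-cong (const⊛xρ y a (σ e))) ⟩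
      numerator (xρ x) (xρ y) σ ((a , e) ∷ [])            ∎
      where
      open ~-Reasoning
      M = xρ ((x +ᵉ e) +ᵉ -ᵉ w)
      G = geometricℤ d N
      M+w : ((x +ᵉ e) +ᵉ -ᵉ w) +ᵉ w ≡ x +ᵉ e
      M+w = ≡.trans (+ᵉ-assoc (x +ᵉ e) (-ᵉ w) w) (≡.trans (≡.cong ((x +ᵉ e) +ᵉ_) (+ᵉ-inverseˡ w)) (+ᵉ-identityʳ (x +ᵉ e)))

    -- Self-adjoint divided differences

    -- f π = (X f - Y f^σ) / Den, paired by ⟨ f , g ⟩ = ⟦ f g Den W′ ⟧ Φ, where Den W′ is the weight x^ρ Δ of
    -- the scalar product; ε is the cocycle σ(Den) = -ε Den.
    record DividedDifference : Set (c ⊔ ℓ) where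
      field
        σ                    : Exp n → Exp n
        σ-isLinearInvolution : IsLinearInvolution σ
        X Y Den W′ ε ε⁻¹      : LPoly n
        Φ                    : Exp n → Carrier
        ε⁻¹⊛ε                : ε⁻¹ ⊛ ε ~ 1L
        Den-σ                : act σ Den ~ neg (ε ⊛ Den)
        X-σ                  : act σ X ~ ε ⊛ Y
        Y-σ                  : act σ Y ~ ε ⊛ X
        Den≈X-Y              : Den ~ X ⊖ Y
        Den-cancel           : ∀ r → r ⊛ Den ~ [] → r ~ []
        Y-twisted-symmetric  : ∀ a b → ⟦ ((Y ⊛ act σ a) ⊛ b) ⊛ W′ ⟧ Φ ≈ ⟦ ((Y ⊛ a) ⊛ act σ b) ⊛ W′ ⟧ Φ
        quotient             : ∀ f → Σ[ h ∈ LPoly n ] h ⊛ Den ~ numerator X Y σ f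

      IsπOf : LPoly n → LPoly n → Set (c ⊔ ℓ)
      IsπOf h f = h ⊛ Den ~ numerator X Y σ f

      ⟨_,_⟩ : LPoly n → LPoly n → Carrier
      ⟨ f , g ⟩ = ⟦ (f ⊛ g) ⊛ (Den ⊛ W′) ⟧ Φ

      ⟨⟩-distribʳ : ∀ f g g′ → ⟨ f , g ⊕ g′ ⟩ ≈ ⟨ f , g ⟩ + ⟨ f , g′ ⟩
      ⟨⟩-distribʳ f g g′ = trans (at (L.trans (⊛-congʳ (Den ⊛ W′) (L.distribˡ f g g′)) (L.distribʳ (Den ⊛ W′) (f ⊛ g) (f ⊛ g′))) Φ)
                                 (⟦⟧-⊕ ((f ⊛ g) ⊛ (Den ⊛ W′)) ((f ⊛ g′) ⊛ (Den ⊛ W′)) Φ)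

      ⟨⟩-via-Den : ∀ h g → ⟨ h , g ⟩ ≈ ⟦ ((h ⊛ Den) ⊛ g) ⊛ W′ ⟧ Φ
      ⟨⟩-via-Den h g = at (L.trans (L.sym (L.*-assoc (h ⊛ g) Den W′)) (⊛-congʳ W′ (L*.xy∙z≈xz∙y h g Den))) Φ

      ⟦⟧-numerator : ∀ f g → ⟦ (numerator X Y σ f ⊛ g) ⊛ W′ ⟧ Φ ≈ ⟦ ((X ⊛ f) ⊛ g) ⊛ W′ ⟧ Φ - ⟦ ((Y ⊛ act σ f) ⊛ g) ⊛ W′ ⟧ Φ
      ⟦⟧-numerator f g = trans (at (L.trans (⊛-congʳ W′ (Lᴾ.[y-z]x≈yx-zx g (X ⊛ f) (Y ⊛ act σ f))) (Lᴾ.[y-z]x≈yx-zx W′ ((X ⊛ f) ⊛ g) ((Y ⊛ act σ f) ⊛ g))) Φ)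
                               (⟦⟧-⊖ (((X ⊛ f) ⊛ g) ⊛ W′) (((Y ⊛ act σ f) ⊛ g) ⊛ W′) Φ)

      π-self-adjoint : ∀ {f h g k} → IsπOf h f → IsπOf k g → ⟨ h , g ⟩ ≈ ⟨ f , k ⟩
      π-self-adjoint {f} {h} {g} {k} h=fπ k=gπ = begin
        ⟨ h , g ⟩                                                 ≈⟨ ⟨⟩-via-Den h g ⟩
        ⟦ ((h ⊛ Den) ⊛ g) ⊛ W′ ⟧ Φ                                ≈⟨ at (⊛-congʳ W′ (⊛-congʳ g h=fπ)) Φ ⟩
        ⟦ (numerator X Y σ f ⊛ g) ⊛ W′ ⟧ Φ                        ≈⟨ ⟦⟧-numerator f g ⟩
        ⟦ ((X ⊛ f) ⊛ g) ⊛ W′ ⟧ Φ - ⟦ ((Y ⊛ act σ f) ⊛ g) ⊛ W′ ⟧ Φ ≈⟨ +-cong (at (⊛-congʳ W′ (L*.xy∙z≈xz∙y X f g)) Φ)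
                                                                                             (-‿cong (trans (Y-twisted-symmetric f g) (at (⊛-congʳ W′ (L*.xy∙z≈xz∙y Y f (act σ g))) Φ))) ⟩
        ⟦ ((X ⊛ g) ⊛ f) ⊛ W′ ⟧ Φ - ⟦ ((Y ⊛ act σ g) ⊛ f) ⊛ W′ ⟧ Φ ≈⟨ ⟦⟧-numerator g f ⟨
        ⟦ (numerator X Y σ g ⊛ f) ⊛ W′ ⟧ Φ                        ≈⟨ at (⊛-congʳ W′ (⊛-congʳ f k=gπ)) Φ ⟨
        ⟦ ((k ⊛ Den) ⊛ f) ⊛ W′ ⟧ Φ                                ≈⟨ ⟨⟩-via-Den k f ⟨
        ⟨ k , f ⟩                                                 ≈⟨ at (⊛-congʳ (Den ⊛ W′) (L.*-comm k f)) Φ ⟩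
        ⟨ f , k ⟩                                                                      ∎
        where open ≈-Reasoning


      act-numerator : ∀ f → act σ (numerator X Y σ f) ~ neg (ε ⊛ numerator X Y σ f)
      act-numerator f = begin
        act σ (X ⊛ f ⊖ Y ⊛ act σ f)                   ≈⟨ act-⊖ σ (X ⊛ f) (Y ⊛ act σ f) ⟩
        act σ (X ⊛ f) ⊖ act σ (Y ⊛ act σ f)           ≈⟨ ⊕-cong (act-⊛ σ-isLinearInvolution X f) (neg-cong (act-⊛ σ-isLinearInvolution Y (act σ f))) ⟩
        act σ X ⊛ act σ f ⊖ act σ Y ⊛ act σ (act σ f) ≈⟨ ⊕-cong (⊛-congʳ (act σ f) X-σ) (neg-cong (⊛-cong Y-σ (act-involutive σ-isLinearInvolution f))) ⟩
        (ε ⊛ Y) ⊛ act σ f ⊖ (ε ⊛ X) ⊛ f               ≈⟨ ⊕-cong (L.*-assoc ε Y (act σ f)) (neg-cong (L.*-assoc ε X f)) ⟩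
        ε ⊛ (Y ⊛ act σ f) ⊖ ε ⊛ (X ⊛ f)               ≈⟨ Lᴾ.x[y-z]≈xy-xz ε (Y ⊛ act σ f) (X ⊛ f) ⟨
        ε ⊛ (Y ⊛ act σ f ⊖ X ⊛ f)                     ≈⟨ ⊛-congˡ ε (Lᴾ.⁻¹-anti-homo‿- (X ⊛ f) (Y ⊛ act σ f)) ⟨
        ε ⊛ neg (X ⊛ f ⊖ Y ⊛ act σ f)                 ≈⟨ Lᴾ.-‿distribʳ-* ε (X ⊛ f ⊖ Y ⊛ act σ f) ⟨
        neg (ε ⊛ (X ⊛ f ⊖ Y ⊛ act σ f))                      ∎
        where open ~-Reasoning

      cancel-ε : ∀ {p q} → ε ⊛ p ~ ε ⊛ q → p ~ q
      cancel-ε {p} {q} εp≈εq = begin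
        p             ≈⟨ L.*-identityˡ p ⟨
        1L ⊛ p        ≈⟨ ⊛-congʳ p ε⁻¹⊛ε ⟨
        (ε⁻¹ ⊛ ε) ⊛ p ≈⟨ L.*-assoc ε⁻¹ ε p ⟩
        ε⁻¹ ⊛ (ε ⊛ p) ≈⟨ ⊛-congˡ ε⁻¹ εp≈εq ⟩
        ε⁻¹ ⊛ (ε ⊛ q) ≈⟨ L.*-assoc ε⁻¹ ε q ⟨
        (ε⁻¹ ⊛ ε) ⊛ q ≈⟨ ⊛-congʳ q ε⁻¹⊛ε ⟩
        1L ⊛ q        ≈⟨ L.*-identityˡ q ⟩
        q                  ∎
        where open ~-Reasoning

      cancel-Den : ∀ {p q} → p ⊛ Den ~ q ⊛ Den → p ~ q
      cancel-Den {p} {q} pDen≈qDen = Lᴾ.x∙y⁻¹≈ε⇒x≈y p q (Den-cancel (p ⊖ q)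
        (L.trans (Lᴾ.[y-z]x≈yx-zx Den p q) (Lᴾ.x≈y⇒x∙y⁻¹≈ε pDen≈qDen)))

      -- f π is σ-invariant: σ multiplies both h Den and the numerator by -ε.
      π-invariant : ∀ {f h} → IsπOf h f → act σ h ~ h
      π-invariant {f} {h} h=fπ = cancel-Den (cancel-ε (Lᴾ.-‿injective (begin
        neg (ε ⊛ (act σ h ⊛ Den))   ≈⟨ neg-cong (L*.x∙yz≈y∙xz ε (act σ h) Den) ⟩
        neg (act σ h ⊛ (ε ⊛ Den))   ≈⟨ Lᴾ.-‿distribʳ-* (act σ h) (ε ⊛ Den) ⟩
        act σ h ⊛ neg (ε ⊛ Den)     ≈⟨ ⊛-congˡ (act σ h) Den-σ ⟨
        act σ h ⊛ act σ Den         ≈⟨ act-⊛ σ-isLinearInvolution h Den ⟨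
        act σ (h ⊛ Den)             ≈⟨ act-cong σ h=fπ ⟩
        act σ (numerator X Y σ f)   ≈⟨ act-numerator f ⟩
        neg (ε ⊛ numerator X Y σ f) ≈⟨ neg-cong (⊛-congˡ ε h=fπ) ⟨
        neg (ε ⊛ (h ⊛ Den))                ∎)))
        where open ~-Reasoning

      π-idempotent : ∀ {f h} → IsπOf h f → IsπOf h h
      π-idempotent {f} {h} h=fπ = begin
        h ⊛ Den                     ≈⟨ ⊛-congˡ h Den≈X-Y ⟩
        h ⊛ (X ⊖ Y)                 ≈⟨ Lᴾ.x[y-z]≈xy-xz h X Y ⟩
        h ⊛ X ⊖ h ⊛ Y               ≈⟨ ⊕-cong (L.*-comm h X) (neg-cong (L.trans (L.*-comm h Y) (⊛-congˡ Y (L.sym (π-invariant {f} {h} h=fπ))))) ⟩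
        X ⊛ h ⊖ Y ⊛ act σ h      ∎
        where open ~-Reasoning

      ⟨⟩-π̂ : ∀ {f h g₁ g₂} → IsπOf h f → IsπOf (g₂ ⊕ g₁) g₁ → ⟨ f , g₂ ⟩ ≈ ⟨ h , g₁ ⟩ - ⟨ f , g₁ ⟩
      ⟨⟩-π̂ {f} {h} {g₁} {g₂} h=fπ g₂+g₁=g₁π = begin
        ⟨ f , g₂ ⟩                             ≈⟨ +-identityʳ _ ⟨
        ⟨ f , g₂ ⟩ + 0#                        ≈⟨ +-congˡ (-‿inverseʳ _) ⟨
        ⟨ f , g₂ ⟩ + (⟨ f , g₁ ⟩ - ⟨ f , g₁ ⟩) ≈⟨ +-assoc _ _ _ ⟨
        (⟨ f , g₂ ⟩ + ⟨ f , g₁ ⟩) - ⟨ f , g₁ ⟩ ≈⟨ +-congʳ (⟨⟩-distribʳ f g₂ g₁) ⟨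
        ⟨ f , g₂ ⊕ g₁ ⟩ - ⟨ f , g₁ ⟩           ≈⟨ +-congʳ (π-self-adjoint {f} {h} {g₁} {g₂ ⊕ g₁} h=fπ g₂+g₁=g₁π) ⟨
        ⟨ h , g₁ ⟩ - ⟨ f , g₁ ⟩                        ∎
        where open ≈-Reasoning

      dual-pair : ∀ {f₁ f₂ g₁ g₂} → IsπOf f₂ f₁ → IsπOf (g₂ ⊕ g₁) g₁ → ⟨ f₁ , g₁ ⟩ ≈ 0# → ⟨ f₂ , g₁ ⟩ ≈ 1# →
                  (⟨ f₁ , g₂ ⟩ ≈ 1#) × (⟨ f₂ , g₂ ⟩ ≈ 0#)
      dual-pair {f₁} {f₂} {g₁} {g₂} f₂=f₁π g₂+g₁=g₁π ⟨f₁,g₁⟩≈0 ⟨f₂,g₁⟩≈1 =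
        trans (⟨⟩-π̂ {f₁} {f₂} {g₁} {g₂} f₂=f₁π g₂+g₁=g₁π) (trans (+-cong ⟨f₂,g₁⟩≈1 (trans (-‿cong ⟨f₁,g₁⟩≈0) -0#≈0#)) (+-identityʳ 1#)) ,
        trans (⟨⟩-π̂ {f₂} {f₂} {g₁} {g₂} (π-idempotent {f₁} {f₂} f₂=f₁π) g₂+g₁=g₁π) (-‿inverseʳ _)

      orthogonal-π̂ : ∀ {f h g₁ g₂} → IsπOf h f → IsπOf (g₂ ⊕ g₁) g₁ → ⟨ h , g₁ ⟩ ≈ 0# → ⟨ f , g₁ ⟩ ≈ 0# → ⟨ f , g₂ ⟩ ≈ 0#
      orthogonal-π̂ {f} {h} {g₁} {g₂} h=fπ g₂+g₁=g₁π ⟨h,g₁⟩≈0 ⟨f,g₁⟩≈0 =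
        trans (⟨⟩-π̂ {f} {h} {g₁} {g₂} h=fπ g₂+g₁=g₁π) (trans (+-cong ⟨h,g₁⟩≈0 (trans (-‿cong ⟨f,g₁⟩≈0) -0#≈0#)) (+-identityʳ 0#))

    ⟦⟧-act-invariant : ∀ {σ} {Φ : Exp n → Carrier} → (∀ e → Φ (σ e) ≈ Φ e) → ∀ p → ⟦ act σ p ⟧ Φ ≈ ⟦ p ⟧ Φ
    ⟦⟧-act-invariant {σ} {Φ} Φ-σ p = trans (⟦⟧-act σ p Φ) (⟦⟧-cong p Φ-σ)

    twisted-symmetric : ∀ {σ} → IsLinearInvolution σ → ∀ {Φ} → (∀ e → Φ (σ e) ≈ Φ e) →
                        ∀ Y W′ → act σ (Y ⊛ W′) ~ Y ⊛ W′ →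
                        ∀ a b → ⟦ ((Y ⊛ act σ a) ⊛ b) ⊛ W′ ⟧ Φ ≈ ⟦ ((Y ⊛ a) ⊛ act σ b) ⊛ W′ ⟧ Φ
    twisted-symmetric {σ} σ-inv {Φ} Φ-σ Y W′ YW′-σ a b = begin
      ⟦ ((Y ⊛ act σ a) ⊛ b) ⊛ W′ ⟧ Φ         ≈⟨ at (regroup (act σ a) b) Φ ⟩
      ⟦ (act σ a ⊛ b) ⊛ (Y ⊛ W′) ⟧ Φ         ≈⟨ at (act-swaps) Φ ⟨
      ⟦ act σ ((a ⊛ act σ b) ⊛ (Y ⊛ W′)) ⟧ Φ ≈⟨ ⟦⟧-act-invariant Φ-σ ((a ⊛ act σ b) ⊛ (Y ⊛ W′)) ⟩
      ⟦ (a ⊛ act σ b) ⊛ (Y ⊛ W′) ⟧ Φ         ≈⟨ at (regroup a (act σ b)) Φ ⟨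
      ⟦ ((Y ⊛ a) ⊛ act σ b) ⊛ W′ ⟧ Φ            ∎
      where
      open ≈-Reasoning
      regroup : ∀ p q → ((Y ⊛ p) ⊛ q) ⊛ W′ ~ (p ⊛ q) ⊛ (Y ⊛ W′)
      regroup p q = L.trans (⊛-congʳ W′ (L.trans (L.*-assoc Y p q) (L.*-comm Y (p ⊛ q)))) (L.*-assoc (p ⊛ q) Y W′)
      act-swaps : act σ ((a ⊛ act σ b) ⊛ (Y ⊛ W′)) ~ (act σ a ⊛ b) ⊛ (Y ⊛ W′)
      act-swaps = L.trans (act-⊛ σ-inv (a ⊛ act σ b) (Y ⊛ W′))
                  (⊛-cong (L.trans (act-⊛ σ-inv a (act σ b)) (⊛-congˡ (act σ a) (act-involutive σ-inv b))) YW′-σ)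

    -- The factorisation of Δ

    ∏ : ∀ {m} → (Fin m → LPoly n) → LPoly n
    ∏ {zero}  h = 1L
    ∏ {suc m} h = h zero ⊛ ∏ (h ∘ suc)

    prodL-allFin : ∀ {m} (h : Fin m → LPoly n) → prodL (List.map h (List.allFin m)) ≡ ∏ h
    prodL-allFin h = ≡.trans (≡.cong prodL (ListP.map-tabulate (λ k → k) h)) (prodL-tabulate h)
      where
      prodL-tabulate : ∀ {m} (h : Fin m → LPoly n) → prodL (List.tabulate h) ≡ ∏ h
      prodL-tabulate {zero}  h = refl
      prodL-tabulate {suc m} h = ≡.cong (h zero ⊛_) (prodL-tabulate (h ∘ suc))

    ∏-cong : ∀ {m} {h g : Fin m → LPoly n} → (∀ k → h k ~ g k) → ∏ h ~ ∏ g
    ∏-cong {zero}  h≈g = L.refl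
    ∏-cong {suc m} h≈g = ⊛-cong (h≈g zero) (∏-cong (h≈g ∘ suc))

    ∏-swapSuc : ∀ {m} (i : Fin m) (h : Fin m → LPoly n) → ∏ (h ∘ swapSuc i) ~ ∏ h
    ∏-swapSuc {suc zero}    zero    h = L.refl
    ∏-swapSuc {suc (suc m)} zero    h = L*.x∙yz≈y∙xz (h (suc zero)) (h zero) (∏ (λ k → h (suc (suc k))))
    ∏-swapSuc {suc (suc m)} (suc i) h = ⊛-congˡ (h zero) (∏-swapSuc i (h ∘ suc))

    act-∏ : ∀ {σ} → IsLinearInvolution σ → ∀ {m} (h : Fin m → LPoly n) → act σ (∏ h) ~ ∏ (act σ ∘ h)
    act-∏ σ-inv {zero}  h = L.reflexive (act-const σ-inv 1#)
    act-∏ {σ} σ-inv {suc m} h = L.trans (act-⊛ σ-inv (h zero) (∏ (h ∘ suc))) (⊛-congˡ (act σ (h zero)) (act-∏ σ-inv (h ∘ suc)))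

    without : ∀ {m} → Fin m → (Fin m → LPoly n) → Fin m → LPoly n
    without a h k with k Fin.≟ a
    ... | yes _ = 1L
    ... | no  _ = h k

    without-≡ : ∀ {m} (a : Fin m) h → without a h a ≡ 1L
    without-≡ a h with a Fin.≟ a
    ... | yes _   = refl
    ... | no  a≢a = ⊥-elim (a≢a refl)

    without-≢ : ∀ {m} {a k : Fin m} h → k ≢ a → without a h k ≡ h k
    without-≢ {a = a} {k} h k≢a with k Fin.≟ a
    ... | yes k≡a = ⊥-elim (k≢a k≡a)
    ... | no  _   = refl

    without-suc : ∀ {m} (a k : Fin m) h → without (suc a) h (suc k) ≡ without a (h ∘ suc) k
    without-suc a k h with k Fin.≟ a
    ... | yes refl = refl
    ... | no  _    = refl

    ∏-extract : ∀ {m} (a : Fin m) h → ∏ h ~ h a ⊛ ∏ (without a h)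
    ∏-extract {suc m} zero    h = ⊛-congˡ (h zero) (L.sym (L.*-identityˡ (∏ (h ∘ suc))))
    ∏-extract {suc m} (suc a) h = begin
      h zero ⊛ ∏ (h ∘ suc)                           ≈⟨ ⊛-congˡ (h zero) (∏-extract a (h ∘ suc)) ⟩
      h zero ⊛ (h (suc a) ⊛ ∏ (without a (h ∘ suc))) ≈⟨ L*.x∙yz≈y∙xz (h zero) (h (suc a)) _ ⟩
      h (suc a) ⊛ (h zero ⊛ ∏ (without a (h ∘ suc))) ≈⟨ ⊛-congˡ (h (suc a)) (⊛-congˡ (h zero) (∏-cong λ k → L.reflexive (without-suc a k h))) ⟨
      h (suc a) ⊛ (h zero ⊛ ∏ (without (suc a) h ∘ suc))     ∎
      where open ~-Reasoning

    var-⊛-ivar : ∀ k → var k ⊛ ivar k ~ 1L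
    var-⊛-ivar k = L.trans (xρ-⊛ (unit k (+ 1)) (unit k -[1+ 0 ])) (L.reflexive (≡.cong xρ (≡.trans (unit-+ᵉ k (+ 1) -[1+ 0 ]) (unit-zero k))))

    ΔFactor : Fin n → Fin n → LPoly n
    ΔFactor k l = (var k ⊖ var l) ⊛ (1L ⊖ ivar k ⊛ ivar l)

    x+x⁻¹ : Fin n → LPoly n
    x+x⁻¹ k = var k ⊕ ivar k

    -- This makes Δ visibly invariant under every inversion x_a ↦ x_a^{-1}.
    ΔFactor≈x+x⁻¹-x+x⁻¹ : ∀ k l → ΔFactor k l ~ x+x⁻¹ k ⊖ x+x⁻¹ l
    ΔFactor≈x+x⁻¹-x+x⁻¹ k l = begin
      (var k ⊖ var l) ⊛ (1L ⊖ ivar k ⊛ ivar l)                                  ≈⟨ Lᴾ.x[y-z]≈xy-xz (var k ⊖ var l) 1L (ivar k ⊛ ivar l) ⟩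
      (var k ⊖ var l) ⊛ 1L ⊖ (var k ⊖ var l) ⊛ (ivar k ⊛ ivar l)                ≈⟨ ⊕-cong (L.*-identityʳ (var k ⊖ var l)) (neg-cong (Lᴾ.[y-z]x≈yx-zx (ivar k ⊛ ivar l) (var k) (var l))) ⟩
      (var k ⊖ var l) ⊖ (var k ⊛ (ivar k ⊛ ivar l) ⊖ var l ⊛ (ivar k ⊛ ivar l)) ≈⟨ ⊕-congˡ (var k ⊖ var l) (neg-cong (⊕-cong cancel-k (neg-cong cancel-l))) ⟩
      (var k ⊖ var l) ⊖ (ivar l ⊖ ivar k)                                       ≈⟨ ⊕-congˡ (var k ⊖ var l) (Lᴾ.⁻¹-anti-homo‿- (ivar l) (ivar k)) ⟩
      (var k ⊖ var l) ⊕ (ivar k ⊖ ivar l)                                       ≈⟨ ⊖-interchange (var k) (ivar k) (var l) (ivar l) ⟨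
      x+x⁻¹ k ⊖ x+x⁻¹ l                                                           ∎
      where
      open ~-Reasoning
      cancel-k : var k ⊛ (ivar k ⊛ ivar l) ~ ivar l
      cancel-k = L.trans (L.sym (L.*-assoc (var k) (ivar k) (ivar l))) (L.trans (⊛-congʳ (ivar l) (var-⊛-ivar k)) (L.*-identityˡ (ivar l)))
      cancel-l : var l ⊛ (ivar k ⊛ ivar l) ~ ivar k
      cancel-l = L.trans (L*.x∙yz≈y∙xz (var l) (ivar k) (ivar l)) (L.trans (⊛-congˡ (ivar k) (var-⊛-ivar l)) (L.*-identityʳ (ivar k)))

    -- `pairs` is built from a local function of Defs; unification recovers it.
    pairs-unfolded : Σ[ pairsAt ∈ (Fin n → Fin n → List (Fin n × Fin n)) ]
                     pairs ≡ List.concatMap (λ k → List.concatMap (pairsAt k) (List.allFin n)) (List.allFin n)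
    pairs-unfolded = _ , refl

    pairsAt : Fin n → Fin n → List (Fin n × Fin n)
    pairsAt = proj₁ pairs-unfolded

    pairsAt-< : ∀ k l → toℕ k ℕ.< toℕ l → pairsAt k l ≡ (k , l) ∷ []
    pairsAt-< k l k<l with toℕ k ℕ.<? toℕ l
    ... | yes _   = refl
    ... | no  k≮l = ⊥-elim (k≮l k<l)

    pairsAt-≮ : ∀ k l → ¬ toℕ k ℕ.< toℕ l → pairsAt k l ≡ []
    pairsAt-≮ k l k≮l with toℕ k ℕ.<? toℕ l
    ... | yes k<l = ⊥-elim (k≮l k<l)
    ... | no  _   = refl

    Δentry : Fin n → Fin n → LPoly n
    Δentry k l = prodL (List.map (λ kl → ΔFactor (proj₁ kl) (proj₂ kl)) (pairsAt k l))

    Δentry-< : ∀ {k l} → toℕ k ℕ.< toℕ l → Δentry k l ~ ΔFactor k l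
    Δentry-< {k} {l} k<l = L.trans (L.reflexive (≡.cong (λ ps → prodL (List.map _ ps)) (pairsAt-< k l k<l))) (L.*-identityʳ (ΔFactor k l))

    Δentry-≮ : ∀ {k l} → ¬ toℕ k ℕ.< toℕ l → Δentry k l ≡ 1L
    Δentry-≮ {k} {l} k≮l = ≡.cong (λ ps → prodL (List.map _ ps)) (pairsAt-≮ k l k≮l)

    prodL-concatMap : ∀ {A B : Set} (F : A → LPoly n) (g : B → List A) xs →
                      prodL (List.map F (List.concatMap g xs)) ~ prodL (List.map (λ x → prodL (List.map F (g x))) xs)
    prodL-concatMap F g []       = L.refl
    prodL-concatMap F g (x ∷ xs) = begin
      prodL (List.map F (g x ++ List.concatMap g xs))                     ≡⟨ ≡.cong prodL (ListP.map-++ F (g x) _) ⟩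
      prodL (List.map F (g x) ++ List.map F (List.concatMap g xs))        ≈⟨ prodL-++ (List.map F (g x)) _ ⟩
      prodL (List.map F (g x)) ⊛ prodL (List.map F (List.concatMap g xs)) ≈⟨ ⊛-congˡ (prodL (List.map F (g x))) (prodL-concatMap F g xs) ⟩
      prodL (List.map F (g x)) ⊛ prodL (List.map (λ x → prodL (List.map F (g x))) xs) ∎
      where
      open ~-Reasoning
      prodL-++ : ∀ ps qs → prodL (ps ++ qs) ~ prodL ps ⊛ prodL qs
      prodL-++ []       qs = L.sym (L.*-identityˡ (prodL qs))
      prodL-++ (p ∷ ps) qs = L.trans (⊛-congˡ p (prodL-++ ps qs)) (L.sym (L.*-assoc p (prodL ps) (prodL qs)))

    Δ≈∏∏Δentry : Δpairs ~ ∏ (λ k → ∏ (Δentry k))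
    Δ≈∏∏Δentry = begin
      Δpairs                                                                                                 ≡⟨ ≡.cong (λ ps → prodL (List.map F ps)) (proj₂ pairs-unfolded) ⟩
      prodL (List.map F (List.concatMap (λ k → List.concatMap (pairsAt k) (List.allFin n)) (List.allFin n))) ≈⟨ prodL-concatMap F _ (List.allFin n) ⟩
      prodL (List.map (λ k → prodL (List.map F (List.concatMap (pairsAt k) (List.allFin n)))) (List.allFin n))
                                                                                         ≡⟨ prodL-allFin (λ k → prodL (List.map F (List.concatMap (pairsAt k) (List.allFin n)))) ⟩
      ∏ (λ k → prodL (List.map F (List.concatMap (pairsAt k) (List.allFin n))))                              ≈⟨ ∏-cong (λ k → L.trans (prodL-concatMap F (pairsAt k) (List.allFin n)) (L.reflexive (prodL-allFin (Δentry k)))) ⟩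
      ∏ (λ k → ∏ (Δentry k))                                                             ∎
      where
      open ~-Reasoning
      F : Fin n × Fin n → LPoly n
      F kl = ΔFactor (proj₁ kl) (proj₂ kl)

    x+x⁻¹-invE : ∀ a k → act (invE a) (x+x⁻¹ k) ~ x+x⁻¹ k
    x+x⁻¹-invE a k with k Fin.≟ a
    ... | yes refl = L.trans (L.reflexive (≡.cong₂ (λ u v → xρ u ⊕ xρ v) (invE-unit-≡ k (+ 1)) (invE-unit-≡ k -[1+ 0 ]))) (⊕-comm (ivar k) (var k))
    ... | no  k≢a  = L.reflexive (≡.cong₂ (λ u v → xρ u ⊕ xρ v) (invE-unit-≢ a (+ 1) k≢a) (invE-unit-≢ a -[1+ 0 ] k≢a))

    ΔFactor-invE : ∀ a k l → act (invE a) (ΔFactor k l) ~ ΔFactor k l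
    ΔFactor-invE a k l = begin
      act (invE a) (ΔFactor k l)                      ≈⟨ act-cong (invE a) (ΔFactor≈x+x⁻¹-x+x⁻¹ k l) ⟩
      act (invE a) (x+x⁻¹ k ⊖ x+x⁻¹ l)                ≈⟨ act-⊖ (invE a) (x+x⁻¹ k) (x+x⁻¹ l) ⟩
      act (invE a) (x+x⁻¹ k) ⊖ act (invE a) (x+x⁻¹ l) ≈⟨ ⊕-cong (x+x⁻¹-invE a k) (neg-cong (x+x⁻¹-invE a l)) ⟩
      x+x⁻¹ k ⊖ x+x⁻¹ l                               ≈⟨ ΔFactor≈x+x⁻¹-x+x⁻¹ k l ⟨
      ΔFactor k l                                     ∎
      where open ~-Reasoning

    Δentry-invE : ∀ a k l → act (invE a) (Δentry k l) ~ Δentry k l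
    Δentry-invE a k l = by-order (toℕ k ℕ.<? toℕ l)
      where
      by-order : Dec (toℕ k ℕ.< toℕ l) → act (invE a) (Δentry k l) ~ Δentry k l
      by-order (yes k<l) = L.trans (act-cong (invE a) (Δentry-< k<l)) (L.trans (ΔFactor-invE a k l) (L.sym (Δentry-< k<l)))
      by-order (no  k≮l) = ≡.subst (λ p → act (invE a) p ~ p) (≡.sym (Δentry-≮ k≮l)) (L.reflexive (act-const (invE-isLinearInvolution a) 1#))

    Δ-invE : ∀ a → act (invE a) Δpairs ~ Δpairs
    Δ-invE a = begin
      act (invE a) Δpairs                   ≈⟨ act-cong (invE a) Δ≈∏∏Δentry ⟩
      act (invE a) (∏ (λ k → ∏ (Δentry k))) ≈⟨ act-∏ σ-inv (λ k → ∏ (Δentry k)) ⟩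
      ∏ (λ k → act (invE a) (∏ (Δentry k))) ≈⟨ ∏-cong (λ k → L.trans (act-∏ σ-inv (Δentry k)) (∏-cong (Δentry-invE a k))) ⟩
      ∏ (λ k → ∏ (Δentry k))                ≈⟨ Δ≈∏∏Δentry ⟨
      Δpairs                                                       ∎
      where
      open ~-Reasoning
      σ-inv = invE-isLinearInvolution a

    module AdjacentTransposition {i j : Fin n} (i→j : nextFin i ≡ just j) where

      i≢j : i ≢ j
      i≢j = nextFin⇒≢ i→j

      π : Fin n → Fin n
      π = swapSuc i

      π-i : π i ≡ j
      π-i = nextFin⇒swapSuc i→j

      π-j : π j ≡ i
      π-j = ≡.trans (≡.cong π (≡.sym π-i)) (swapSuc-involutive i i)

      σ-inv : IsLinearInvolution (swapE i j)
      σ-inv = swapE-isLinearInvolution i≢j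

      act-var : ∀ k → act (swapE i j) (var k) ≡ var (π k)
      act-var k = ≡.cong xρ (swapE-unit i→j k (+ 1))

      act-ivar : ∀ k → act (swapE i j) (ivar k) ≡ ivar (π k)
      act-ivar k = ≡.cong xρ (swapE-unit i→j k -[1+ 0 ])

      act-ΔFactor : ∀ k l → act (swapE i j) (ΔFactor k l) ~ ΔFactor (π k) (π l)
      act-ΔFactor k l = begin
        act (swapE i j) (ΔFactor k l)                         ≈⟨ act-cong (swapE i j) (ΔFactor≈x+x⁻¹-x+x⁻¹ k l) ⟩
        act (swapE i j) (x+x⁻¹ k ⊖ x+x⁻¹ l)                   ≈⟨ act-⊖ (swapE i j) (x+x⁻¹ k) (x+x⁻¹ l) ⟩
        act (swapE i j) (x+x⁻¹ k) ⊖ act (swapE i j) (x+x⁻¹ l) ≈⟨ ⊕-cong (act-x+x⁻¹ k) (neg-cong (act-x+x⁻¹ l)) ⟩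
        x+x⁻¹ (π k) ⊖ x+x⁻¹ (π l)                             ≈⟨ ΔFactor≈x+x⁻¹-x+x⁻¹ (π k) (π l) ⟨
        ΔFactor (π k) (π l)                                  ∎
        where
        open ~-Reasoning
        act-x+x⁻¹ : ∀ k → act (swapE i j) (x+x⁻¹ k) ~ x+x⁻¹ (π k)
        act-x+x⁻¹ k = L.trans (act-⊕ (swapE i j) (var k) (ivar k)) (L.reflexive (≡.cong₂ _⊕_ (act-var k) (act-ivar k)))

      ¬ji⇒¬πij : ∀ {k l} → ¬ (k ≡ j × l ≡ i) → ¬ (π k ≡ i × π l ≡ j)
      ¬ji⇒¬πij {k} {l} ¬ji (πk≡i , πl≡j) = ¬ji (≡.trans (≡.sym (swapSuc-involutive i k)) (≡.trans (≡.cong π πk≡i) π-i) ,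
                                               ≡.trans (≡.sym (swapSuc-involutive i l)) (≡.trans (≡.cong π πl≡j) π-j))

      i<j : toℕ i ℕ.< toℕ j
      i<j = ℕP.≤-reflexive (≡.sym (nextFin⇒toℕ i→j))

      π-mono-< : ∀ {k l} → ¬ (k ≡ i × l ≡ j) → toℕ k ℕ.< toℕ l → toℕ (π k) ℕ.< toℕ (π l)
      π-mono-< {k} {l} ¬ij = swapSuc-mono-< i k l (λ (k≡i , l≡πi) → ¬ij (k≡i , ≡.trans l≡πi π-i))

      π-mono-≮ : ∀ {k l} → ¬ (k ≡ j × l ≡ i) → ¬ toℕ k ℕ.< toℕ l → ¬ toℕ (π k) ℕ.< toℕ (π l)
      π-mono-≮ {k} {l} ¬ji k≮l πk<πl = k≮l (≡.subst₂ (λ a b → toℕ a ℕ.< toℕ b) (swapSuc-involutive i k) (swapSuc-involutive i l)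
                                                        (π-mono-< (¬ji⇒¬πij ¬ji) πk<πl))

      Δentry-swap : ∀ {k l} → ¬ (k ≡ i × l ≡ j) → ¬ (k ≡ j × l ≡ i) → act (swapE i j) (Δentry k l) ~ Δentry (π k) (π l)
      Δentry-swap {k} {l} ¬ij ¬ji = by-order (toℕ k ℕ.<? toℕ l)
        where
        by-order : Dec (toℕ k ℕ.< toℕ l) → act (swapE i j) (Δentry k l) ~ Δentry (π k) (π l)
        by-order (yes k<l) = L.trans (act-cong (swapE i j) (Δentry-< k<l)) (L.trans (act-ΔFactor k l) (L.sym (Δentry-< (π-mono-< ¬ij k<l))))
        by-order (no  k≮l) = ≡.subst₂ (λ p q → act (swapE i j) p ~ q) (≡.sym (Δentry-≮ k≮l)) (≡.sym (Δentry-≮ (π-mono-≮ ¬ji k≮l)))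
                                      (L.reflexive (act-const σ-inv 1#))

      Δ′entry : Fin n → Fin n → LPoly n
      Δ′entry k l with k Fin.≟ i | l Fin.≟ j
      ... | yes _ | yes _ = 1L
      ... | yes _ | no  _ = Δentry k l
      ... | no  _ | _     = Δentry k l

      Δ′entry-ij : Δ′entry i j ≡ 1L
      Δ′entry-ij with i Fin.≟ i | j Fin.≟ j
      ... | yes _   | yes _   = refl
      ... | yes _   | no  j≢j = ⊥-elim (j≢j refl)
      ... | no  i≢i | _       = ⊥-elim (i≢i refl)

      Δ′entry-other : ∀ {k l} → ¬ (k ≡ i × l ≡ j) → Δ′entry k l ≡ Δentry k l
      Δ′entry-other {k} {l} ¬ij with k Fin.≟ i | l Fin.≟ j
      ... | yes k≡i | yes l≡j = ⊥-elim (¬ij (k≡i , l≡j))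
      ... | yes _   | no  _   = refl
      ... | no  _   | _       = refl

      Δ′ : LPoly n
      Δ′ = ∏ (λ k → ∏ (Δ′entry k))

      Δ′entry-ji : Δ′entry j i ≡ 1L
      Δ′entry-ji = ≡.trans (Δ′entry-other (λ (j≡i , _) → i≢j (≡.sym j≡i))) (Δentry-≮ (ℕP.<-asym i<j))

      Δ≈ΔFactor⊛Δ′ : Δpairs ~ ΔFactor i j ⊛ Δ′
      Δ≈ΔFactor⊛Δ′ = begin
        Δpairs                                                                       ≈⟨ Δ≈∏∏Δentry ⟩
        ∏ (λ k → ∏ (Δentry k))                                                       ≈⟨ ∏-extract i (λ k → ∏ (Δentry k)) ⟩
        ∏ (Δentry i) ⊛ ∏ (without i (λ k → ∏ (Δentry k)))                            ≈⟨ ⊛-congʳ _ (∏-extract j (Δentry i)) ⟩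
        (Δentry i j ⊛ ∏ (without j (Δentry i))) ⊛ ∏ (without i (λ k → ∏ (Δentry k))) ≈⟨ L.*-assoc (Δentry i j) _ _ ⟩
        Δentry i j ⊛ (∏ (without j (Δentry i)) ⊛ ∏ (without i (λ k → ∏ (Δentry k)))) ≈⟨ L.trans (⊛-congʳ _ (Δentry-< i<j)) (⊛-congˡ (ΔFactor i j) (L.sym (⊛-cong (∏-cong row-i) (∏-cong other-rows)))) ⟩
        ΔFactor i j ⊛ (∏ (Δ′entry i) ⊛ ∏ (without i (λ k → ∏ (Δ′entry k))))          ≈⟨ ⊛-congˡ (ΔFactor i j) (∏-extract i (λ k → ∏ (Δ′entry k))) ⟨
        ΔFactor i j ⊛ Δ′                                                                 ∎
        where
        open ~-Reasoning
        row-i : ∀ l → Δ′entry i l ~ without j (Δentry i) l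
        row-i l = by-cases (l Fin.≟ j)
          where
          by-cases : Dec (l ≡ j) → Δ′entry i l ~ without j (Δentry i) l
          by-cases (yes refl) = L.reflexive (≡.trans Δ′entry-ij (≡.sym (without-≡ l (Δentry i))))
          by-cases (no  l≢j)  = L.reflexive (≡.trans (Δ′entry-other (λ (_ , l≡j) → l≢j l≡j)) (≡.sym (without-≢ (Δentry i) l≢j)))
        other-rows : ∀ k → without i (λ k → ∏ (Δ′entry k)) k ~ without i (λ k → ∏ (Δentry k)) k
        other-rows k = by-cases (k Fin.≟ i)
          where
          by-cases : Dec (k ≡ i) → without i (λ k → ∏ (Δ′entry k)) k ~ without i (λ k → ∏ (Δentry k)) k
          by-cases (yes refl) = L.reflexive (≡.trans (without-≡ k _) (≡.sym (without-≡ k _)))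
          by-cases (no  k≢i)  = L.trans (L.reflexive (without-≢ (λ k → ∏ (Δ′entry k)) k≢i))
                                  (L.trans (∏-cong {h = Δ′entry k} {g = Δentry k} (λ l → L.reflexive (Δ′entry-other (λ (k≡i , _) → k≢i k≡i))))
                                           (L.reflexive (≡.sym (without-≢ (λ k → ∏ (Δentry k)) k≢i))))

      Δ′entry-swap : ∀ k l → act (swapE i j) (Δ′entry k l) ~ Δ′entry (π k) (π l)
      Δ′entry-swap k l with (k Fin.≟ i) ×-dec (l Fin.≟ j) | (k Fin.≟ j) ×-dec (l Fin.≟ i)
      ... | yes (refl , refl) | _ =
        ≡.subst₂ (λ p q → act (swapE i j) p ~ q) (≡.sym Δ′entry-ij) (≡.sym (≡.trans (≡.cong₂ Δ′entry π-i π-j) Δ′entry-ji))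
          (L.reflexive (act-const σ-inv 1#))
      ... | no _ | yes (refl , refl) =
        ≡.subst₂ (λ p q → act (swapE i j) p ~ q) (≡.sym Δ′entry-ji) (≡.sym (≡.trans (≡.cong₂ Δ′entry π-j π-i) Δ′entry-ij))
          (L.reflexive (act-const σ-inv 1#))
      ... | no ¬ij | no ¬ji =
        ≡.subst₂ (λ p q → act (swapE i j) p ~ q) (≡.sym (Δ′entry-other ¬ij)) (≡.sym (Δ′entry-other (¬ji⇒¬πij ¬ji)))
          (Δentry-swap ¬ij ¬ji)

      Δ′-swap : act (swapE i j) Δ′ ~ Δ′
      Δ′-swap = begin
        act (swapE i j) (∏ (λ k → ∏ (Δ′entry k))) ≈⟨ act-∏ σ-inv (λ k → ∏ (Δ′entry k)) ⟩
        ∏ (λ k → act (swapE i j) (∏ (Δ′entry k))) ≈⟨ ∏-cong (λ k → L.trans (act-∏ σ-inv (Δ′entry k)) (∏-cong (Δ′entry-swap k))) ⟩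
        ∏ (λ k → ∏ (λ l → Δ′entry (π k) (π l)))   ≈⟨ ∏-cong (λ k → ∏-swapSuc i (Δ′entry (π k))) ⟩
        ∏ (λ k → ∏ (Δ′entry (π k)))               ≈⟨ ∏-swapSuc i (λ k → ∏ (Δ′entry k)) ⟩
        ∏ (λ k → ∏ (Δ′entry k))                                     ∎
        where open ~-Reasoning

      Δ′entry-invE : ∀ a k l → act (invE a) (Δ′entry k l) ~ Δ′entry k l
      Δ′entry-invE a k l with (k Fin.≟ i) ×-dec (l Fin.≟ j)
      ... | yes (refl , refl) = ≡.subst (λ p → act (invE a) p ~ p) (≡.sym Δ′entry-ij) (L.reflexive (act-const (invE-isLinearInvolution a) 1#))
      ... | no ¬ij            = ≡.subst (λ p → act (invE a) p ~ p) (≡.sym (Δ′entry-other ¬ij)) (Δentry-invE a k l)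

      Δ′-invE : ∀ a → act (invE a) Δ′ ~ Δ′
      Δ′-invE a = L.trans (act-∏ σ-inv′ (λ k → ∏ (Δ′entry k))) (∏-cong (λ k → L.trans (act-∏ σ-inv′ (Δ′entry k)) (∏-cong (Δ′entry-invE a k))))
        where σ-inv′ = invE-isLinearInvolution a

    CT≈⟦⟧ : ∀ p → CT p ≈ ⟦ p ⟧ (indicator zeroE)
    CT≈⟦⟧ p = coeff≈⟦⟧indicator p zeroE

    indicator-zeroE-invariant : ∀ {σ} → IsLinearInvolution σ → ∀ e → indicator zeroE (σ e) ≈ indicator zeroE e
    indicator-zeroE-invariant {σ} σ-inv e = by-cases (≡-dec ℤ._≟_ e zeroE)
      where
      open IsLinearInvolution σ-inv
      by-cases : Dec (e ≡ zeroE) → indicator zeroE (σ e) ≈ indicator zeroE e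
      by-cases (yes refl) = reflexive (≡.cong (indicator zeroE) fixes-zeroE)
      by-cases (no  e≢0)  = trans (indicator-≢ λ σe≡0 → e≢0 (≡.trans (≡.sym (involutive e)) (≡.trans (≡.cong σ σe≡0) fixes-zeroE)))
                                  (sym (indicator-≢ e≢0))

  -- CTβ pairs with the expansion of ∏ᵢ (1 + β xᵢ)⁻¹, whose coefficient of x^{-e} is ∏ᵢ βfactor β (-eᵢ)
  module BCWeight (n : ℕ) (β : Carrier) where

    βweight : ∀ {m} → Vec ℤ m → Carrier
    βweight = Vec.foldr (λ _ → Carrier) (λ z r → βfactor {n} β z * r) 1#

    CTβ≈⟦⟧ : ∀ (p : LPoly n) → CTβ β p ≈ ⟦ p ⟧ βweight
    CTβ≈⟦⟧ []            = ≈-refl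
    CTβ≈⟦⟧ ((a , e) ∷ p) = +-congˡ (CTβ≈⟦⟧ p)

    βweight-swap : ∀ {m} {i j : Fin m} → nextFin i ≡ just j → ∀ e → βweight (swapE i j e) ≈ βweight e
    βweight-swap {suc zero}    {zero}          ()
    βweight-swap {suc (suc m)} {zero}  {j}     refl (z₀ Vec.∷ z₁ Vec.∷ zs) = x∙yz≈y∙xz (βfactor {n} β z₁) (βfactor {n} β z₀) (βweight zs)
      where open CommutativeSemigroupProperties *-commutativeSemigroup using (x∙yz≈y∙xz)
    βweight-swap {suc (suc m)} {suc i} {j}     i→j  (z Vec.∷ zs) with nextFin i in i→j′
    βweight-swap {suc (suc m)} {suc i} {suc _} refl (z Vec.∷ zs) | just _ = *-congˡ (βweight-swap i→j′ zs)

    βweightAt : ∀ {m} → Fin m → (ℤ → Carrier) → Vec ℤ m → Carrier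
    βweightAt zero    g (z Vec.∷ zs) = g z * βweight zs
    βweightAt (suc k) g (z Vec.∷ zs) = βfactor {n} β z * βweightAt k g zs

    βweight≈βweightAt : ∀ {m} (k : Fin m) e → βweight e ≈ βweightAt k (βfactor {n} β) e
    βweight≈βweightAt zero    (z Vec.∷ zs) = ≈-refl
    βweight≈βweightAt (suc k) (z Vec.∷ zs) = *-congˡ (βweight≈βweightAt k zs)

    βweightAt-cong : ∀ {m} (k : Fin m) {g h : ℤ → Carrier} → (∀ z → g z ≈ h z) → ∀ e → βweightAt k g e ≈ βweightAt k h e
    βweightAt-cong zero    g≈h (z Vec.∷ zs) = *-congʳ (g≈h z)
    βweightAt-cong (suc k) g≈h (z Vec.∷ zs) = *-congˡ (βweightAt-cong k g≈h zs)

    βweightAt-linear : ∀ {m} (k : Fin m) (g h : ℤ → Carrier) e →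
                       βweightAt k g e + β * βweightAt k h e ≈ βweightAt k (λ z → g z + β * h z) e
    βweightAt-linear zero    g h (z Vec.∷ zs) = begin
      g z * βweight zs + β * (h z * βweight zs) ≈⟨ +-congˡ (sym (*-assoc β (h z) (βweight zs))) ⟩
      g z * βweight zs + (β * h z) * βweight zs ≈⟨ distribʳ (βweight zs) (g z) (β * h z) ⟨
      (g z + β * h z) * βweight zs                ∎
      where open ≈-Reasoning
    βweightAt-linear (suc k) g h (z Vec.∷ zs) = begin
      b * βweightAt k g zs + β * (b * βweightAt k h zs) ≈⟨ +-congˡ (x∙yz≈y∙xz β b _) ⟩
      b * βweightAt k g zs + b * (β * βweightAt k h zs) ≈⟨ distribˡ b _ _ ⟨
      b * (βweightAt k g zs + β * βweightAt k h zs)     ≈⟨ *-congˡ (βweightAt-linear k g h zs) ⟩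
      b * βweightAt k (λ z → g z + β * h z) zs            ∎
      where
      open ≈-Reasoning
      open CommutativeSemigroupProperties *-commutativeSemigroup using (x∙yz≈y∙xz)
      b = βfactor {n} β z


    βweight-shift : ∀ {m} (k : Fin m) e → βweight (e +ᵉ unit k (+ 1)) ≈ βweightAt k (λ z → βfactor {n} β (z ℤ.+ + 1)) e
    βweight-shift zero    (z Vec.∷ zs) = *-congˡ (reflexive (≡.cong βweight (+ᵉ-identityʳ zs)))
    βweight-shift (suc k) (z Vec.∷ zs) = *-cong (reflexive (≡.cong (βfactor {n} β) (ℤP.+-identityʳ z))) (βweight-shift k zs)

    δ₀ : ℤ → Carrier
    δ₀ (+ zero)  = 1#
    δ₀ (+ suc _) = 0#
    δ₀ -[1+ _ ]  = 0#

    δ₀-neg : ∀ z → δ₀ (ℤ.- z) ≡ δ₀ z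
    δ₀-neg (+ zero)  = refl
    δ₀-neg (+ suc _) = refl
    δ₀-neg -[1+ _ ]  = refl

    -- (1 + β x) Σₘ (-β)^m x^m = 1, coefficientwise
    βfactor-recursion : ∀ z → βfactor {n} β z + β * βfactor {n} β (z ℤ.+ + 1) ≈ δ₀ z
    βfactor-recursion (+ zero)         = trans (+-congˡ (zeroʳ β)) (+-identityʳ 1#)
    βfactor-recursion (+ suc _)        = trans (+-congˡ (zeroʳ β)) (+-identityʳ 0#)
    βfactor-recursion -[1+ zero ]      = trans (+-cong (*-identityʳ (- β)) (*-identityʳ β)) (-‿inverseˡ β)
    βfactor-recursion -[1+ suc k ]     = trans (sym (distribʳ (pow {n} (- β) (suc k)) (- β) β)) (trans (*-congʳ (-‿inverseˡ β)) (zeroˡ _))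

    twistedWeight : ∀ {m} → Fin m → Vec ℤ m → Carrier
    twistedWeight k = βweightAt k δ₀

    twistedWeight-invE : ∀ {m} (k : Fin m) e → twistedWeight k (invE k e) ≈ twistedWeight k e
    twistedWeight-invE zero    (z Vec.∷ zs) = reflexive (≡.cong (_* βweight zs) (δ₀-neg z))
    twistedWeight-invE (suc k) (z Vec.∷ zs) = *-congˡ (twistedWeight-invE k zs)

    -- multiplying by 1 + β x_k cancels the k-th factor (1 + β x_k)⁻¹ of the weight
    ⟦⟧-⊛[1+βx] : ∀ k (Z : LPoly n) → ⟦ Z ⊛ (1L ⊕ const β ⊛ var k) ⟧ βweight ≈ ⟦ Z ⟧ (twistedWeight k)
    ⟦⟧-⊛[1+βx] k Z = trans (⟦⟧-⊛ Z (1L ⊕ const β ⊛ var k) βweight) (⟦⟧-cong Z shifted)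
      where
      shifted : ∀ b → ⟦ 1L ⊕ const β ⊛ var k ⟧ (λ a → βweight (b +ᵉ a)) ≈ twistedWeight k b
      shifted b = begin
        ⟦ 1L ⊕ const β ⊛ var k ⟧ (λ a → βweight (b +ᵉ a))                                   ≈⟨ ⟦⟧-⊕ 1L (const β ⊛ var k) (λ a → βweight (b +ᵉ a)) ⟩
        ⟦ 1L ⟧ (λ a → βweight (b +ᵉ a)) + ⟦ const β ⊛ var k ⟧ (λ a → βweight (b +ᵉ a))      ≈⟨ +-cong (⟦⟧-xρ zeroE (λ a → βweight (b +ᵉ a))) (trans (+-identityʳ _) (*-congʳ (*-identityʳ β))) ⟩
        βweight (b +ᵉ zeroE) + β * βweight (b +ᵉ (zeroE +ᵉ unit k (+ 1)))                   ≈⟨ +-cong (reflexive (≡.cong βweight (+ᵉ-identityʳ b)))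
                                                                                           (*-congˡ (reflexive (≡.cong (λ v → βweight (b +ᵉ v)) (+ᵉ-identityˡ (unit k (+ 1)))))) ⟩
        βweight b + β * βweight (b +ᵉ unit k (+ 1))                                         ≈⟨ +-cong (βweight≈βweightAt k b) (*-congˡ (βweight-shift k b)) ⟩
        βweightAt k (βfactor {n} β) b + β * βweightAt k (λ z → βfactor {n} β (z ℤ.+ + 1)) b ≈⟨ βweightAt-linear k (βfactor {n} β) (λ z → βfactor {n} β (z ℤ.+ + 1)) b ⟩
        βweightAt k (λ z → βfactor {n} β z + β * βfactor {n} β (z ℤ.+ + 1)) b               ≈⟨ βweightAt-cong k βfactor-recursion b ⟩
        twistedWeight k b                                                              ∎
        where open ≈-Reasoning

  module _ {n : ℕ} where

    -- The operators π_i^♡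

    reflection-quotient : ∀ (r : Reflection) {σ} → (∀ e → σ e ≡ Reflection.reflect r e) →
                          ∀ {Den w} → Den ~ xρ w ⊛ (1L ⊖ xρ (Reflection.root r)) →
                          ∀ {x y} c → y ≡ x +ᵉ c *ᵉ Reflection.root r →
                          ∀ f → Σ[ h ∈ LPoly n ] h ⊛ Den ~ numerator (xρ x) (xρ y) σ f
    reflection-quotient r {σ} σ≗r {Den} {w} Den≈ {x} {y} c y≡x+cα =
      quotient-exists (xρ x) (xρ y) σ Den (λ a e → const a ⊛ (xρ ((x +ᵉ e) +ᵉ -ᵉ w) ⊛ geometricℤ root (c ℤ.+ coroot e)))
        (λ a e → quotient-term σ x y Den≈ a e (c ℤ.+ coroot e) (≡.trans (≡.cong (y +ᵉ_) (σ≗r e)) (reflect-shift c y≡x+cα e)))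
      where open Reflection r

    record Presentation (t : Type) (β : Carrier) (i : Fin n) : Set (c ⊔ ℓ) where
      field
        operator : DividedDifference
      open DividedDifference operator public
      field
        IsPi⇒IsπOf : ∀ f h → IsPi t β i f h → IsπOf h f
        IsπOf⇒IsPi : ∀ f h → IsπOf h f → IsPi t β i f h
        sp≈⟨⟩      : ∀ f g → sp t β f g ≈ ⟨ f , g ⟩

    module _ {t β} {i : Fin n} (P : Presentation t β i) where
      open Presentation P

      sp-dual-pair : ∀ f₁ g₁ f₂ g₂ → IsPi t β i f₁ f₂ → IsPiHat t β i g₁ g₂ →
                     sp t β f₁ g₁ ≈ 0# → sp t β f₂ g₁ ≈ 1# → (sp t β f₁ g₂ ≈ 1#) × (sp t β f₂ g₂ ≈ 0#)
      sp-dual-pair f₁ g₁ f₂ g₂ f₂=f₁π g₂=g₁π̂ sp₁₁≈0 sp₂₁≈1 =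
        let ⟨f₁,g₂⟩≈1 , ⟨f₂,g₂⟩≈0 = dual-pair {f₁} {f₂} {g₁} {g₂} (IsPi⇒IsπOf f₁ f₂ f₂=f₁π) (IsPi⇒IsπOf g₁ (g₂ ⊕ g₁) g₂=g₁π̂)
                                               (trans (sym (sp≈⟨⟩ f₁ g₁)) sp₁₁≈0) (trans (sym (sp≈⟨⟩ f₂ g₁)) sp₂₁≈1)
        in trans (sp≈⟨⟩ f₁ g₂) ⟨f₁,g₂⟩≈1 , trans (sp≈⟨⟩ f₂ g₂) ⟨f₂,g₂⟩≈0

      sp-orthogonal : ∀ {v} (V : LPoly n → Set v) g₁ g₂ → (∀ f h → V f → IsPi t β i f h → V h) →
                      (∀ f → V f → sp t β f g₁ ≈ 0#) → IsPiHat t β i g₁ g₂ → ∀ f → V f → sp t β f g₂ ≈ 0#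
      sp-orthogonal V g₁ g₂ V-stable V⊥g₁ g₂=g₁π̂ f f∈V =
        let h , h=fπ = quotient f
        in trans (sp≈⟨⟩ f g₂) (orthogonal-π̂ {f} {h} {g₁} {g₂} h=fπ (IsPi⇒IsπOf g₁ (g₂ ⊕ g₁) g₂=g₁π̂)
                                (trans (sym (sp≈⟨⟩ h g₁)) (V⊥g₁ h (V-stable f h f∈V (IsπOf⇒IsPi f h h=fπ))))
                                (trans (sym (sp≈⟨⟩ f g₁)) (V⊥g₁ f f∈V)))

    IsPi-adjacent : ∀ t β {i j : Fin n} → nextFin i ≡ just j → ∀ f h →
                    IsPi t β i f h ≡ (h ⊛ (var i ⊖ var j) ≋ numerator (var i) (var j) (swapE i j) f)
    IsPi-adjacent t β {i} i→j f h with nextFin i | i→j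
    ... | just _ | refl = refl

    IsPi-C-last : ∀ β {i : Fin n} → nextFin i ≡ nothing → ∀ f h →
                  IsPi C β i f h ≡ (h ⊛ (var i ⊖ ivar i) ≋ numerator (var i) (ivar i) (invE i) f)
    IsPi-C-last β {i} last f h with nextFin i | last
    ... | nothing | refl = refl

    IsPi-B-last : ∀ β {i : Fin n} → nextFin i ≡ nothing → ∀ f h →
                  IsPi B β i f h ≡ (h ⊛ (var i ⊖ 1L) ≋ var i ⊛ f ⊖ act (invE i) f)
    IsPi-B-last β {i} last f h with nextFin i | last
    ... | nothing | refl = refl

    IsPi-BC-last : ∀ β {i : Fin n} → nextFin i ≡ nothing → ∀ f h →
                   IsPi BC β i f h ≡ (h ⊛ (var i ⊖ ivar i) ≋ numerator (var i ⊕ const β) (ivar i ⊕ const β) (invE i) f)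
    IsPi-BC-last β {i} last f h with nextFin i | last
    ... | nothing | refl = refl

    IsPi-D-last : ∀ β {p i : Fin n} → nextFin i ≡ nothing → prevFin i ≡ just p → ∀ f h →
                  IsPi D β i f h ≡ (h ⊛ (1L ⊖ ivar p ⊛ ivar i) ≋ f ⊖ (ivar p ⊛ ivar i) ⊛ act (tauE p i) f)
    IsPi-D-last β {p} {i} last i←p f h with nextFin i | last
    ... | nothing | refl with prevFin i | i←p
    ...   | just _ | refl = refl

    -- for n = 1 there is no x_{n-1}, and Defs makes the defining relation of π^D empty
    IsPi-D-1 : ∀ β {i : Fin n} → nextFin i ≡ nothing → prevFin i ≡ nothing → ∀ f h → ¬ IsPi D β i f h
    IsPi-D-1 β {i} last first f h with nextFin i | last
    ... | nothing | refl with prevFin i | first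
    ...   | nothing | refl = lower

    ∸-pred : ∀ m t → suc t ℕ.≤ m → m ∸ t ≡ suc (m ∸ suc t)
    ∸-pred (suc m) zero    _         = refl
    ∸-pred (suc m) (suc t) (s≤s t<m) = ∸-pred m t t<m

    lookup-ρC : ∀ k → lookup (ρC {n}) k ≡ + (n ∸ toℕ k)
    lookup-ρC = VecP.lookup∘tabulate _

    lookup-ρD : ∀ k → lookup (ρD {n}) k ≡ + (n ∸ suc (toℕ k))
    lookup-ρD = VecP.lookup∘tabulate _

    ρC-adjacent : ∀ {i j} → nextFin i ≡ just j → lookup (ρC {n}) i ≡ + 1 ℤ.+ lookup ρC j
    ρC-adjacent {i} {j} i→j = ≡.trans (lookup-ρC i) (≡.trans (≡.cong +_ (∸-pred n (toℕ i) (≡.subst (ℕ._≤ n) (nextFin⇒toℕ i→j) (FinP.toℕ≤n j))))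
                                (≡.sym (≡.trans (≡.cong (λ w → + 1 ℤ.+ w) (lookup-ρC j)) (≡.cong (λ t → + suc (n ∸ t)) (nextFin⇒toℕ i→j)))))

    ρD-adjacent : ∀ {i j} → nextFin i ≡ just j → lookup (ρD {n}) i ≡ + 1 ℤ.+ lookup ρD j
    ρD-adjacent {i} {j} i→j = ≡.trans (lookup-ρD i) (≡.trans (≡.cong +_ (∸-pred n (suc (toℕ i)) (≡.subst (λ t → suc t ℕ.≤ n) (nextFin⇒toℕ i→j) (FinP.toℕ<n j))))
                                (≡.sym (≡.trans (≡.cong (λ w → + 1 ℤ.+ w) (lookup-ρD j)) (≡.cong (λ t → + suc (n ∸ suc t)) (nextFin⇒toℕ i→j)))))

    ρC-last : ∀ {i} → nextFin i ≡ nothing → lookup (ρC {n}) i ≡ + 1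
    ρC-last {i} last = ≡.trans (lookup-ρC i) (≡.cong +_ (≡.trans (≡.cong (_∸ toℕ i) (≡.sym (nextFin-nothing⇒last last))) (ℕP.m+n∸n≡m 1 (toℕ i))))

    ρD-last : ∀ {i} → nextFin i ≡ nothing → lookup (ρD {n}) i ≡ + 0
    ρD-last {i} last = ≡.trans (lookup-ρD i) (≡.cong +_ (≡.trans (≡.cong (_∸ suc (toℕ i)) (≡.sym (nextFin-nothing⇒last last))) (ℕP.n∸n≡0 (suc (toℕ i)))))

    ρD-second-last : ∀ {p i} → nextFin i ≡ nothing → prevFin i ≡ just p → lookup (ρD {n}) p ≡ + 1
    ρD-second-last {p} {i} last i←p = ≡.trans (lookup-ρD p) (≡.cong +_ (≡.trans
      (≡.cong (_∸ suc (toℕ p)) (≡.trans (≡.sym (nextFin-nothing⇒last last)) (≡.cong suc (prevFin⇒toℕ i←p))))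
      (ℕP.m+n∸n≡m 1 (suc (toℕ p)))))

    act-xρ⊛ : ∀ {σ} → IsLinearInvolution σ → ∀ {v : Exp n} → σ v ≡ v → ∀ {p} → act σ p ~ p → act σ (xρ v ⊛ p) ~ xρ v ⊛ p
    act-xρ⊛ σ-inv {v} σv≡v {p} σp≈p = L.trans (act-⊛ σ-inv (xρ v) p) (⊛-cong (L.reflexive (≡.cong xρ σv≡v)) σp≈p)

    module AdjacentCase {i j : Fin n} (i→j : nextFin i ≡ just j) (ρ : Exp n) (Q : LPoly n) (Φ : Exp n → Carrier)
                        (ρ-adjacent : lookup ρ i ≡ + 1 ℤ.+ lookup ρ j)
                        (Q-swap : act (swapE i j) Q ~ Q)
                        (Φ-swap : ∀ e → Φ (swapE i j e) ≈ Φ e) where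

      open AdjacentTransposition i→j
      open Reflection (adjacentReflection i≢j) using (root; coroot; reflect-fixes)

      Den E′ W′ : LPoly n
      Den = var i ⊖ var j
      E′  = 1L ⊖ ivar i ⊛ ivar j
      W′  = xρ ρ ⊛ (Q ⊛ (E′ ⊛ Δ′))

      weight-factor : xρ ρ ⊛ (Q ⊛ Δpairs) ~ Den ⊛ W′
      weight-factor = begin
        xρ ρ ⊛ (Q ⊛ Δpairs)            ≈⟨ ⊛-congˡ (xρ ρ) (⊛-congˡ Q (L.trans Δ≈ΔFactor⊛Δ′ (L.*-assoc Den E′ Δ′))) ⟩
        xρ ρ ⊛ (Q ⊛ (Den ⊛ (E′ ⊛ Δ′))) ≈⟨ ⊛-congˡ (xρ ρ) (L*.x∙yz≈y∙xz Q Den (E′ ⊛ Δ′)) ⟩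
        xρ ρ ⊛ (Den ⊛ (Q ⊛ (E′ ⊛ Δ′))) ≈⟨ L*.x∙yz≈y∙xz (xρ ρ) Den (Q ⊛ (E′ ⊛ Δ′)) ⟩
        Den ⊛ W′                             ∎
        where open ~-Reasoning

      i+root≡j : unit i (+ 1) +ᵉ root ≡ unit j (+ 1)
      i+root≡j = begin
        unit i (+ 1) +ᵉ (unit j (+ 1) +ᵉ unit i -[1+ 0 ]) ≡⟨ ≡.cong (unit i (+ 1) +ᵉ_) (+ᵉ-comm (unit j (+ 1)) (unit i -[1+ 0 ])) ⟩
        unit i (+ 1) +ᵉ (unit i -[1+ 0 ] +ᵉ unit j (+ 1)) ≡⟨ +ᵉ-assoc (unit i (+ 1)) (unit i -[1+ 0 ]) (unit j (+ 1)) ⟨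
        (unit i (+ 1) +ᵉ unit i -[1+ 0 ]) +ᵉ unit j (+ 1) ≡⟨ ≡.cong (_+ᵉ unit j (+ 1)) (≡.trans (unit-+ᵉ i (+ 1) -[1+ 0 ]) (unit-zero i)) ⟩
        zeroE +ᵉ unit j (+ 1)                             ≡⟨ +ᵉ-identityˡ (unit j (+ 1)) ⟩
        unit j (+ 1)                                       ∎
        where open ≡.≡-Reasoning

      Den≈ : Den ~ xρ (unit i (+ 1)) ⊛ (1L ⊖ xρ root)
      Den≈ = L.sym (L.trans (xρ-⊛-1-xρ (unit i (+ 1)) root) (L.reflexive (≡.cong (λ e → var i ⊖ xρ e) i+root≡j)))

      root-i : lookup root i ≡ -[1+ 0 ]
      root-i = ≡.trans (lookup-unit+unit (+ 1) -[1+ 0 ] i) (≡.cong₂ ℤ._+_ (lookup-unit-≢ (+ 1) i≢j) (lookup-unit-≡ i -[1+ 0 ]))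

      xⱼxᵖ-fixed : swapE i j (unit j (+ 1) +ᵉ ρ) ≡ unit j (+ 1) +ᵉ ρ
      xⱼxᵖ-fixed = ≡.trans (swapE≗reflect i≢j _) (reflect-fixes (begin
        + 1 ℤ.* lookup v i ℤ.+ -[1+ 0 ] ℤ.* lookup v j                               ≡⟨ ≡.cong₂ (λ a b → + 1 ℤ.* a ℤ.+ -[1+ 0 ] ℤ.* b)
                                                                                              (≡.trans (lookup-+ᵉ (unit j (+ 1)) ρ i) (≡.cong₂ ℤ._+_ (lookup-unit-≢ (+ 1) i≢j) ρ-adjacent))
                                                                                              (≡.trans (lookup-+ᵉ (unit j (+ 1)) ρ j) (≡.cong (ℤ._+ lookup ρ j) (lookup-unit-≡ j (+ 1)))) ⟩
        + 1 ℤ.* (+ 0 ℤ.+ (+ 1 ℤ.+ lookup ρ j)) ℤ.+ -[1+ 0 ] ℤ.* (+ 1 ℤ.+ lookup ρ j) ≡⟨ balanced (lookup ρ j) ⟩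
        + 0                                                                               ∎))
        where
        open ≡.≡-Reasoning
        v = unit j (+ 1) +ᵉ ρ
        balanced : ∀ r → + 1 ℤ.* (+ 0 ℤ.+ (+ 1 ℤ.+ r)) ℤ.+ -[1+ 0 ] ℤ.* (+ 1 ℤ.+ r) ≡ + 0
        balanced = solve-∀

      E′-swap : act (swapE i j) E′ ~ E′
      E′-swap = begin
        act (swapE i j) (1L ⊖ ivar i ⊛ ivar j)                                       ≈⟨ act-⊖ (swapE i j) 1L (ivar i ⊛ ivar j) ⟩
        act (swapE i j) 1L ⊖ act (swapE i j) (ivar i ⊛ ivar j)                       ≈⟨ ⊕-cong (L.reflexive (act-const σ-inv 1#)) (neg-cong (act-⊛ σ-inv (ivar i) (ivar j))) ⟩
        1L ⊖ act (swapE i j) (ivar i) ⊛ act (swapE i j) (ivar j)                     ≡⟨ ≡.cong₂ (λ a b → 1L ⊖ a ⊛ b) (≡.trans (act-ivar i) (≡.cong ivar π-i)) (≡.trans (act-ivar j) (≡.cong ivar π-j)) ⟩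
        1L ⊖ ivar j ⊛ ivar i                                                         ≈⟨ ⊕-congˡ 1L (neg-cong (L.*-comm (ivar j) (ivar i))) ⟩
        E′                                                      ∎
        where open ~-Reasoning

      xⱼW′-swap : act (swapE i j) (var j ⊛ W′) ~ var j ⊛ W′
      xⱼW′-swap = begin
        act (swapE i j) (var j ⊛ W′)                    ≈⟨ act-cong (swapE i j) regroup ⟩
        act (swapE i j) (xρ (unit j (+ 1) +ᵉ ρ) ⊛ rest) ≈⟨ act-xρ⊛ σ-inv xⱼxᵖ-fixed (L.trans (act-⊛ σ-inv Q (E′ ⊛ Δ′))
                                                                (⊛-cong Q-swap (L.trans (act-⊛ σ-inv E′ Δ′) (⊛-cong E′-swap Δ′-swap)))) ⟩
        xρ (unit j (+ 1) +ᵉ ρ) ⊛ rest                   ≈⟨ regroup ⟨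
        var j ⊛ W′                                           ∎
        where
        open ~-Reasoning
        rest = Q ⊛ (E′ ⊛ Δ′)
        regroup : var j ⊛ W′ ~ xρ (unit j (+ 1) +ᵉ ρ) ⊛ rest
        regroup = L.trans (L.sym (L.*-assoc (var j) (xρ ρ) rest)) (⊛-congʳ rest (xρ-⊛ (unit j (+ 1)) ρ))

      operator : DividedDifference
      operator = record
        { σ = swapE i j ; σ-isLinearInvolution = σ-inv
        ; X = var i ; Y = var j ; Den = Den ; W′ = W′ ; ε = 1L ; ε⁻¹ = 1L ; Φ = Φ
        ; ε⁻¹⊛ε = L.*-identityˡ 1L
        ; Den-σ = L.trans (act-⊖ (swapE i j) (var i) (var j))
                  (L.trans (L.reflexive (≡.cong₂ (λ a b → a ⊖ b) (≡.trans (act-var i) (≡.cong var π-i)) (≡.trans (act-var j) (≡.cong var π-j))))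
                  (L.trans (L.sym (Lᴾ.⁻¹-anti-homo‿- (var i) (var j))) (neg-cong (L.sym (L.*-identityˡ Den)))))
        ; X-σ = L.trans (L.reflexive (≡.trans (act-var i) (≡.cong var π-i))) (L.sym (L.*-identityˡ (var j)))
        ; Y-σ = L.trans (L.reflexive (≡.trans (act-var j) (≡.cong var π-j))) (L.sym (L.*-identityˡ (var i)))
        ; Den≈X-Y = L.refl
        ; Den-cancel = cancel-xʷ[1-xᵈ] root-i Den≈
        ; Y-twisted-symmetric = twisted-symmetric σ-inv Φ-swap (var j) W′ xⱼW′-swap
        ; quotient = reflection-quotient (adjacentReflection i≢j) (swapE≗reflect i≢j) Den≈ (+ 1)
                       (≡.sym (≡.trans (≡.cong (unit i (+ 1) +ᵉ_) (*ᵉ-identityˡ root)) i+root≡j))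
        }

      presentation : ∀ {t β} → (∀ f g → sp t β f g ≈ ⟦ (f ⊛ g) ⊛ (xρ ρ ⊛ (Q ⊛ Δpairs)) ⟧ Φ) → Presentation t β i
      presentation {t} {β} sp≈ = record
        { operator   = operator
        ; IsPi⇒IsπOf = λ f h → ≋⇒~ ∘ ≡.subst (λ A → A) (IsPi-adjacent t β i→j f h)
        ; IsπOf⇒IsPi = λ f h → ≡.subst (λ A → A) (≡.sym (IsPi-adjacent t β i→j f h)) ∘ ~⇒≋
        ; sp≈⟨⟩      = λ f g → trans (sp≈ f g) (at (⊛-congˡ (f ⊛ g) weight-factor) Φ)
        }

    module _ {i j : Fin n} (i→j : nextFin i ≡ just j) where
      open AdjacentTransposition i→j

      prodL-swap : ∀ (q : Fin n → LPoly n) → (∀ k → act (swapE i j) (q k) ~ q (π k)) →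
                   act (swapE i j) (prodL (List.map q (List.allFin n))) ~ prodL (List.map q (List.allFin n))
      prodL-swap q q-swap = begin
        act (swapE i j) (prodL (List.map q (List.allFin n))) ≡⟨ ≡.cong (act (swapE i j)) (prodL-allFin q) ⟩
        act (swapE i j) (∏ q)                                ≈⟨ act-∏ σ-inv q ⟩
        ∏ (act (swapE i j) ∘ q)                              ≈⟨ ∏-cong q-swap ⟩
        ∏ (q ∘ π)                                            ≈⟨ ∏-swapSuc i q ⟩
        ∏ q                                                  ≡⟨ prodL-allFin q ⟨
        prodL (List.map q (List.allFin n))                     ∎
        where open ~-Reasoning

      QC-swap : act (swapE i j) (prodL (List.map (λ k → var k ⊖ ivar k) (List.allFin n))) ~ prodL (List.map (λ k → var k ⊖ ivar k) (List.allFin n))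
      QC-swap = prodL-swap (λ k → var k ⊖ ivar k) λ k → L.trans (act-⊖ (swapE i j) (var k) (ivar k)) (L.reflexive (≡.cong₂ _⊖_ (act-var k) (act-ivar k)))

      QB-swap : act (swapE i j) (prodL (List.map (λ k → var k ⊖ 1L) (List.allFin n))) ~ prodL (List.map (λ k → var k ⊖ 1L) (List.allFin n))
      QB-swap = prodL-swap (λ k → var k ⊖ 1L) λ k → L.trans (act-⊖ (swapE i j) (var k) 1L) (L.reflexive (≡.cong₂ _⊖_ (act-var k) (act-const σ-inv 1#)))

      adjacentPresentation : ∀ t β → Presentation t β i
      adjacentPresentation B β = AdjacentCase.presentation i→j ρD _ (indicator zeroE) (ρD-adjacent i→j) QB-swap (indicator-zeroE-invariant σ-inv)
                                   (λ f g → CT≈⟦⟧ ((f ⊛ g) ⊛ WB))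
      adjacentPresentation C β = AdjacentCase.presentation i→j ρC _ (indicator zeroE) (ρC-adjacent i→j) QC-swap (indicator-zeroE-invariant σ-inv)
                                   (λ f g → CT≈⟦⟧ ((f ⊛ g) ⊛ WC))
      adjacentPresentation D β = AdjacentCase.presentation i→j ρD 1L (indicator zeroE) (ρD-adjacent i→j) (L.reflexive (act-const σ-inv 1#))
                                   (indicator-zeroE-invariant σ-inv)
                                   (λ f g → trans (CT≈⟦⟧ ((f ⊛ g) ⊛ WD)) (at (⊛-congˡ (f ⊛ g) (⊛-congˡ (xρ ρD) (L.sym (L.*-identityˡ Δpairs)))) _))
      adjacentPresentation BC β = AdjacentCase.presentation i→j ρC _ (BCWeight.βweight n β) (ρC-adjacent i→j) QC-swap (BCWeight.βweight-swap n β i→j)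
                                   (λ f g → BCWeight.CTβ≈⟦⟧ n β ((f ⊛ g) ⊛ WC))

    module LastIndex {i : Fin n} (last : nextFin i ≡ nothing) where

      σ-inv : IsLinearInvolution (invE i)
      σ-inv = invE-isLinearInvolution i

      act-var-i : act (invE i) (var i) ≡ ivar i
      act-var-i = ≡.cong xρ (invE-unit-≡ i (+ 1))

      act-ivar-i : act (invE i) (ivar i) ≡ var i
      act-ivar-i = ≡.cong xρ (invE-unit-≡ i -[1+ 0 ])

      act-xρ-≢ : ∀ {k} z → k ≢ i → act (invE i) (xpow k z) ≡ xpow k z
      act-xρ-≢ z k≢i = ≡.cong xρ (invE-unit-≢ i z k≢i)

      weight-factor : ∀ (ρ : Exp n) q → xρ ρ ⊛ (prodL (List.map q (List.allFin n)) ⊛ Δpairs) ~ q i ⊛ (xρ ρ ⊛ (∏ (without i q) ⊛ Δpairs))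
      weight-factor ρ q = begin
        xρ ρ ⊛ (prodL (List.map q (List.allFin n)) ⊛ Δpairs) ≡⟨ ≡.cong (λ Q → xρ ρ ⊛ (Q ⊛ Δpairs)) (prodL-allFin q) ⟩
        xρ ρ ⊛ (∏ q ⊛ Δpairs)                                ≈⟨ ⊛-congˡ (xρ ρ) (L.trans (⊛-congʳ Δpairs (∏-extract i q)) (L.*-assoc (q i) _ Δpairs)) ⟩
        xρ ρ ⊛ (q i ⊛ (∏ (without i q) ⊛ Δpairs))            ≈⟨ L*.x∙yz≈y∙xz (xρ ρ) (q i) _ ⟩
        q i ⊛ (xρ ρ ⊛ (∏ (without i q) ⊛ Δpairs))                ∎
        where open ~-Reasoning

      W′-invariant : ∀ (ρ : Exp n) q y → invE i (y +ᵉ ρ) ≡ y +ᵉ ρ → (∀ k → k ≢ i → act (invE i) (q k) ~ q k) →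
                     act (invE i) (xρ y ⊛ (xρ ρ ⊛ (∏ (without i q) ⊛ Δpairs))) ~ xρ y ⊛ (xρ ρ ⊛ (∏ (without i q) ⊛ Δpairs))
      W′-invariant ρ q y fixed q-inv = begin
        act (invE i) (xρ y ⊛ (xρ ρ ⊛ rest)) ≈⟨ act-cong (invE i) regroup ⟩
        act (invE i) (xρ (y +ᵉ ρ) ⊛ rest)   ≈⟨ act-xρ⊛ σ-inv fixed (L.trans (act-⊛ σ-inv (∏ (without i q)) Δpairs) (⊛-cong without-inv (Δ-invE i))) ⟩
        xρ (y +ᵉ ρ) ⊛ rest                  ≈⟨ regroup ⟨
        xρ y ⊛ (xρ ρ ⊛ rest)                         ∎
        where
        open ~-Reasoning
        rest = ∏ (without i q) ⊛ Δpairs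
        regroup : xρ y ⊛ (xρ ρ ⊛ rest) ~ xρ (y +ᵉ ρ) ⊛ rest
        regroup = L.trans (L.sym (L.*-assoc (xρ y) (xρ ρ) rest)) (⊛-congʳ rest (xρ-⊛ y ρ))
        factor-inv : ∀ k → act (invE i) (without i q k) ~ without i q k
        factor-inv k with k Fin.≟ i
        ... | yes _   = L.reflexive (act-const σ-inv 1#)
        ... | no  k≢i = q-inv k k≢i
        without-inv : act (invE i) (∏ (without i q)) ~ ∏ (without i q)
        without-inv = L.trans (act-∏ σ-inv (without i q)) (∏-cong factor-inv)

      invE-fixes : ∀ {v} → lookup v i ≡ + 0 → invE i v ≡ v
      invE-fixes {v} vᵢ≡0 = ≡.trans (invE≗reflect-long i v) (Reflection.reflect-fixes (longReflection i) (≡.cong (λ u → + 1 ℤ.* u ℤ.+ + 0 ℤ.* u) vᵢ≡0))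

      long-root-i : lookup (Reflection.root (longReflection i)) i ≡ -[1+ 1 ]
      long-root-i = lookup-unit-≡ i -[1+ 1 ]

      Den-C : LPoly n
      Den-C = var i ⊖ ivar i

      Den-C≈ : Den-C ~ xρ (unit i (+ 1)) ⊛ (1L ⊖ xρ (unit i -[1+ 1 ]))
      Den-C≈ = L.sym (L.trans (xρ-⊛-1-xρ (unit i (+ 1)) (unit i -[1+ 1 ])) (L.reflexive (≡.cong (λ e → var i ⊖ xρ e) (unit-+ᵉ i (+ 1) -[1+ 1 ]))))

      Den-C-σ : act (invE i) Den-C ~ neg (1L ⊛ Den-C)
      Den-C-σ = L.trans (act-⊖ (invE i) (var i) (ivar i)) (L.trans (L.reflexive (≡.cong₂ _⊖_ act-var-i act-ivar-i))
                (L.trans (L.sym (Lᴾ.⁻¹-anti-homo‿- (var i) (ivar i))) (neg-cong (L.sym (L.*-identityˡ Den-C)))))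

      C-quotient : ∀ f → Σ[ h ∈ LPoly n ] h ⊛ Den-C ~ numerator (var i) (ivar i) (invE i) f
      C-quotient = reflection-quotient (longReflection i) (invE≗reflect-long i) Den-C≈ (+ 1)
                     (≡.sym (≡.trans (≡.cong (unit i (+ 1) +ᵉ_) (*ᵉ-identityˡ (unit i -[1+ 1 ]))) (unit-+ᵉ i (+ 1) -[1+ 1 ])))

      QC-factor : ∀ k → k ≢ i → act (invE i) (var k ⊖ ivar k) ~ var k ⊖ ivar k
      QC-factor k k≢i = L.trans (act-⊖ (invE i) (var k) (ivar k)) (L.reflexive (≡.cong₂ _⊖_ (act-xρ-≢ (+ 1) k≢i) (act-xρ-≢ -[1+ 0 ] k≢i)))

      W′-C : LPoly n
      W′-C = xρ ρC ⊛ (∏ (without i (λ k → var k ⊖ ivar k)) ⊛ Δpairs)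

      x⁻¹W′-C-invariant : act (invE i) (ivar i ⊛ W′-C) ~ ivar i ⊛ W′-C
      x⁻¹W′-C-invariant = W′-invariant ρC (λ k → var k ⊖ ivar k) (unit i -[1+ 0 ])
        (invE-fixes (≡.trans (lookup-+ᵉ (unit i -[1+ 0 ]) ρC i) (≡.cong₂ ℤ._+_ (lookup-unit-≡ i -[1+ 0 ]) (ρC-last last)))) QC-factor

      C-operator : (Φ : Exp n → Carrier) → (∀ e → Φ (invE i e) ≈ Φ e) → DividedDifference
      C-operator Φ Φ-inv = record
        { σ = invE i ; σ-isLinearInvolution = σ-inv
        ; X = var i ; Y = ivar i ; Den = Den-C ; W′ = W′-C ; ε = 1L ; ε⁻¹ = 1L ; Φ = Φ
        ; ε⁻¹⊛ε = L.*-identityˡ 1L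
        ; Den-σ = Den-C-σ
        ; X-σ = L.trans (L.reflexive act-var-i) (L.sym (L.*-identityˡ (ivar i)))
        ; Y-σ = L.trans (L.reflexive act-ivar-i) (L.sym (L.*-identityˡ (var i)))
        ; Den≈X-Y = L.refl
        ; Den-cancel = cancel-xʷ[1-xᵈ] long-root-i Den-C≈
        ; Y-twisted-symmetric = twisted-symmetric σ-inv Φ-inv (ivar i) W′-C x⁻¹W′-C-invariant
        ; quotient = C-quotient
        }

      C-presentation : ∀ β → Presentation C β i
      C-presentation β = record
        { operator   = C-operator (indicator zeroE) (indicator-zeroE-invariant σ-inv)
        ; IsPi⇒IsπOf = λ f h → ≋⇒~ ∘ ≡.subst (λ A → A) (IsPi-C-last β last f h)
        ; IsπOf⇒IsPi = λ f h → ≡.subst (λ A → A) (≡.sym (IsPi-C-last β last f h)) ∘ ~⇒≋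
        ; sp≈⟨⟩      = λ f g → trans (CT≈⟦⟧ ((f ⊛ g) ⊛ WC)) (at (⊛-congˡ (f ⊛ g) (weight-factor ρC (λ k → var k ⊖ ivar k))) _)
        }

      Den-B : LPoly n
      Den-B = var i ⊖ 1L

      Den-B≈ : Den-B ~ xρ (unit i (+ 1)) ⊛ (1L ⊖ xρ (unit i -[1+ 0 ]))
      Den-B≈ = L.sym (L.trans (xρ-⊛-1-xρ (unit i (+ 1)) (unit i -[1+ 0 ]))
                 (L.reflexive (≡.cong (λ e → var i ⊖ xρ e) (≡.trans (unit-+ᵉ i (+ 1) -[1+ 0 ]) (unit-zero i)))))

      ivar⊛var : ivar i ⊛ var i ~ 1L
      ivar⊛var = L.trans (L.*-comm (ivar i) (var i)) (var-⊛-ivar i)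

      QB-factor : ∀ k → k ≢ i → act (invE i) (var k ⊖ 1L) ~ var k ⊖ 1L
      QB-factor k k≢i = L.trans (act-⊖ (invE i) (var k) 1L) (L.reflexive (≡.cong₂ _⊖_ (act-xρ-≢ (+ 1) k≢i) (act-const σ-inv 1#)))

      W′-B : LPoly n
      W′-B = xρ ρD ⊛ (∏ (without i (λ k → var k ⊖ 1L)) ⊛ Δpairs)

      B-operator : DividedDifference
      B-operator = record
        { σ = invE i ; σ-isLinearInvolution = σ-inv
        ; X = var i ; Y = 1L ; Den = Den-B ; W′ = W′-B ; ε = ivar i ; ε⁻¹ = var i ; Φ = indicator zeroE
        ; ε⁻¹⊛ε = var-⊛-ivar i
        ; Den-σ = begin
            act (invE i) (var i ⊖ 1L)              ≈⟨ act-⊖ (invE i) (var i) 1L ⟩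
            act (invE i) (var i) ⊖ act (invE i) 1L ≡⟨ ≡.cong₂ _⊖_ act-var-i (act-const σ-inv 1#) ⟩
            ivar i ⊖ 1L                            ≈⟨ Lᴾ.⁻¹-anti-homo‿- 1L (ivar i) ⟨
            neg (1L ⊖ ivar i)                      ≈⟨ neg-cong (⊕-cong ivar⊛var (neg-cong (L.*-identityʳ (ivar i)))) ⟨
            neg (ivar i ⊛ var i ⊖ ivar i ⊛ 1L)     ≈⟨ neg-cong (Lᴾ.x[y-z]≈xy-xz (ivar i) (var i) 1L) ⟨
            neg (ivar i ⊛ (var i ⊖ 1L))     ∎
        ; X-σ = L.trans (L.reflexive act-var-i) (L.sym (L.*-identityʳ (ivar i)))
        ; Y-σ = L.trans (L.reflexive (act-const σ-inv 1#)) (L.sym ivar⊛var)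
        ; Den≈X-Y = L.refl
        ; Den-cancel = cancel-xʷ[1-xᵈ] (lookup-unit-≡ i -[1+ 0 ]) Den-B≈
        ; Y-twisted-symmetric = twisted-symmetric σ-inv (indicator-zeroE-invariant σ-inv) 1L W′-B
            (W′-invariant ρD (λ k → var k ⊖ 1L) zeroE (invE-fixes (≡.trans (lookup-+ᵉ zeroE ρD i) (≡.cong₂ ℤ._+_ (lookup-zeroE i) (ρD-last last)))) QB-factor)
        ; quotient = reflection-quotient (shortReflection i) (invE≗reflect-short i) Den-B≈ (+ 1)
            (≡.sym (≡.trans (≡.cong (unit i (+ 1) +ᵉ_) (*ᵉ-identityˡ (unit i -[1+ 0 ]))) (≡.trans (unit-+ᵉ i (+ 1) -[1+ 0 ]) (unit-zero i))))
        }
        where open ~-Reasoning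

      B-presentation : ∀ β → Presentation B β i
      B-presentation β = record
        { operator   = B-operator
        ; IsPi⇒IsπOf = λ f h → (λ h≈ → L.trans h≈ (⊕-congˡ (var i ⊛ f) (neg-cong (L.sym (L.*-identityˡ (act (invE i) f))))))
                                ∘ ≋⇒~ ∘ ≡.subst (λ A → A) (IsPi-B-last β last f h)
        ; IsπOf⇒IsPi = λ f h h≈ → ≡.subst (λ A → A) (≡.sym (IsPi-B-last β last f h))
                                    (~⇒≋ (L.trans h≈ (⊕-congˡ (var i ⊛ f) (neg-cong (L.*-identityˡ (act (invE i) f))))))
        ; sp≈⟨⟩      = λ f g → trans (CT≈⟦⟧ ((f ⊛ g) ⊛ WB)) (at (⊛-congˡ (f ⊛ g) (weight-factor ρD (λ k → var k ⊖ 1L))) _)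
        }

      module _ (β : Carrier) where
        open BCWeight n β

        X-BC Y-BC U : LPoly n
        X-BC = var i ⊕ const β
        Y-BC = ivar i ⊕ const β
        U    = 1L ⊕ const β ⊛ var i

        Y-BC≈ : Y-BC ~ ivar i ⊛ U
        Y-BC≈ = L.sym (begin
          ivar i ⊛ (1L ⊕ const β ⊛ var i)                          ≈⟨ L.distribˡ (ivar i) 1L (const β ⊛ var i) ⟩
          ivar i ⊛ 1L ⊕ ivar i ⊛ (const β ⊛ var i)                 ≈⟨ ⊕-cong (L.*-identityʳ (ivar i)) (L.trans (L*.x∙yz≈y∙xz (ivar i) (const β) (var i))
                                                                (L.trans (⊛-congˡ (const β) ivar⊛var) (L.*-identityʳ (const β)))) ⟩
          ivar i ⊕ const β                                ∎)
          where open ~-Reasoning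

        numerator-BC : ∀ f → numerator X-BC Y-BC (invE i) f ~ numerator (var i) (ivar i) (invE i) f ⊕ const β ⊛ numerator 1L 1L (invE i) f
        numerator-BC f = begin
          X-BC ⊛ f ⊖ Y-BC ⊛ σf                                     ≈⟨ ⊕-cong (L.distribʳ f (var i) (const β)) (neg-cong (L.distribʳ σf (ivar i) (const β))) ⟩
          (var i ⊛ f ⊕ const β ⊛ f) ⊖ (ivar i ⊛ σf ⊕ const β ⊛ σf) ≈⟨ ⊖-interchange (var i ⊛ f) (const β ⊛ f) (ivar i ⊛ σf) (const β ⊛ σf) ⟩
          (var i ⊛ f ⊖ ivar i ⊛ σf) ⊕ (const β ⊛ f ⊖ const β ⊛ σf) ≈⟨ ⊕-congˡ (var i ⊛ f ⊖ ivar i ⊛ σf) (Lᴾ.x[y-z]≈xy-xz (const β) f σf) ⟨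
          (var i ⊛ f ⊖ ivar i ⊛ σf) ⊕ const β ⊛ (f ⊖ σf)           ≈⟨ ⊕-congˡ (var i ⊛ f ⊖ ivar i ⊛ σf) (⊛-congˡ (const β) (⊕-cong (L.*-identityˡ f) (neg-cong (L.*-identityˡ σf)))) ⟨
          (var i ⊛ f ⊖ ivar i ⊛ σf) ⊕ const β ⊛ (1L ⊛ f ⊖ 1L ⊛ σf)          ∎
          where
          open ~-Reasoning
          σf = act (invE i) f

        BC-quotient : ∀ f → Σ[ h ∈ LPoly n ] h ⊛ Den-C ~ numerator X-BC Y-BC (invE i) f
        BC-quotient f =
          let h₁ , h₁-ok = C-quotient f
              h₂ , h₂-ok = reflection-quotient (longReflection i) (invE≗reflect-long i) Den-C≈ {zeroE} {zeroE} (+ 0)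
                             (≡.sym (≡.trans (≡.cong (zeroE +ᵉ_) (*ᵉ-zeroˡ (unit i -[1+ 1 ]))) (+ᵉ-identityˡ zeroE))) f
          in h₁ ⊕ const β ⊛ h₂ ,
             L.trans (L.distribʳ Den-C h₁ (const β ⊛ h₂))
               (L.trans (⊕-cong h₁-ok (L.trans (L.*-assoc (const β) h₂ Den-C) (⊛-congˡ (const β) h₂-ok))) (L.sym (numerator-BC f)))

        BC-twisted-symmetric : ∀ a b → ⟦ ((Y-BC ⊛ act (invE i) a) ⊛ b) ⊛ W′-C ⟧ βweight ≈ ⟦ ((Y-BC ⊛ a) ⊛ act (invE i) b) ⊛ W′-C ⟧ βweight
        BC-twisted-symmetric a b = begin
          ⟦ ((Y-BC ⊛ act (invE i) a) ⊛ b) ⊛ W′-C ⟧ βweight             ≈⟨ untwist (act (invE i) a) b ⟩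
          ⟦ ((ivar i ⊛ act (invE i) a) ⊛ b) ⊛ W′-C ⟧ (twistedWeight i) ≈⟨ twisted-symmetric σ-inv (twistedWeight-invE i) (ivar i) W′-C x⁻¹W′-C-invariant a b ⟩
          ⟦ ((ivar i ⊛ a) ⊛ act (invE i) b) ⊛ W′-C ⟧ (twistedWeight i) ≈⟨ untwist a (act (invE i) b) ⟨
          ⟦ ((Y-BC ⊛ a) ⊛ act (invE i) b) ⊛ W′-C ⟧ βweight              ∎
          where
          open ≈-Reasoning
          untwist : ∀ p q → ⟦ ((Y-BC ⊛ p) ⊛ q) ⊛ W′-C ⟧ βweight ≈ ⟦ ((ivar i ⊛ p) ⊛ q) ⊛ W′-C ⟧ (twistedWeight i)
          untwist p q = trans (at (L.trans (⊛-congʳ W′-C (⊛-congʳ q (L.trans (⊛-congʳ p Y-BC≈) (L*.xy∙z≈xz∙y (ivar i) U p))))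
                                   (L.trans (⊛-congʳ W′-C (L*.xy∙z≈xz∙y ((ivar i) ⊛ p) U q)) (L*.xy∙z≈xz∙y (((ivar i) ⊛ p) ⊛ q) U W′-C))) βweight)
                              (⟦⟧-⊛[1+βx] i (((ivar i ⊛ p) ⊛ q) ⊛ W′-C))

        BC-operator : DividedDifference
        BC-operator = record
          { σ = invE i ; σ-isLinearInvolution = σ-inv
          ; X = X-BC ; Y = Y-BC ; Den = Den-C ; W′ = W′-C ; ε = 1L ; ε⁻¹ = 1L ; Φ = βweight
          ; ε⁻¹⊛ε = L.*-identityˡ 1L
          ; Den-σ = Den-C-σ
          ; X-σ = L.trans (act-⊕ (invE i) (var i) (const β)) (L.trans (L.reflexive (≡.cong₂ _⊕_ act-var-i (act-const σ-inv β))) (L.sym (L.*-identityˡ Y-BC)))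
          ; Y-σ = L.trans (act-⊕ (invE i) (ivar i) (const β)) (L.trans (L.reflexive (≡.cong₂ _⊕_ act-ivar-i (act-const σ-inv β))) (L.sym (L.*-identityˡ X-BC)))
          ; Den≈X-Y = L.sym (L.trans (⊖-interchange (var i) (const β) (ivar i) (const β)) (L.trans (⊕-congˡ Den-C (L.-‿inverseʳ (const β))) (L.+-identityʳ Den-C)))
          ; Den-cancel = cancel-xʷ[1-xᵈ] long-root-i Den-C≈
          ; Y-twisted-symmetric = BC-twisted-symmetric
          ; quotient = BC-quotient
          }

        BC-presentation : Presentation BC β i
        BC-presentation = record
          { operator   = BC-operator
          ; IsPi⇒IsπOf = λ f h → ≋⇒~ ∘ ≡.subst (λ A → A) (IsPi-BC-last β last f h)
          ; IsπOf⇒IsPi = λ f h → ≡.subst (λ A → A) (≡.sym (IsPi-BC-last β last f h)) ∘ ~⇒≋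
          ; sp≈⟨⟩      = λ f g → trans (CTβ≈⟦⟧ ((f ⊛ g) ⊛ WC)) (at (⊛-congˡ (f ⊛ g) (weight-factor ρC (λ k → var k ⊖ ivar k))) _)
          }

    module LastIndexD {p i : Fin n} (last : nextFin i ≡ nothing) (i←p : prevFin i ≡ just p) where

      p→i : nextFin p ≡ just i
      p→i = toℕ⇒nextFin (prevFin⇒toℕ i←p)

      open AdjacentTransposition p→i using (Δ′; Δ≈ΔFactor⊛Δ′; Δ′-swap; Δ′-invE) renaming (i≢j to p≢i)
      open Reflection (τReflection p≢i) using (root; reflect-fixes; reflect-root)

      τ-inv : IsLinearInvolution (tauE p i)
      τ-inv = tauE-isLinearInvolution p≢i

      Y Den W′ : LPoly n
      Y   = xρ root
      Den = 1L ⊖ Y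
      W′  = xρ ρD ⊛ ((var p ⊖ var i) ⊛ Δ′)

      ivar⊛ivar≈Y : ivar p ⊛ ivar i ~ Y
      ivar⊛ivar≈Y = xρ-⊛ (unit p -[1+ 0 ]) (unit i -[1+ 0 ])

      weight-factor : xρ ρD ⊛ Δpairs ~ Den ⊛ W′
      weight-factor = begin
        xρ ρD ⊛ Δpairs                                            ≈⟨ ⊛-congˡ (xρ ρD) Δ≈ΔFactor⊛Δ′ ⟩
        xρ ρD ⊛ (((var p ⊖ var i) ⊛ (1L ⊖ ivar p ⊛ ivar i)) ⊛ Δ′) ≈⟨ ⊛-congˡ (xρ ρD) (⊛-congʳ Δ′ (⊛-congˡ (var p ⊖ var i) (⊕-congˡ 1L (neg-cong ivar⊛ivar≈Y)))) ⟩
        xρ ρD ⊛ (((var p ⊖ var i) ⊛ Den) ⊛ Δ′)                    ≈⟨ ⊛-congˡ (xρ ρD) (L*.xy∙z≈y∙xz (var p ⊖ var i) Den Δ′) ⟩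
        xρ ρD ⊛ (Den ⊛ ((var p ⊖ var i) ⊛ Δ′))                    ≈⟨ L*.x∙yz≈y∙xz (xρ ρD) Den ((var p ⊖ var i) ⊛ Δ′) ⟩
        Den ⊛ W′                                                    ∎
        where open ~-Reasoning

      Δ′-τ : act (tauE p i) Δ′ ~ Δ′
      Δ′-τ = begin
        act (tauE p i) Δ′                                ≈⟨ act-ext (tauE≗swapE∘invE∘invE p≢i) Δ′ ⟩
        act (swapE p i ∘ invE p ∘ invE i) Δ′             ≈⟨ L.trans (L.sym (act-∘ (swapE p i) (invE p ∘ invE i) Δ′)) (act-cong (swapE p i) (L.sym (act-∘ (invE p) (invE i) Δ′))) ⟩
        act (swapE p i) (act (invE p) (act (invE i) Δ′)) ≈⟨ act-cong (swapE p i) (L.trans (act-cong (invE p) (Δ′-invE i)) (Δ′-invE p)) ⟩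
        act (swapE p i) Δ′                               ≈⟨ Δ′-swap ⟩
        Δ′                                                  ∎
        where open ~-Reasoning

      YW′≈ : Y ⊛ W′ ~ (xρ ((root +ᵉ ρD) +ᵉ unit p (+ 1)) ⊖ xρ ((root +ᵉ ρD) +ᵉ unit i (+ 1))) ⊛ Δ′
      YW′≈ = begin
        Y ⊛ (xρ ρD ⊛ ((var p ⊖ var i) ⊛ Δ′))     ≈⟨ L.sym (L.*-assoc Y (xρ ρD) _) ⟩
        (Y ⊛ xρ ρD) ⊛ ((var p ⊖ var i) ⊛ Δ′)     ≈⟨ ⊛-congʳ _ (xρ-⊛ root ρD) ⟩
        xρ (root +ᵉ ρD) ⊛ ((var p ⊖ var i) ⊛ Δ′) ≈⟨ L.sym (L.*-assoc (xρ (root +ᵉ ρD)) (var p ⊖ var i) Δ′) ⟩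
        (xρ (root +ᵉ ρD) ⊛ (var p ⊖ var i)) ⊛ Δ′ ≈⟨ ⊛-congʳ Δ′ (L.trans (Lᴾ.x[y-z]≈xy-xz (xρ (root +ᵉ ρD)) (var p) (var i))
                                                            (⊕-cong (xρ-⊛ (root +ᵉ ρD) (unit p (+ 1))) (neg-cong (xρ-⊛ (root +ᵉ ρD) (unit i (+ 1)))))) ⟩
        (xρ ((root +ᵉ ρD) +ᵉ unit p (+ 1)) ⊖ xρ ((root +ᵉ ρD) +ᵉ unit i (+ 1))) ⊛ Δ′ ∎
        where open ~-Reasoning

      root-p : lookup root p ≡ -[1+ 0 ]
      root-p = ≡.trans (lookup-unit+unit -[1+ 0 ] -[1+ 0 ] p) (≡.cong₂ ℤ._+_ (lookup-unit-≡ p -[1+ 0 ]) (lookup-unit-≢ -[1+ 0 ] p≢i))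

      root-i : lookup root i ≡ -[1+ 0 ]
      root-i = ≡.trans (lookup-unit+unit -[1+ 0 ] -[1+ 0 ] i) (≡.cong₂ ℤ._+_ (lookup-unit-≢ -[1+ 0 ] (p≢i ∘ ≡.sym)) (lookup-unit-≡ i -[1+ 0 ]))

      -- both monomials of x^root x^{ρ^D} (x_p - x_i) are τ-invariant, as ρ^D_p = 1 and ρ^D_i = 0
      τ-fixes-shift : ∀ k a b → lookup (unit k (+ 1)) p ≡ a → lookup (unit k (+ 1)) i ≡ b → a ℤ.+ b ≡ + 1 →
                      tauE p i ((root +ᵉ ρD) +ᵉ unit k (+ 1)) ≡ (root +ᵉ ρD) +ᵉ unit k (+ 1)
      τ-fixes-shift k a b kₚ kᵢ a+b≡1 = ≡.trans (tauE≗reflect p≢i _) (reflect-fixes (begin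
        + 1 ℤ.* lookup v p ℤ.+ + 1 ℤ.* lookup v i                                 ≡⟨ ≡.cong₂ (λ x y → + 1 ℤ.* x ℤ.+ + 1 ℤ.* y) (lookup-v p root-p (ρD-second-last last i←p) kₚ) (lookup-v i root-i (ρD-last last) kᵢ) ⟩
        + 1 ℤ.* ((-[1+ 0 ] ℤ.+ + 1) ℤ.+ a) ℤ.+ + 1 ℤ.* ((-[1+ 0 ] ℤ.+ + 0) ℤ.+ b) ≡⟨ balanced a b ⟩
        (a ℤ.+ b) ℤ.+ -[1+ 0 ]                                                    ≡⟨ ≡.cong (ℤ._+ -[1+ 0 ]) a+b≡1 ⟩
        + 0                                                                           ∎))
        where
        open ≡.≡-Reasoning
        v = (root +ᵉ ρD) +ᵉ unit k (+ 1)
        lookup-v : ∀ m {r s t} → lookup root m ≡ r → lookup ρD m ≡ s → lookup (unit k (+ 1)) m ≡ t → lookup v m ≡ (r ℤ.+ s) ℤ.+ t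
        lookup-v m r≡ s≡ t≡ = ≡.trans (lookup-+ᵉ (root +ᵉ ρD) (unit k (+ 1)) m) (≡.cong₂ ℤ._+_ (≡.trans (lookup-+ᵉ root ρD m) (≡.cong₂ ℤ._+_ r≡ s≡)) t≡)
        balanced : ∀ a b → + 1 ℤ.* ((-[1+ 0 ] ℤ.+ + 1) ℤ.+ a) ℤ.+ + 1 ℤ.* ((-[1+ 0 ] ℤ.+ + 0) ℤ.+ b) ≡ (a ℤ.+ b) ℤ.+ -[1+ 0 ]
        balanced = solve-∀

      YW′-τ : act (tauE p i) (Y ⊛ W′) ~ Y ⊛ W′
      YW′-τ = begin
        act (tauE p i) (Y ⊛ W′)                                                   ≈⟨ act-cong (tauE p i) YW′≈ ⟩
        act (tauE p i) ((xρ k₁ ⊖ xρ k₂) ⊛ Δ′)                                     ≈⟨ act-⊛ τ-inv (xρ k₁ ⊖ xρ k₂) Δ′ ⟩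
        act (tauE p i) (xρ k₁ ⊖ xρ k₂) ⊛ act (tauE p i) Δ′                        ≈⟨ ⊛-cong (L.trans (act-⊖ (tauE p i) (xρ k₁) (xρ k₂)) (L.reflexive (≡.cong₂ (λ a b → xρ a ⊖ xρ b)
                                                                              (τ-fixes-shift p (+ 1) (+ 0) (lookup-unit-≡ p (+ 1)) (lookup-unit-≢ (+ 1) (p≢i ∘ ≡.sym)) refl)
                                                                              (τ-fixes-shift i (+ 0) (+ 1) (lookup-unit-≢ (+ 1) p≢i) (lookup-unit-≡ i (+ 1)) refl)))) Δ′-τ ⟩
        (xρ k₁ ⊖ xρ k₂) ⊛ Δ′                                                      ≈⟨ YW′≈ ⟨
        Y ⊛ W′                                                          ∎
        where
        open ~-Reasoning
        k₁ = (root +ᵉ ρD) +ᵉ unit p (+ 1)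
        k₂ = (root +ᵉ ρD) +ᵉ unit i (+ 1)

      Den≈ : Den ~ xρ zeroE ⊛ (1L ⊖ xρ root)
      Den≈ = L.sym (L.*-identityˡ Den)

      ε : LPoly n
      ε = xρ (-ᵉ root)

      Yε≈1 : Y ⊛ ε ~ 1L
      Yε≈1 = L.trans (xρ-⊛ root (-ᵉ root)) (L.reflexive (≡.cong xρ (+ᵉ-inverseʳ root)))

      act-Y : act (tauE p i) Y ≡ ε
      act-Y = ≡.cong xρ (≡.trans (tauE≗reflect p≢i root) reflect-root)

      D-operator : DividedDifference
      D-operator = record
        { σ = tauE p i ; σ-isLinearInvolution = τ-inv
        ; X = 1L ; Y = Y ; Den = Den ; W′ = W′ ; ε = ε ; ε⁻¹ = Y ; Φ = indicator zeroE
        ; ε⁻¹⊛ε = Yε≈1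
        ; Den-σ = begin
            act (tauE p i) (1L ⊖ Y)              ≈⟨ act-⊖ (tauE p i) 1L Y ⟩
            act (tauE p i) 1L ⊖ act (tauE p i) Y ≡⟨ ≡.cong₂ _⊖_ (act-const τ-inv 1#) act-Y ⟩
            1L ⊖ ε                               ≈⟨ Lᴾ.⁻¹-anti-homo‿- ε 1L ⟨
            neg (ε ⊖ 1L)                         ≈⟨ neg-cong (⊕-cong (L.*-identityʳ ε) (neg-cong (L.trans (L.*-comm ε Y) Yε≈1))) ⟨
            neg (ε ⊛ 1L ⊖ ε ⊛ Y)                 ≈⟨ neg-cong (Lᴾ.x[y-z]≈xy-xz ε 1L Y) ⟨
            neg (ε ⊛ (1L ⊖ Y))                   ∎
        ; X-σ = L.trans (L.reflexive (act-const τ-inv 1#)) (L.sym (L.trans (L.*-comm ε Y) Yε≈1))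
        ; Y-σ = L.trans (L.reflexive act-Y) (L.sym (L.*-identityʳ ε))
        ; Den≈X-Y = L.refl
        ; Den-cancel = cancel-xʷ[1-xᵈ] root-i Den≈
        ; Y-twisted-symmetric = twisted-symmetric τ-inv (indicator-zeroE-invariant τ-inv) Y W′ YW′-τ
        ; quotient = reflection-quotient (τReflection p≢i) (tauE≗reflect p≢i) Den≈ {zeroE} {root} (+ 1)
                       (≡.sym (≡.trans (+ᵉ-identityˡ (+ 1 *ᵉ root)) (*ᵉ-identityˡ root)))
        }
        where open ~-Reasoning

      numerator≈ : ∀ f → f ⊖ (ivar p ⊛ ivar i) ⊛ act (tauE p i) f ~ numerator 1L Y (tauE p i) f
      numerator≈ f = ⊕-cong (L.sym (L.*-identityˡ f)) (neg-cong (⊛-congʳ (act (tauE p i) f) ivar⊛ivar≈Y))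

      Den′≈Den : 1L ⊖ ivar p ⊛ ivar i ~ Den
      Den′≈Den = ⊕-congˡ 1L (neg-cong ivar⊛ivar≈Y)

      D-presentation : ∀ β → Presentation D β i
      D-presentation β = record
        { operator   = D-operator
        ; IsPi⇒IsπOf = λ f h h=fπ → L.trans (⊛-congˡ h (L.sym Den′≈Den))
                                      (L.trans (≋⇒~ (≡.subst (λ A → A) (IsPi-D-last β last i←p f h) h=fπ)) (numerator≈ f))
        ; IsπOf⇒IsPi = λ f h h=fπ → ≡.subst (λ A → A) (≡.sym (IsPi-D-last β last i←p f h))
                                      (~⇒≋ (L.trans (⊛-congˡ h Den′≈Den) (L.trans h=fπ (L.sym (numerator≈ f)))))
        ; sp≈⟨⟩      = λ f g → trans (CT≈⟦⟧ ((f ⊛ g) ⊛ WD)) (at (⊛-congˡ (f ⊛ g) weight-factor) _)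
        }

    presentation : ∀ t β (i : Fin n) → Presentation t β i ⊎ (∀ f h → ¬ IsPi t β i f h)
    presentation t β i = by-position (nextFin i) refl
      where
      last-index : nextFin i ≡ nothing → ∀ t → Presentation t β i ⊎ (∀ f h → ¬ IsPi t β i f h)
      last-index last B  = inj₁ (LastIndex.B-presentation last β)
      last-index last C  = inj₁ (LastIndex.C-presentation last β)
      last-index last BC = inj₁ (LastIndex.BC-presentation last β)
      last-index last D  = by-predecessor (prevFin i) refl
        where
        by-predecessor : ∀ m → prevFin i ≡ m → Presentation D β i ⊎ (∀ f h → ¬ IsPi D β i f h)
        by-predecessor (just p) i←p = inj₁ (LastIndexD.D-presentation last i←p β)
        by-predecessor nothing  i←  = inj₂ (IsPi-D-1 β last i←)
      by-position : ∀ m → nextFin i ≡ m → Presentation t β i ⊎ (∀ f h → ¬ IsPi t β i f h)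
      by-position (just j) i→j  = inj₁ (adjacentPresentation i→j t β)
      by-position nothing  last = last-index last t

lemma13 : ∀ {c ℓ v} (R : CommutativeRing c ℓ) → let open Laurent R in
    (t : Type) (β : Carrier) (n : ℕ) (i : Fin n) →
    (∀ (f₁ g₁ f₂ g₂ : LPoly n) →
      IsPi t β i f₁ f₂ → IsPiHat t β i g₁ g₂ →
      sp t β f₁ g₁ ≈ 0# → sp t β f₂ g₁ ≈ 1# →
      (sp t β f₁ g₂ ≈ 1#) × (sp t β f₂ g₂ ≈ 0#))
    ×
    (∀ (V : LPoly n → Set v) (g₁ g₂ : LPoly n) →
      IsLinearSpace V →
      (∀ f h → V f → IsPi t β i f h → V h) →
      (∀ f → V f → sp t β f g₁ ≈ 0#) →
      IsPiHat t β i g₁ g₂ →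
      ∀ f → V f → sp t β f g₂ ≈ 0#)
lemma13 R t β n i with presentation R t β i
... | inj₁ P  = sp-dual-pair R P , λ V g₁ g₂ _ → sp-orthogonal R P V g₁ g₂
... | inj₂ ¬π = (λ f₁ g₁ f₂ g₂ f₂=f₁π → ⊥-elim (¬π f₁ f₂ f₂=f₁π))
              , (λ V g₁ g₂ _ _ _ g₂=g₁π̂ → ⊥-elim (¬π g₁ _ g₂=g₁π̂))
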